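{- Let $G$ be a double wheel with principal path $\overrightarrow{v_kv_1v_2}$ and components $G_1,G_2$, neither of which is an even wheel, where $v_3,\dots,v_{k-1}$ are the remaining vertices on the outer cycle of $G$ and $u_1,\dots,u_m$ are the vertices of $G$ not on the outer cycle. Then every monomial $v_1^0v_2^0v_k^0\prod_{i=3}^{k-1}v_i^{\alpha_i}\prod_{j=1}^m u_j^{\beta_j}$ with $\alpha_i\le2$ and $\beta_j\le4$ vanishes in $P(G-\overrightarrow{v_kv_1v_2})$.
   Context: For a graph $G$, vertices are also variables and $P(G)=\prod_{uv\in E(G),\,u<v}(u-v)$ for a fixed arbitrary orientation; a monomial vanishes if its coefficient is zero. $G-\overrightarrow{v_kv_1v_2}$ is $G$ with edges $v_kv_1,v_1v_2$ deleted (vertices kept). An ordinary wheel consists of a cycle $v_1\dots v_kv_1$ ($k\ge3$) and a vertex adjacent to all $v_i$; it is even if $k$ is even. A broken wheel consists of a path $v_2\dots v_k$ ($k\ge3$) and a vertex $v_1$ adjacent to all of $v_2,\dots,v_k$. For both, $\overrightarrow{v_kv_1v_2}$ is the principal path, $v_kv_1,v_1v_2$ the principal edges, $v_1,v_2,v_k$ the principal vertices. A double wheel is obtained from two graphs $G_1,G_2$ (its components), each an ordinary or broken wheel, at least one of them ordinary, by identifying their vertices $v_1$ and identifying a principal edge of $G_1$ with a principal edge of $G_2$ (the two pieces on opposite sides of the identified edge in the plane); in the result the common vertex is $v_1$, the two non-identified principal vertices are $v_2,v_k$, and $\overrightarrow{v_kv_1v_2}$ is the principal path. -}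

module Defs where

open import Data.Bool using (Bool; true; false; if_then_else_; not; _∧_; _∨_)
open import Data.Nat using (ℕ; zero; suc; _+_; _∸_; _≤_; _<_; _<?_; _≡ᵇ_)
open import Data.Nat.Divisibility using (_∣_)
open import Data.Integer as ℤ using (ℤ; -_)
open import Data.Fin using (Fin; fromℕ<; toℕ)
open import Data.Vec using (Vec; replicate; updateAt)
open import Data.Vec.Properties using (≡-dec)
open import Data.List using (List; []; _∷_; _++_; map; filter; concatMap; length; foldr)
open import Data.Product using (_×_; _,_; proj₁; proj₂)
open import Data.Unit using (⊤)
open import Relation.Nullary using (¬_; yes; no)
open import Relation.Binary.PropositionalEquality using (_≡_; refl)
import Data.Nat.Properties as ℕP

-- The coefficient of a monomial in a
-- polynomial is the sum of the coefficients of all terms with exactly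
-- that exponent vector (i.e. the coefficient after collecting terms).

Monomial : ℕ → Set
Monomial n = Vec ℕ n

Poly : ℕ → Set
Poly n = List (ℤ × Monomial n)

onePoly : ∀ {n} → Poly n
onePoly = (ℤ.1ℤ , replicate _ 0) ∷ []

mulVar : ∀ {n} → Fin n → Poly n → Poly n
mulVar a = map (λ t → proj₁ t , updateAt (proj₂ t) a suc)

negPoly : ∀ {n} → Poly n → Poly n
negPoly = map (λ t → - proj₁ t , proj₂ t)

mulEdge : ∀ {n} → Fin n × Fin n → Poly n → Poly n
mulEdge (a , b) p = mulVar a p ++ negPoly (mulVar b p)

coeff : ∀ {n} → Monomial n → Poly n → ℤ
coeff m [] = ℤ.0ℤ
coeff m ((c , m') ∷ p) with ≡-dec ℕP._≟_ m' m
... | yes _ = c ℤ.+ coeff m p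
... | no  _ = coeff m p

record Graph : Set where
  field
    V : ℕ
    E : List (Fin V × Fin V)
open Graph public

-- Orientation: σ i = true means the i-th edge (a , b) contributes
-- (x_a - x_b), false means (x_b - x_a).  Quantifying over σ covers every
-- fixed orientation of the edges.
orientedProd : ∀ {n} → (ℕ → Bool) → ℕ → List (Fin n × Fin n) → Poly n
orientedProd σ i [] = onePoly
orientedProd σ i ((a , b) ∷ es) =
  mulEdge (if σ i then (a , b) else (b , a)) (orientedProd σ (suc i) es)

P : (G : Graph) → (ℕ → Bool) → Poly (V G)
P G σ = orientedProd σ 0 (E G)

Vanishes : ∀ {n} → Monomial n → Poly n → Set
Vanishes m p = coeff m p ≡ ℤ.0ℤ

range : ℕ → ℕ → List ℕ
range a zero = []
range a (suc c) = a ∷ range (suc a) c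

sameEdge : ℕ × ℕ → ℕ × ℕ → Bool
sameEdge (a , b) (c , d) = ((a ≡ᵇ c) ∧ (b ≡ᵇ d)) ∨ ((a ≡ᵇ d) ∧ (b ≡ᵇ c))

deleteEdge : ℕ × ℕ → List (ℕ × ℕ) → List (ℕ × ℕ)
deleteEdge e = filter (λ e' → Data.Bool.T? (not (sameEdge e e')))
  where import Data.Bool

-- convert ℕ-labelled edges to Fin N-labelled ones (all labels used
-- below are < N; see the sanity checks at the end of this file)
toFinEdges : (N : ℕ) → List (ℕ × ℕ) → List (Fin N × Fin N)
toFinEdges N [] = []
toFinEdges N ((a , b) ∷ es) with a <? N | b <? N
... | yes a< | yes b< = (fromℕ< a< , fromℕ< b<) ∷ toFinEdges N es
... | _      | _      = toFinEdges N es

-- Wheels.  A component is an ordinary wheel (cycle v₁…v_k v₁ plus a hub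
-- adjacent to all v_i) or a broken wheel (path v₂…v_k plus v₁ adjacent
-- to all of v₂,…,v_k).

data Kind : Set where
  ordinary broken : Kind

NotEvenWheel : Kind → ℕ → Set
NotEvenWheel ordinary k = ¬ (2 ∣ k)
NotEvenWheel broken   k = ⊤

AtLeastOneOrdinary : Kind → Kind → Set
AtLeastOneOrdinary ordinary _ = ⊤
AtLeastOneOrdinary broken ordinary = ⊤
AtLeastOneOrdinary broken broken = Data.Empty.⊥
  where import Data.Empty

nHubs : Kind → ℕ
nHubs ordinary = 1
nHubs broken   = 0

-- edges of a wheel with parameter k, whose vertex v_j (1 ≤ j ≤ k) gets
-- global label f j and whose hub (if ordinary) gets label h
wheelEdges : Kind → (k : ℕ) → (f : ℕ → ℕ) → (h : ℕ) → List (ℕ × ℕ)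
wheelEdges ordinary k f h =
  map (λ j → f j , f (suc j)) (range 1 (k ∸ 1))
  ++ ((f k , f 1) ∷ map (λ j → h , f j) (range 1 k))
wheelEdges broken k f h =
  map (λ j → f j , f (suc j)) (range 2 (k ∸ 2))
  ++ map (λ j → f 1 , f j) (range 2 (k ∸ 1))

-- Outer cycle of G: w₁ w₂ … w_K w₁ with K = k₁ + k₂ - 2, where w_i has
-- label i-1.  G₁'s v_j ↦ w_j (1 ≤ j ≤ k₁); G₂'s v₁ ↦ w₁ and
-- G₂'s v_j ↦ w_{k₁+j-2} (2 ≤ j ≤ k₂).  Thus G₁'s principal edge v₁v_{k₁}
-- is identified with G₂'s principal edge v₁v₂ (the edge w₁w_{k₁}, kept
-- once).  The principal path of G is w_K w₁ w₂, i.e. v₁ = w₁ (label 0),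
-- v₂ = w₂ (label 1), v_k = w_K (label K-1).  Hubs: label K for G₁
-- (if ordinary), label K + nHubs t₁ for G₂ (if ordinary); these are the
-- vertices u_j not on the outer cycle.

outerLen : ℕ → ℕ → ℕ
outerLen k₁ k₂ = k₁ + k₂ ∸ 2

dwSize : Kind → ℕ → Kind → ℕ → ℕ
dwSize t₁ k₁ t₂ k₂ = outerLen k₁ k₂ + nHubs t₁ + nHubs t₂

g₁label : ℕ → ℕ
g₁label j = j ∸ 1

g₂label : ℕ → ℕ → ℕ
g₂label k₁ 1 = 0
g₂label k₁ j = k₁ + j ∸ 3

dwEdgesℕ : Kind → ℕ → Kind → ℕ → List (ℕ × ℕ)
dwEdgesℕ t₁ k₁ t₂ k₂ =
  wheelEdges t₁ k₁ g₁label K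
  ++ deleteEdge (0 , k₁ ∸ 1)
       (wheelEdges t₂ k₂ (g₂label k₁) (K + nHubs t₁))
  where K = outerLen k₁ k₂

-- G - v_k v₁ v₂ : delete the principal edges v₁v₂ and v_kv₁
dwMinusPathEdgesℕ : Kind → ℕ → Kind → ℕ → List (ℕ × ℕ)
dwMinusPathEdgesℕ t₁ k₁ t₂ k₂ =
  deleteEdge (0 , 1) (deleteEdge (0 , outerLen k₁ k₂ ∸ 1) (dwEdgesℕ t₁ k₁ t₂ k₂))

doubleWheel : Kind → ℕ → Kind → ℕ → Graph
doubleWheel t₁ k₁ t₂ k₂ = record
  { V = dwSize t₁ k₁ t₂ k₂
  ; E = toFinEdges (dwSize t₁ k₁ t₂ k₂) (dwEdgesℕ t₁ k₁ t₂ k₂) }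

doubleWheelMinusPath : Kind → ℕ → Kind → ℕ → Graph
doubleWheelMinusPath t₁ k₁ t₂ k₂ = record
  { V = dwSize t₁ k₁ t₂ k₂
  ; E = toFinEdges (dwSize t₁ k₁ t₂ k₂) (dwMinusPathEdgesℕ t₁ k₁ t₂ k₂) }

-- Exponent conditions of the monomial, for vertex with label i:
--   i ∈ {0, 1, K-1} (v₁, v₂, v_k)      : exponent 0
--   2 ≤ i < K-1 (v₃ … v_{k-1})          : exponent ≤ 2
--   i ≥ K (inner vertices u_j)          : exponent ≤ 4

ExponentBound : (K i e : ℕ) → Set
ExponentBound K i e with i <? 2 | suc i Data.Nat.≟ K | i <? K
  where import Data.Nat
... | yes _ | _     | _     = e ≡ 0
... | no _  | yes _ | _     = e ≡ 0
... | no _  | no _  | yes _ = e ≤ 2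
... | no _  | no _  | no _  = e ≤ 4

-- Sanity checks (edge counts): ordinary wheel 2k edges, broken 2k-3;
-- double wheel = sum - 1; minus the principal path: 2 fewer.

private
  c1 : length (E (doubleWheel ordinary 3 ordinary 3)) ≡ 11
  c1 = refl
  c2 : length (E (doubleWheel ordinary 5 broken 4)) ≡ 14
  c2 = refl
  c3 : length (E (doubleWheelMinusPath broken 6 ordinary 7)) ≡ 20
  c3 = refl
  c4 : length (E (doubleWheelMinusPath ordinary 3 ordinary 5)) ≡ 13
  c4 = refl
  c5 : dwEdgesℕ ordinary 3 broken 3 ≡
       (0 , 1) ∷ (1 , 2) ∷ (2 , 0) ∷ (4 , 0) ∷ (4 , 1) ∷ (4 , 2) ∷
       (2 , 3) ∷ (0 , 3) ∷ []
  c5 = refl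

{-# OPTIONS --safe #-}
-- The coefficient of m in a product of linear forms x_a - x_b satisfies
--   c_{ab ∷ L}(m) = [m_a > 0] c_L(m - e_a) - [m_b > 0] c_L(m - e_b),
-- so it is invariant under reordering the edges and, up to sign, reorienting them.
-- Since m vanishes at v₁, v₂, v_k, every remaining edge at one of these vertices
-- must contribute its other endpoint.  Once these forced edges are removed, each
-- component is a fan (a hub joined to every vertex of a path), possibly preceded
-- by a chain of path edges.  Expanding a fan whose last path vertex may not be
-- used yields the factor fanValue, which vanishes when the path has an odd number
-- of interior vertices and the exponents are at most 2, and at most 1 at the first
-- path vertex.  The parity comes from the components not being even wheels, the
-- bounds from α_i ≤ 2 and β_j ≤ 4 less what the forced edges have consumed.
module Submission where

open import Defs
open import Data.Nat as N using (ℕ; zero; suc; _≤_; _<_; s≤s; z≤n; pred; _≟_; _≡ᵇ_; _∸_; _+_; _<?_)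
import Data.Nat.Properties as NP
open import Data.Nat.Divisibility using (_∣_; divides)
open import Data.Integer as ℤ using (ℤ; 0ℤ; 1ℤ; -_; _-_)
import Data.Integer.Properties as ZP
open import Data.Integer.Solver using (module +-*-Solver)
open +-*-Solver using (solve; _:=_; _:+_; _:*_; _:-_; :-_; con)
open import Data.Fin using (Fin; toℕ; fromℕ<)
import Data.Fin.Properties as FP
open import Data.Vec using (Vec; []; _∷_; replicate; updateAt; lookup)
open import Data.Vec.Properties using (≡-dec)
open import Data.List using (List; []; _∷_; _++_; map; foldr; [_])
open import Data.List.Properties using (filter-++; ++-assoc; ++-identityʳ)
open import Data.List.Relation.Unary.All using (All; []; _∷_)
import Data.List.Relation.Unary.All as All
open import Data.List.Relation.Unary.All.Properties using (++⁺)
open import Data.List.Relation.Binary.Permutation.Propositional as Perm using (_↭_; ↭-trans; ↭-refl; ↭-reflexive)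
import Data.List.Relation.Binary.Permutation.Propositional.Properties as PP
open import Data.Maybe using (Maybe; just; nothing)
open import Data.Bool using (Bool; true; false; _∨_; not; if_then_else_)
open import Data.Bool.Properties using (not-involutive; ∨-zeroʳ)
open import Data.Product using (_×_; _,_; proj₁; proj₂; Σ)
open import Data.Sum using (_⊎_; inj₁; inj₂; [_,_]′)
open import Data.Unit using (⊤; tt)
open import Data.Empty using (⊥; ⊥-elim)
open import Relation.Nullary using (¬_; yes; no)
open import Relation.Binary.PropositionalEquality hiding ([_])

-- Exponent vectors read at a ℕ index; indices beyond the length read as 0.
at : ∀ {n} → Vec ℕ n → ℕ → ℕ
at [] _ = 0
at (x ∷ xs) zero = x
at (x ∷ xs) (suc j) = at xs j

decAt : ∀ {n} → ℕ → Vec ℕ n → Vec ℕ n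
decAt _ [] = []
decAt zero (x ∷ xs) = pred x ∷ xs
decAt (suc j) (x ∷ xs) = x ∷ decAt j xs

incAt : ∀ {n} → ℕ → Vec ℕ n → Vec ℕ n
incAt _ [] = []
incAt zero (x ∷ xs) = suc x ∷ xs
incAt (suc j) (x ∷ xs) = x ∷ incAt j xs

updateAt-suc≡incAt : ∀ {n} a (a< : a < n) (v : Vec ℕ n) → updateAt v (fromℕ< a<) suc ≡ incAt a v
updateAt-suc≡incAt zero (s≤s _) (x ∷ v) = refl
updateAt-suc≡incAt (suc a) (s≤s a<) (x ∷ v) = cong (x ∷_) (updateAt-suc≡incAt a a< v)

at-incAt : ∀ {n} a (a< : a < n) (v : Vec ℕ n) → at (incAt a v) a ≡ suc (at v a)
at-incAt zero (s≤s _) (x ∷ v) = refl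
at-incAt (suc a) (s≤s a<) (x ∷ v) = at-incAt a a< v

decAt-incAt : ∀ {n} a (v : Vec ℕ n) → decAt a (incAt a v) ≡ v
decAt-incAt a [] = refl
decAt-incAt zero (x ∷ v) = refl
decAt-incAt (suc a) (x ∷ v) = cong (x ∷_) (decAt-incAt a v)

incAt-decAt : ∀ {n} a (v : Vec ℕ n) → at v a ≢ 0 → incAt a (decAt a v) ≡ v
incAt-decAt a [] h = ⊥-elim (h refl)
incAt-decAt zero (zero ∷ v) h = ⊥-elim (h refl)
incAt-decAt zero (suc x ∷ v) h = refl
incAt-decAt (suc a) (x ∷ v) h = cong (x ∷_) (incAt-decAt a v h)

decAt-comm : ∀ {n} a c (m : Vec ℕ n) → decAt a (decAt c m) ≡ decAt c (decAt a m)
decAt-comm a c [] = refl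
decAt-comm zero zero (x ∷ m) = refl
decAt-comm zero (suc c) (x ∷ m) = refl
decAt-comm (suc a) zero (x ∷ m) = refl
decAt-comm (suc a) (suc c) (x ∷ m) = cong (x ∷_) (decAt-comm a c m)

at-decAt-other : ∀ {n} a c (m : Vec ℕ n) → a ≢ c → at (decAt a m) c ≡ at m c
at-decAt-other a c [] h = refl
at-decAt-other zero zero (x ∷ m) h = ⊥-elim (h refl)
at-decAt-other zero (suc c) (x ∷ m) h = refl
at-decAt-other (suc a) zero (x ∷ m) h = refl
at-decAt-other (suc a) (suc c) (x ∷ m) h = at-decAt-other a c m (λ e → h (cong suc e))

at-decAt-same : ∀ {n} a (m : Vec ℕ n) → at (decAt a m) a ≡ pred (at m a)
at-decAt-same a [] = refl
at-decAt-same zero (x ∷ m) = refl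
at-decAt-same (suc a) (x ∷ m) = at-decAt-same a m

whenPos : ℕ → ℤ → ℤ
whenPos zero _ = 0ℤ
whenPos (suc _) z = z

whenPos-0ℤ : ∀ x → whenPos x 0ℤ ≡ 0ℤ
whenPos-0ℤ zero = refl
whenPos-0ℤ (suc x) = refl

whenPos-zero : ∀ x z → (x ≢ 0 → z ≡ 0ℤ) → whenPos x z ≡ 0ℤ
whenPos-zero zero z h = refl
whenPos-zero (suc x) z h = h (λ ())

whenPos-comm : ∀ x y z → whenPos x (whenPos y z) ≡ whenPos y (whenPos x z)
whenPos-comm zero zero z = refl
whenPos-comm zero (suc y) z = refl
whenPos-comm (suc x) zero z = refl
whenPos-comm (suc x) (suc y) z = refl

whenPos-distrib-sub : ∀ x u v → whenPos x (u - v) ≡ whenPos x u - whenPos x v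
whenPos-distrib-sub zero u v = refl
whenPos-distrib-sub (suc x) u v = refl

whenPos-*ˡ : ∀ x s z → whenPos x (s ℤ.* z) ≡ s ℤ.* whenPos x z
whenPos-*ˡ zero s z = sym (ZP.*-zeroʳ s)
whenPos-*ˡ (suc x) s z = refl

coeff-++ : ∀ {n} (m : Monomial n) (p q : Poly n) → coeff m (p ++ q) ≡ coeff m p ℤ.+ coeff m q
coeff-++ m [] q = sym (ZP.+-identityˡ _)
coeff-++ m ((c , mq) ∷ p) q with ≡-dec NP._≟_ mq m
... | yes _ = trans (cong (ℤ._+_ c) (coeff-++ m p q)) (sym (ZP.+-assoc c _ _))
... | no _ = coeff-++ m p q

coeff-neg : ∀ {n} (m : Monomial n) (p : Poly n) → coeff m (negPoly p) ≡ - coeff m p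
coeff-neg m [] = refl
coeff-neg m ((c , mq) ∷ p) with ≡-dec NP._≟_ mq m
... | yes _ = trans (cong (ℤ._+_ (- c)) (coeff-neg m p)) (sym (ZP.neg-distrib-+ c _))
... | no _ = coeff-neg m p

mapExponents : ∀ {n} → (Monomial n → Monomial n) → Poly n → Poly n
mapExponents g = map (λ t → proj₁ t , g (proj₂ t))

coeff-mapExponents : ∀ {n} (g : Monomial n → Monomial n) (m m₀ : Monomial n) →
  (∀ v → g v ≡ m → v ≡ m₀) → (∀ v → v ≡ m₀ → g v ≡ m) →
  ∀ p → coeff m (mapExponents g p) ≡ coeff m₀ p
coeff-mapExponents g m m₀ f₁ f₂ [] = refl
coeff-mapExponents g m m₀ f₁ f₂ ((c , v) ∷ p) with ≡-dec NP._≟_ (g v) m | ≡-dec NP._≟_ v m₀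
... | yes _ | yes _ = cong (ℤ._+_ c) (coeff-mapExponents g m m₀ f₁ f₂ p)
... | yes e | no ne = ⊥-elim (ne (f₁ v e))
... | no ne | yes e = ⊥-elim (ne (f₂ v e))
... | no _ | no _ = coeff-mapExponents g m m₀ f₁ f₂ p

coeff-mapExponents-miss : ∀ {n} (g : Monomial n → Monomial n) (m : Monomial n) →
  (∀ v → g v ≢ m) → ∀ p → coeff m (mapExponents g p) ≡ 0ℤ
coeff-mapExponents-miss g m f [] = refl
coeff-mapExponents-miss g m f ((c , v) ∷ p) with ≡-dec NP._≟_ (g v) m
... | yes e = ⊥-elim (f v e)
... | no _ = coeff-mapExponents-miss g m f p

mulVar≡mapExponents : ∀ {n} a (a< : a < n) (p : Poly n) → mulVar (fromℕ< a<) p ≡ mapExponents (incAt a) p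
mulVar≡mapExponents a a< [] = refl
mulVar≡mapExponents a a< ((c , v) ∷ p) =
  cong₂ _∷_ (cong (c ,_) (updateAt-suc≡incAt a a< v)) (mulVar≡mapExponents a a< p)

coeff-mulVar-fromℕ< : ∀ {n} a (a< : a < n) (m : Monomial n) (p : Poly n) →
  coeff m (mulVar (fromℕ< a<) p) ≡ whenPos (at m a) (coeff (decAt a m) p)
coeff-mulVar-fromℕ< a a< m p rewrite mulVar≡mapExponents a a< p with at m a in eq
... | zero = coeff-mapExponents-miss (incAt a) m
  (λ v e → NP.1+n≢0 (trans (sym (at-incAt a a< v)) (trans (cong (λ w → at w a) e) eq))) p
... | suc k = coeff-mapExponents (incAt a) m (decAt a m)
  (λ v e → trans (sym (decAt-incAt a v)) (cong (decAt a) e))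
  (λ v e → trans (cong (incAt a) e) (incAt-decAt a m (λ h → NP.1+n≢0 (trans (sym eq) h))))
  p

coeff-mulVar : ∀ {n} (i : Fin n) (m : Monomial n) (p : Poly n) →
  coeff m (mulVar i p) ≡ whenPos (at m (toℕ i)) (coeff (decAt (toℕ i) m) p)
coeff-mulVar i m p =
  trans (cong (λ j → coeff m (mulVar j p)) (sym (FP.fromℕ<-toℕ i (FP.toℕ<n i))))
        (coeff-mulVar-fromℕ< (toℕ i) (FP.toℕ<n i) m p)

CoeffFn : ℕ → Set
CoeffFn n = Monomial n → ℤ

edgeCoeff : ∀ {n} → ℕ × ℕ → CoeffFn n → CoeffFn n
edgeCoeff (a , b) f m = whenPos (at m a) (f (decAt a m)) - whenPos (at m b) (f (decAt b m))

coeff-mulEdge : ∀ {n} (i j : Fin n) (m : Monomial n) (p : Poly n) →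
  coeff m (mulEdge (i , j) p) ≡ edgeCoeff (toℕ i , toℕ j) (λ m → coeff m p) m
coeff-mulEdge i j m p =
  trans (coeff-++ m (mulVar i p) _)
   (cong₂ ℤ._+_ (coeff-mulVar i m p)
     (trans (coeff-neg m (mulVar j p)) (cong -_ (coeff-mulVar j m p))))

edgeProd : ∀ {n} → List (Fin n × Fin n) → Poly n
edgeProd = foldr mulEdge onePoly

prodCoeff : ∀ {n} → List (Fin n × Fin n) → CoeffFn n
prodCoeff L m = coeff m (edgeProd L)

prodCoeff-∷ : ∀ {n} (i j : Fin n) L → prodCoeff ((i , j) ∷ L) ≗ edgeCoeff (toℕ i , toℕ j) (prodCoeff L)
prodCoeff-∷ i j L m = coeff-mulEdge i j m (edgeProd L)

edgeCoeff-cong : ∀ {n} e (f g : CoeffFn n) → f ≗ g → edgeCoeff e f ≗ edgeCoeff e g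
edgeCoeff-cong (a , b) f g h m = cong₂ _-_ (cong (whenPos (at m a)) (h _)) (cong (whenPos (at m b)) (h _))

edgeCoeff-zero : ∀ {n} a b (f : CoeffFn n) m →
  (at m a ≢ 0 → f (decAt a m) ≡ 0ℤ) → (at m b ≢ 0 → f (decAt b m) ≡ 0ℤ) → edgeCoeff (a , b) f m ≡ 0ℤ
edgeCoeff-zero a b f m h₁ h₂ = cong₂ _-_ (whenPos-zero (at m a) _ h₁) (whenPos-zero (at m b) _ h₂)

edgeCoeff-scale : ∀ {n} a b (s : ℤ) (f g : CoeffFn n) → f ≗ (λ m → s ℤ.* g m) →
  edgeCoeff (a , b) f ≗ (λ m → s ℤ.* edgeCoeff (a , b) g m)
edgeCoeff-scale a b s f g f≗sg m
  rewrite f≗sg (decAt a m) | f≗sg (decAt b m)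
        | whenPos-*ˡ (at m a) s (g (decAt a m)) | whenPos-*ˡ (at m b) s (g (decAt b m)) =
  solve 3 (λ s x y → s :* x :- s :* y := s :* (x :- y)) refl
    s (whenPos (at m a) (g (decAt a m))) (whenPos (at m b) (g (decAt b m)))

edgeCoeff-swap-scale : ∀ {n} a b (s : ℤ) (f g : CoeffFn n) → f ≗ (λ m → s ℤ.* g m) →
  edgeCoeff (b , a) f ≗ (λ m → - s ℤ.* edgeCoeff (a , b) g m)
edgeCoeff-swap-scale a b s f g f≗sg m
  rewrite edgeCoeff-scale b a s f g f≗sg m =
  solve 3 (λ s x y → s :* (y :- x) := (:- s) :* (x :- y)) refl
    s (whenPos (at m a) (g (decAt a m))) (whenPos (at m b) (g (decAt b m)))

whenPos² : ∀ {n} → ℕ → ℕ → Vec ℕ n → ℤ → ℤ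
whenPos² a c m z = whenPos (at m a) (whenPos (at (decAt a m) c) z)

whenPos²-comm : ∀ {n} a c (m : Vec ℕ n) z → whenPos² a c m z ≡ whenPos² c a m z
whenPos²-comm a c m z with a ≟ c
... | yes refl = refl
... | no a≢c rewrite at-decAt-other a c m a≢c | at-decAt-other c a m (≢-sym a≢c) =
  whenPos-comm (at m a) (at m c) z

whenPos²-swap : ∀ {n} a c (m : Vec ℕ n) (f : CoeffFn n) →
  whenPos² a c m (f (decAt c (decAt a m))) ≡ whenPos² c a m (f (decAt a (decAt c m)))
whenPos²-swap a c m f = trans (whenPos²-comm a c m _) (cong (λ w → whenPos² c a m (f w)) (decAt-comm c a m))

edgeCoeff² : ∀ {n} a b c d (f : CoeffFn n) m →
  edgeCoeff (a , b) (edgeCoeff (c , d) f) m ≡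
  (whenPos² a c m (f (decAt c (decAt a m))) - whenPos² a d m (f (decAt d (decAt a m))))
  - (whenPos² b c m (f (decAt c (decAt b m))) - whenPos² b d m (f (decAt d (decAt b m))))
edgeCoeff² a b c d f m = cong₂ _-_ (whenPos-distrib-sub (at m a) _ _) (whenPos-distrib-sub (at m b) _ _)

edgeCoeff-comm : ∀ {n} e e′ (f : CoeffFn n) → edgeCoeff e (edgeCoeff e′ f) ≗ edgeCoeff e′ (edgeCoeff e f)
edgeCoeff-comm (a , b) (c , d) f m = begin
  edgeCoeff (a , b) (edgeCoeff (c , d) f) m
    ≡⟨ edgeCoeff² a b c d f m ⟩
  (w a c - w a d) - (w b c - w b d)
    ≡⟨ cong₂ _-_ (cong₂ _-_ (whenPos²-swap a c m f) (whenPos²-swap a d m f))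
                 (cong₂ _-_ (whenPos²-swap b c m f) (whenPos²-swap b d m f)) ⟩
  (w c a - w d a) - (w c b - w d b)
    ≡⟨ solve 4 (λ x y z u → (x :- y) :- (z :- u) := (x :- z) :- (y :- u)) refl
         (w c a) (w d a) (w c b) (w d b) ⟩
  (w c a - w c b) - (w d a - w d b)
    ≡⟨ edgeCoeff² c d a b f m ⟨
  edgeCoeff (c , d) (edgeCoeff (a , b) f) m ∎
  where
  open ≡-Reasoning
  w : ℕ → ℕ → ℤ
  w x y = whenPos² x y m (f (decAt y (decAt x m)))

prodCoeff-↭ : ∀ {n} {L L′ : List (Fin n × Fin n)} → L ↭ L′ → prodCoeff L ≗ prodCoeff L′
prodCoeff-↭ Perm.refl m = refl
prodCoeff-↭ {L = (i , j) ∷ L} {.(i , j) ∷ L′} (Perm.prep _ p) m =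
  trans (prodCoeff-∷ i j L m)
  (trans (edgeCoeff-cong _ (prodCoeff L) (prodCoeff L′) (prodCoeff-↭ p) m) (sym (prodCoeff-∷ i j L′ m)))
prodCoeff-↭ {L = (i , j) ∷ (k , l) ∷ L} {(.k , .l) ∷ (.i , .j) ∷ L′} (Perm.swap _ _ p) m =
  trans (prodCoeff-∷ i j ((k , l) ∷ L) m)
  (trans (edgeCoeff-cong (toℕ i , toℕ j) _ _ (prodCoeff-∷ k l L) m)
  (trans (edgeCoeff-cong (toℕ i , toℕ j) _ _ (edgeCoeff-cong (toℕ k , toℕ l) (prodCoeff L) (prodCoeff L′) (prodCoeff-↭ p)) m)
  (trans (edgeCoeff-comm (toℕ i , toℕ j) (toℕ k , toℕ l) (prodCoeff L′) m)
  (trans (sym (edgeCoeff-cong (toℕ k , toℕ l) _ _ (prodCoeff-∷ i j L′) m))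
  (sym (prodCoeff-∷ k l ((i , j) ∷ L′) m))))))
prodCoeff-↭ (Perm.trans p q) m = trans (prodCoeff-↭ p m) (prodCoeff-↭ q m)

orientedProd-scale : ∀ {n} (σ : ℕ → Bool) i (L : List (Fin n × Fin n)) →
  Σ ℤ (λ s → ∀ m → coeff m (orientedProd σ i L) ≡ s ℤ.* prodCoeff L m)
orientedProd-scale σ i [] = 1ℤ , λ m → sym (ZP.*-identityˡ _)
orientedProd-scale σ i ((x , y) ∷ L) with orientedProd-scale σ (suc i) L | σ i
... | s , h | true = s , λ m →
  trans (coeff-mulEdge x y m (orientedProd σ (suc i) L))
  (trans (edgeCoeff-scale (toℕ x) (toℕ y) s _ (prodCoeff L) h m)
   (cong (ℤ._*_ s) (sym (prodCoeff-∷ x y L m))))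
... | s , h | false = - s , λ m →
  trans (coeff-mulEdge y x m (orientedProd σ (suc i) L))
  (trans (edgeCoeff-swap-scale (toℕ x) (toℕ y) s _ (prodCoeff L) h m)
   (cong (ℤ._*_ (- s)) (sym (prodCoeff-∷ x y L m))))

orientedProd-vanishes : ∀ {n} (σ : ℕ → Bool) (L : List (Fin n × Fin n)) m → prodCoeff L m ≡ 0ℤ →
  coeff m (orientedProd σ 0 L) ≡ 0ℤ
orientedProd-vanishes σ L m h with orientedProd-scale σ 0 L
... | s , e = trans (e m) (trans (cong (ℤ._*_ s) h) (ZP.*-zeroʳ s))

toFinEdge : ∀ N → ℕ × ℕ → Maybe (Fin N × Fin N)
toFinEdge N (a , b) with a <? N | b <? N
... | yes p | yes q = just (fromℕ< p , fromℕ< q)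
... | _ | _ = nothing

consMaybe : ∀ {A : Set} → Maybe A → List A → List A
consMaybe nothing l = l
consMaybe (just e) l = e ∷ l

toFinEdges-∷ : ∀ N x L → toFinEdges N (x ∷ L) ≡ consMaybe (toFinEdge N x) (toFinEdges N L)
toFinEdges-∷ N (a , b) L with a <? N | b <? N
... | yes p | yes q = refl
... | yes _ | no _ = refl
... | no _ | yes _ = refl
... | no _ | no _ = refl

consMaybe-prep : ∀ {A : Set} (o : Maybe A) {l l′} → l ↭ l′ → consMaybe o l ↭ consMaybe o l′
consMaybe-prep nothing p = p
consMaybe-prep (just e) p = Perm.prep e p

consMaybe-swap : ∀ {A : Set} (o o′ : Maybe A) {l l′} → l ↭ l′ → consMaybe o (consMaybe o′ l) ↭ consMaybe o′ (consMaybe o l′)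
consMaybe-swap nothing nothing p = p
consMaybe-swap nothing (just e) p = Perm.prep e p
consMaybe-swap (just e) nothing p = Perm.prep e p
consMaybe-swap (just e) (just e′) p = Perm.swap e e′ p

toFinEdges-↭ : ∀ N {L L′ : List (ℕ × ℕ)} → L ↭ L′ → toFinEdges N L ↭ toFinEdges N L′
toFinEdges-↭ N Perm.refl = Perm.refl
toFinEdges-↭ N {x ∷ xs} {.x ∷ ys} (Perm.prep .x p)
  rewrite toFinEdges-∷ N x xs | toFinEdges-∷ N x ys = consMaybe-prep (toFinEdge N x) (toFinEdges-↭ N p)
toFinEdges-↭ N {x ∷ y ∷ xs} {.y ∷ .x ∷ ys} (Perm.swap .x .y p)
  rewrite toFinEdges-∷ N x (y ∷ xs) | toFinEdges-∷ N y xs | toFinEdges-∷ N y (x ∷ ys) | toFinEdges-∷ N x ys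
  = consMaybe-swap (toFinEdge N x) (toFinEdge N y) (toFinEdges-↭ N p)
toFinEdges-↭ N (Perm.trans p q) = Perm.trans (toFinEdges-↭ N p) (toFinEdges-↭ N q)

prodCoeffℕ : (N : ℕ) → List (ℕ × ℕ) → CoeffFn N
prodCoeffℕ N L = prodCoeff (toFinEdges N L)

prodCoeffℕ-↭ : ∀ N {L L′} → L ↭ L′ → prodCoeffℕ N L ≗ prodCoeffℕ N L′
prodCoeffℕ-↭ N p = prodCoeff-↭ (toFinEdges-↭ N p)

prodCoeffℕ-∷ : ∀ N a b L → a < N → b < N → prodCoeffℕ N ((a , b) ∷ L) ≗ edgeCoeff (a , b) (prodCoeffℕ N L)
prodCoeffℕ-∷ N a b L a< b< m with a <? N | b <? N
... | yes p | yes q = trans (prodCoeff-∷ (fromℕ< p) (fromℕ< q) (toFinEdges N L) m)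
   (cong (λ e → edgeCoeff e (prodCoeffℕ N L) m) (cong₂ _,_ (FP.toℕ-fromℕ< p) (FP.toℕ-fromℕ< q)))
... | yes _ | no ¬q = ⊥-elim (¬q b<)
... | no ¬p | _ = ⊥-elim (¬p a<)

δ₁ : ℕ → ℤ
δ₁ 1 = 1ℤ
δ₁ _ = 0ℤ

-- fanValue a (c₀ ∷ … ∷ c_{n-1}) is the coefficient of h^a p₀^c₀ ⋯ p_{n-1}^c_{n-1} in the
-- product over the fan edges h p₀, p₀ p₁, h p₁, …, p_{n-1} p_n, h p_n evaluated at p_n = 0.
fanValue∷ : ℕ → ℕ → List ℕ → ℤ
fanValue∷ a 1 [] = whenPos a (δ₁ (pred a))
fanValue∷ a 2 [] = - δ₁ a
fanValue∷ a _ [] = 0ℤ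
fanValue∷ a 0 (x ∷ cs) = - whenPos a (whenPos x (fanValue∷ (pred a) (pred x) cs))
fanValue∷ a 1 (x ∷ cs) = whenPos x (fanValue∷ a (pred x) cs) ℤ.+ whenPos a (fanValue∷ (pred a) x cs)
fanValue∷ a 2 (x ∷ cs) = - fanValue∷ a x cs
fanValue∷ a _ (x ∷ cs) = 0ℤ

fanValue : ℕ → List ℕ → ℤ
fanValue a [] = δ₁ a
fanValue a (c ∷ cs) = fanValue∷ a c cs

fanValue-hub0 : ∀ c cs → fanValue 0 (c ∷ cs) ≡ 0ℤ
fanValue-hub0 0 [] = refl
fanValue-hub0 1 [] = refl
fanValue-hub0 2 [] = refl
fanValue-hub0 (suc (suc (suc c))) [] = refl
fanValue-hub0 0 (x ∷ cs) = refl
fanValue-hub0 1 (x ∷ cs) =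
  trans (cong (λ z → whenPos x z ℤ.+ 0ℤ) (fanValue-hub0 (pred x) cs)) (cong (λ z → z ℤ.+ 0ℤ) (whenPos-0ℤ x))
fanValue-hub0 2 (x ∷ cs) = cong -_ (fanValue-hub0 x cs)
fanValue-hub0 (suc (suc (suc c))) (x ∷ cs) = refl

fanValue-hub1 : ∀ c cs → c ≤ 1 → All (_≤ 2) cs → fanValue 1 (c ∷ cs) ≡ 0ℤ
fanValue-hub1 0 [] _ _ = refl
fanValue-hub1 1 [] _ _ = refl
fanValue-hub1 0 (x ∷ cs) _ _ = trans (cong (λ z → - whenPos x z) (fanValue-hub0 (pred x) cs)) (cong -_ (whenPos-0ℤ x))
fanValue-hub1 1 (x ∷ cs) _ (x≤2 ∷ cs≤2) =
  trans (cong₂ ℤ._+_ (cong (whenPos x) (fanValue-hub1 (pred x) cs (NP.pred-mono-≤ x≤2) cs≤2)) (fanValue-hub0 x cs))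
        (cong (λ z → z ℤ.+ 0ℤ) (whenPos-0ℤ x))
fanValue-hub1 (suc (suc c)) cs (s≤s ()) _

fanValue-hub2-0 : ∀ cs → All (_≤ 2) cs → fanValue 2 (0 ∷ cs) ≡ 0ℤ
fanValue-hub2-0 [] _ = refl
fanValue-hub2-0 (x ∷ cs) (x≤2 ∷ cs≤2) =
  trans (cong (λ z → - whenPos x z) (fanValue-hub1 (pred x) cs (NP.pred-mono-≤ x≤2) cs≤2)) (cong -_ (whenPos-0ℤ x))

oddLength : List ℕ → Bool
oddLength [] = false
oddLength (_ ∷ xs) = not (oddLength xs)

-- For cs of even length fanValue 2 (1 ∷ cs) need not vanish, but it cancels against
-- fanValue 1 (2 ∷ cs); carrying both parities makes the induction go through.
fanValue-hub2-1 : ∀ cs → All (_≤ 2) cs →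
  (oddLength cs ≡ true → fanValue 2 (1 ∷ cs) ≡ 0ℤ) ×
  (oddLength cs ≡ false → fanValue 2 (1 ∷ cs) ℤ.+ fanValue 1 (2 ∷ cs) ≡ 0ℤ)
fanValue-hub2-1 [] _ = (λ ()) , (λ _ → refl)
fanValue-hub2-1 (0 ∷ cs) (_ ∷ cs≤2) = (λ _ → v≡0) , (λ _ → cong₂ ℤ._+_ v≡0 (cong -_ (fanValue-hub1 0 cs z≤n cs≤2)))
  where v≡0 : fanValue 2 (1 ∷ 0 ∷ cs) ≡ 0ℤ
        v≡0 = trans (ZP.+-identityˡ _) (fanValue-hub1 0 cs z≤n cs≤2)
fanValue-hub2-1 (1 ∷ cs) (_ ∷ cs≤2) = (λ _ → v≡0) , (λ _ → cong₂ ℤ._+_ v≡0 (cong -_ (fanValue-hub1 1 cs (s≤s z≤n) cs≤2)))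
  where v≡0 : fanValue 2 (1 ∷ 1 ∷ cs) ≡ 0ℤ
        v≡0 = cong₂ ℤ._+_ (fanValue-hub2-0 cs cs≤2) (fanValue-hub1 1 cs (s≤s z≤n) cs≤2)
fanValue-hub2-1 (2 ∷ cs) (_ ∷ cs≤2) with fanValue-hub2-1 cs cs≤2 | oddLength cs in eq
... | _ , even | false = (λ _ → even eq) , (λ ())
... | odd , _ | true = (λ ()) , λ _ →
  trans (cong (λ z → (z ℤ.+ W) - W) (odd eq)) (solve 1 (λ w → (con 0ℤ :+ w) :- w := con 0ℤ) refl W)
  where W = fanValue 1 (2 ∷ cs)
fanValue-hub2-1 (suc (suc (suc x)) ∷ cs) (s≤s (s≤s ()) ∷ _)

fanValue-vanishes : ∀ a c cs → a ≤ 2 → c ≤ 1 → All (_≤ 2) cs → oddLength cs ≡ true → fanValue a (c ∷ cs) ≡ 0ℤ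
fanValue-vanishes 0 c cs _ _ _ _ = fanValue-hub0 c cs
fanValue-vanishes 1 c cs _ c≤1 cs≤2 _ = fanValue-hub1 c cs c≤1 cs≤2
fanValue-vanishes 2 0 cs _ _ cs≤2 _ = fanValue-hub2-0 cs cs≤2
fanValue-vanishes 2 1 cs _ _ cs≤2 odd = proj₁ (fanValue-hub2-1 cs cs≤2) odd
fanValue-vanishes 2 (suc (suc c)) cs _ (s≤s ()) _ _
fanValue-vanishes (suc (suc (suc a))) c cs (s≤s (s≤s ())) _ _ _

EdgesIn : ℕ → List (ℕ × ℕ) → Set
EdgesIn N = All (λ e → proj₁ e < N × proj₂ e < N)

Avoids : ℕ → List (ℕ × ℕ) → Set
Avoids v = All (λ e → proj₁ e ≢ v × proj₂ e ≢ v)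

NotIn : ℕ → List ℕ → Set
NotIn x = All (x ≢_)

Distinct : List ℕ → Set
Distinct [] = ⊤
Distinct (x ∷ xs) = NotIn x xs × Distinct xs

at-replicate0 : ∀ n u → at (replicate n 0) u ≡ 0
at-replicate0 zero u = refl
at-replicate0 (suc n) zero = refl
at-replicate0 (suc n) (suc u) = at-replicate0 n u

prodCoeffℕ-[] : ∀ N (m : Vec ℕ N) v → at m v ≢ 0 → prodCoeffℕ N [] m ≡ 0ℤ
prodCoeffℕ-[] N m v h with ≡-dec NP._≟_ (replicate N 0) m
... | yes e = ⊥-elim (h (trans (cong (λ w → at w v) (sym e)) (at-replicate0 N v)))
... | no _ = refl

prodCoeffℕ-isolated : ∀ N L (m : Vec ℕ N) v → at m v ≢ 0 → Avoids v L → EdgesIn N L → prodCoeffℕ N L m ≡ 0ℤ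
prodCoeffℕ-isolated N [] m v h _ _ = prodCoeffℕ-[] N m v h
prodCoeffℕ-isolated N ((a , b) ∷ L) m v h ((av , bv) ∷ hs) ((a< , b<) ∷ rs) =
  trans (prodCoeffℕ-∷ N a b L a< b< m)
  (edgeCoeff-zero a b (prodCoeffℕ N L) m
    (λ _ → prodCoeffℕ-isolated N L (decAt a m) v (λ e → h (trans (sym (at-decAt-other a v m av)) e)) hs rs)
    (λ _ → prodCoeffℕ-isolated N L (decAt b m) v (λ e → h (trans (sym (at-decAt-other b v m bv)) e)) hs rs))

clearAt : ∀ {n} → ℕ → Vec ℕ n → Vec ℕ n
clearAt _ [] = []
clearAt zero (x ∷ xs) = 0 ∷ xs
clearAt (suc j) (x ∷ xs) = x ∷ clearAt j xs

clearAll : ∀ {n} → List ℕ → Vec ℕ n → Vec ℕ n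
clearAll [] m = m
clearAll (v ∷ S) m = clearAt v (clearAll S m)

elemᵇ : ℕ → List ℕ → Bool
elemᵇ u [] = false
elemᵇ u (v ∷ S) = (u ≡ᵇ v) ∨ elemᵇ u S

at-clearAt-same : ∀ {n} v (m : Vec ℕ n) → at (clearAt v m) v ≡ 0
at-clearAt-same v [] = refl
at-clearAt-same zero (x ∷ m) = refl
at-clearAt-same (suc v) (x ∷ m) = at-clearAt-same v m

at-clearAt-other : ∀ {n} v u (m : Vec ℕ n) → v ≢ u → at (clearAt v m) u ≡ at m u
at-clearAt-other v u [] h = refl
at-clearAt-other zero zero (x ∷ m) h = ⊥-elim (h refl)
at-clearAt-other zero (suc u) (x ∷ m) h = refl
at-clearAt-other (suc v) zero (x ∷ m) h = refl
at-clearAt-other (suc v) (suc u) (x ∷ m) h = at-clearAt-other v u m (λ e → h (cong suc e))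

≡ᵇ-refl : ∀ u → (u ≡ᵇ u) ≡ true
≡ᵇ-refl zero = refl
≡ᵇ-refl (suc u) = ≡ᵇ-refl u

true≢false : true ≢ false
true≢false ()

≡ᵇ-true⇒≡ : ∀ u v → (u ≡ᵇ v) ≡ true → u ≡ v
≡ᵇ-true⇒≡ u v eq = NP.≡ᵇ⇒≡ u v (subst Data.Bool.T (sym eq) tt)

at-clearAll : ∀ {n} S u (m : Vec ℕ n) → at (clearAll S m) u ≡ (if elemᵇ u S then 0 else at m u)
at-clearAll [] u m = refl
at-clearAll (v ∷ S) u m with u ≟ v
... | yes refl rewrite ≡ᵇ-refl u = at-clearAt-same u (clearAll S m)
... | no u≢v rewrite at-clearAt-other v u (clearAll S m) (λ e → u≢v (sym e)) with u ≡ᵇ v in eq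
...   | true = ⊥-elim (u≢v (≡ᵇ-true⇒≡ u v eq))
...   | false = at-clearAll S u m

at-ext : ∀ {n} (v w : Vec ℕ n) → (∀ u → at v u ≡ at w u) → v ≡ w
at-ext [] [] h = refl
at-ext (x ∷ v) (y ∷ w) h = cong₂ _∷_ (h zero) (at-ext v w (λ u → h (suc u)))

fanEdges : ℕ → ℕ → List ℕ → List (ℕ × ℕ)
fanEdges h p [] = (h , p) ∷ []
fanEdges h p (q ∷ qs) = (h , p) ∷ (p , q) ∷ fanEdges h q qs

lastOf : ℕ → List ℕ → ℕ
lastOf p [] = p
lastOf p (q ∷ qs) = lastOf q qs

dropLast : ℕ → List ℕ → List ℕ
dropLast p [] = []
dropLast p (q ∷ qs) = p ∷ dropLast q qs

NotIn-dropLast : ∀ x q qs → NotIn x (q ∷ qs) → NotIn x (dropLast q qs)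
NotIn-dropLast x q [] h = []
NotIn-dropLast x q (r ∷ rs) (h₁ ∷ h₂) = h₁ ∷ NotIn-dropLast x r rs h₂

NotIn-lastOf : ∀ x q qs → NotIn x (q ∷ qs) → x ≢ lastOf q qs
NotIn-lastOf x q [] (h₁ ∷ _) = h₁
NotIn-lastOf x q (r ∷ rs) (_ ∷ h₂) = NotIn-lastOf x r rs h₂

map-at-decAt : ∀ {n} v (m : Vec ℕ n) xs → NotIn v xs → map (at (decAt v m)) xs ≡ map (at m) xs
map-at-decAt v m [] _ = refl
map-at-decAt v m (x ∷ xs) (h ∷ hs) = cong₂ _∷_ (at-decAt-other v x m h) (map-at-decAt v m xs hs)

clearAll-decAt : ∀ {n} S v (m : Vec ℕ n) → elemᵇ v S ≡ true → clearAll S (decAt v m) ≡ clearAll S m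
clearAll-decAt S v m hv = at-ext _ _ λ u →
  trans (at-clearAll S u (decAt v m)) (trans (aux u (elemᵇ u S) refl) (sym (at-clearAll S u m)))
  where
  aux : ∀ u b → elemᵇ u S ≡ b → (if b then 0 else at (decAt v m) u) ≡ (if b then 0 else at m u)
  aux u true _ = refl
  aux u false e = at-decAt-other v u m (λ v≡u → true≢false (trans (sym hv) (trans (cong (λ w → elemᵇ w S) v≡u) e)))

clearAll-∷-zero : ∀ {n} S v (m : Vec ℕ n) → at m v ≡ 0 → clearAll (v ∷ S) m ≡ clearAll S m
clearAll-∷-zero S v m h = at-ext _ _ λ u → aux u
  where
  aux : ∀ u → at (clearAt v (clearAll S m)) u ≡ at (clearAll S m) u
  aux u with v ≟ u
  ... | no v≢u = at-clearAt-other v u (clearAll S m) v≢u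
  ... | yes refl = trans (at-clearAt-same v (clearAll S m))
        (sym (trans (at-clearAll S v m) (aux2 (elemᵇ v S))))
    where aux2 : ∀ b → (if b then 0 else at m v) ≡ 0
          aux2 true = refl
          aux2 false = h

clearAt-comm : ∀ {n} a b (m : Vec ℕ n) → clearAt a (clearAt b m) ≡ clearAt b (clearAt a m)
clearAt-comm a b [] = refl
clearAt-comm zero zero (x ∷ m) = refl
clearAt-comm zero (suc b) (x ∷ m) = refl
clearAt-comm (suc a) zero (x ∷ m) = refl
clearAt-comm (suc a) (suc b) (x ∷ m) = cong (x ∷_) (clearAt-comm a b m)

pred< : ∀ {x t} → x ≢ 0 → x ≤ t → pred x < t
pred< {zero} h _ = ⊥-elim (h refl)
pred< {suc x} h le = le

pred≤ : ∀ {x t} → x ≤ t → pred x ≤ t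
pred≤ {zero} le = le
pred≤ {suc x} le = NP.≤-trans (NP.n≤1+n x) le

AgreeOff : ∀ {N} → List ℕ → ℕ → Vec ℕ N → Vec ℕ N → Set
AgreeOff S₀ q m₀ m = ∀ u → elemᵇ u S₀ ≡ false → u ≢ q → at m u ≡ at m₀ u

elemᵇ-≢ : ∀ {u v} S → elemᵇ u S ≡ false → elemᵇ v S ≡ true → v ≢ u
elemᵇ-≢ S hu hv refl = true≢false (trans (sym hv) hu)

AgreeOff-decAt : ∀ {N} S₀ q (m₀ m : Vec ℕ N) v → (elemᵇ v S₀ ≡ true ⊎ v ≡ q) → AgreeOff S₀ q m₀ m → AgreeOff S₀ q m₀ (decAt v m)
AgreeOff-decAt S₀ q m₀ m v (inj₁ hv) ag u hu uq = trans (at-decAt-other v u m (elemᵇ-≢ S₀ hu hv)) (ag u hu uq)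
AgreeOff-decAt S₀ q m₀ m v (inj₂ refl) ag u hu uq = trans (at-decAt-other v u m (λ e → uq (sym e))) (ag u hu uq)

fan-coeff-edge : ∀ N h p (R : List (ℕ × ℕ)) t S₀ (m₀ m : Vec ℕ N) →
  h < N → p < N → EdgesIn N R → h ≢ p → Avoids h R → elemᵇ h S₀ ≡ true →
  (∀ m′ → AgreeOff S₀ p m₀ m′ → at m′ p < t → prodCoeffℕ N R m′ ≡ 0ℤ) → AgreeOff S₀ p m₀ m → at m p ≤ t →
  prodCoeffℕ N ((h , p) ∷ R) m ≡ δ₁ (at m h) ℤ.* prodCoeffℕ N R (clearAll (h ∷ []) m)
fan-coeff-edge N h p R t S₀ m₀ m h< p< inR h≢p avh hS rest-vanishes ag le =
  trans (prodCoeffℕ-∷ N h p R h< p< m)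
  (trans (cong (_-_ (whenPos (at m h) (prodCoeffℕ N R (decAt h m))))
     (whenPos-zero (at m p) _ (λ nz → rest-vanishes (decAt p m) (AgreeOff-decAt S₀ p m₀ m p (inj₂ refl) ag)
         (subst (_< t) (sym (at-decAt-same p m)) (pred< nz le)))))
  (trans (ZP.+-identityʳ _) (first (at m h) refl)))
  where
  first : ∀ A → at m h ≡ A → whenPos A (prodCoeffℕ N R (decAt h m)) ≡ δ₁ A ℤ.* prodCoeffℕ N R (clearAt h m)
  first zero _ = refl
  first (suc zero) e = trans (sym (ZP.*-identityˡ _)) (cong (λ w → 1ℤ ℤ.* prodCoeffℕ N R w)
      (at-ext _ _ λ u → aux u))
    where
    aux : ∀ u → at (decAt h m) u ≡ at (clearAt h m) u
    aux u with h ≟ u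
    ... | yes refl = trans (at-decAt-same h m) (trans (cong pred e) (sym (at-clearAt-same h m)))
    ... | no h≢u = trans (at-decAt-other h u m h≢u) (sym (at-clearAt-other h u m h≢u))
  first (suc (suc a)) e = prodCoeffℕ-isolated N R (decAt h m) h
      (λ z → NP.1+n≢0 (trans (sym (trans (at-decAt-same h m) (cong pred e))) z)) avh inR

elemᵇ-here : ∀ v S → elemᵇ v (v ∷ S) ≡ true
elemᵇ-here v S rewrite ≡ᵇ-refl v = refl

elemᵇ-there : ∀ v u S → elemᵇ v S ≡ true → elemᵇ v (u ∷ S) ≡ true
elemᵇ-there v u S h rewrite h = ∨-zeroʳ (v ≡ᵇ u)

clearAll-decAt² : ∀ {n} h p I a b (m : Vec ℕ n) → elemᵇ a (p ∷ h ∷ I) ≡ true → elemᵇ b (p ∷ h ∷ I) ≡ true →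
  at (decAt a (decAt b m)) p ≡ 0 → clearAll (h ∷ I) (decAt a (decAt b m)) ≡ clearAll (h ∷ p ∷ I) m
clearAll-decAt² h p I a b m ha hb e =
  trans (sym (clearAll-∷-zero (h ∷ I) p _ e))
  (trans (clearAll-decAt (p ∷ h ∷ I) a (decAt b m) ha)
  (trans (clearAll-decAt (p ∷ h ∷ I) b m hb)
  (clearAt-comm p h (clearAll I m))))

fanEdges-in : ∀ N h q qs → h < N → All (_< N) (q ∷ qs) → EdgesIn N (fanEdges h q qs)
fanEdges-in N h q [] h< (q< ∷ _) = (h< , q<) ∷ []
fanEdges-in N h q (r ∷ rs) h< (q< ∷ rs<) = (h< , q<) ∷ (q< , All.head rs<) ∷ fanEdges-in N h r rs h< rs<

fanEdges-avoid : ∀ v h q qs → h ≢ v → NotIn v (q ∷ qs) → Avoids v (fanEdges h q qs)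
fanEdges-avoid v h q [] hv (qv ∷ _) = (hv , λ e → qv (sym e)) ∷ []
fanEdges-avoid v h q (r ∷ rs) hv (qv ∷ rv ∷ rsv) =
  (hv , λ e → qv (sym e)) ∷ ((λ e → qv (sym e)) , (λ e → rv (sym e))) ∷ fanEdges-avoid v h r rs hv (rv ∷ rsv)

at-decAt²-other : ∀ {n} a b u (m : Vec ℕ n) → a ≢ u → b ≢ u → at (decAt a (decAt b m)) u ≡ at m u
at-decAt²-other a b u m au bu = trans (at-decAt-other a u (decAt b m) au) (at-decAt-other b u m bu)

map-at-decAt² : ∀ {n} a b (m : Vec ℕ n) xs → NotIn a xs → NotIn b xs → map (at (decAt a (decAt b m))) xs ≡ map (at m) xs
map-at-decAt² a b m xs ha hb = trans (map-at-decAt a (decAt b m) xs ha) (map-at-decAt b m xs hb)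

whenPos-cong : ∀ x {u v} → (x ≢ 0 → u ≡ v) → whenPos x u ≡ whenPos x v
whenPos-cong zero h = refl
whenPos-cong (suc x) h = h (λ ())

[_>0] : ℕ → ℤ
[ zero >0] = 0ℤ
[ suc _ >0] = 1ℤ

whenPos≡* : ∀ x u → whenPos x u ≡ [ x >0] ℤ.* u
whenPos≡* zero u = sym (ZP.*-zeroˡ u)
whenPos≡* (suc x) u = sym (ZP.*-identityˡ u)

opaque
  wedgeExpr : ℕ → ℕ → ℕ → ℤ → ℤ → ℤ → ℤ → ℤ
  wedgeExpr A P X t₁ t₂ t₃ t₄ =
    whenPos A (whenPos P t₁ - whenPos X t₂) - whenPos P (whenPos (pred P) t₃ - whenPos X t₄)

  wedgeExpr-cong : ∀ A P X {t₁ t₂ t₃ t₄ u₁ u₂ u₃ u₄} →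
    (P ≢ 0 → t₁ ≡ u₁) → (X ≢ 0 → t₂ ≡ u₂) → (pred P ≢ 0 → t₃ ≡ u₃) → (P ≢ 0 → X ≢ 0 → t₄ ≡ u₄) →
    wedgeExpr A P X t₁ t₂ t₃ t₄ ≡ wedgeExpr A P X u₁ u₂ u₃ u₄
  wedgeExpr-cong A P X e₁ e₂ e₃ e₄ =
    cong₂ _-_ (cong (whenPos A) (cong₂ _-_ (whenPos-cong P e₁) (whenPos-cong X e₂)))
              (whenPos-cong P (λ P≢0 → cong₂ _-_ (whenPos-cong (pred P) e₃) (whenPos-cong X (e₄ P≢0))))

  wedgeExpr-polynomial : ∀ A P X t₁ t₂ t₃ t₄ → wedgeExpr A P X t₁ t₂ t₃ t₄ ≡
    [ A >0] ℤ.* ([ P >0] ℤ.* t₁ - [ X >0] ℤ.* t₂) - [ P >0] ℤ.* ([ pred P >0] ℤ.* t₃ - [ X >0] ℤ.* t₄)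
  wedgeExpr-polynomial A P X t₁ t₂ t₃ t₄ = cong₂ _-_
    (trans (whenPos≡* A _) (cong (ℤ._*_ [ A >0]) (cong₂ _-_ (whenPos≡* P t₁) (whenPos≡* X t₂))))
    (trans (whenPos≡* P _) (cong (ℤ._*_ [ P >0]) (cong₂ _-_ (whenPos≡* (pred P) t₃) (whenPos≡* X t₄))))

-- The coefficient of the wedge (x_h - x_p)(x_p - x_q) times a remainder which, once
-- p is used up, contributes Φ (hub exponent), or Ψ (hub exponent) after one factor x_q.
wedgeValue : (ℕ → ℤ) → (ℕ → ℤ) → ℕ → ℕ → ℕ → ℤ
wedgeValue Φ Ψ A 0 X = - whenPos A (whenPos X (Ψ (pred A)))
wedgeValue Φ Ψ A 1 X = whenPos X (Ψ A) ℤ.+ whenPos A (Φ (pred A))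
wedgeValue Φ Ψ A 2 X = - Φ A
wedgeValue Φ Ψ A (suc (suc (suc _))) X = 0ℤ

opaque
  unfolding wedgeExpr

  prodCoeffℕ-wedge : ∀ N h p q L (m : Vec ℕ N) → h < N → p < N → q < N → h ≢ p → h ≢ q → p ≢ q →
    prodCoeffℕ N ((h , p) ∷ (p , q) ∷ L) m ≡
    wedgeExpr (at m h) (at m p) (at m q)
      (prodCoeffℕ N L (decAt p (decAt h m))) (prodCoeffℕ N L (decAt q (decAt h m)))
      (prodCoeffℕ N L (decAt p (decAt p m))) (prodCoeffℕ N L (decAt q (decAt p m)))
  prodCoeffℕ-wedge N h p q L m h< p< q< hp hq pq =
    trans (prodCoeffℕ-∷ N h p _ h< p< m)
    (cong₂ _-_
      (cong (whenPos (at m h)) (trans (prodCoeffℕ-∷ N p q L p< q< (decAt h m))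
         (cong₂ (λ x y → whenPos x (prodCoeffℕ N L (decAt p (decAt h m))) - whenPos y (prodCoeffℕ N L (decAt q (decAt h m))))
            (at-decAt-other h p m hp) (at-decAt-other h q m hq))))
      (cong (whenPos (at m p)) (trans (prodCoeffℕ-∷ N p q L p< q< (decAt p m))
         (cong₂ (λ x y → whenPos x (prodCoeffℕ N L (decAt p (decAt p m))) - whenPos y (prodCoeffℕ N L (decAt q (decAt p m))))
            (at-decAt-same p m) (at-decAt-other p q m pq)))))

-- t₁ … t₄ are the four terms of the wedge expansion.
wedgeExpr-value : ∀ A P X (Φ Ψ : ℕ → ℤ) z t₁ t₂ t₃ t₄ →
  (pred P ≢ 0 → t₁ ≡ 0ℤ) → (pred P ≡ 0 → t₁ ≡ Φ (pred A) ℤ.* z) →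
  (P ≢ 0 → t₂ ≡ 0ℤ) → (X ≢ 0 → P ≡ 0 → t₂ ≡ Ψ (pred A) ℤ.* z) →
  (pred (pred P) ≢ 0 → t₃ ≡ 0ℤ) → (pred (pred P) ≡ 0 → t₃ ≡ Φ A ℤ.* z) →
  (pred P ≢ 0 → t₄ ≡ 0ℤ) → (X ≢ 0 → pred P ≡ 0 → t₄ ≡ Ψ A ℤ.* z) →
  wedgeExpr A P X t₁ t₂ t₃ t₄ ≡ wedgeValue Φ Ψ A P X ℤ.* z
wedgeExpr-value A 0 X Φ Ψ z t₁ t₂ t₃ t₄ _ _ _ t₂≡ _ _ _ _ = begin
  wedgeExpr A 0 X t₁ t₂ t₃ t₄
    ≡⟨ wedgeExpr-cong A 0 X absurd (λ X≢0 → t₂≡ X≢0 refl) absurd (λ 0≢0 _ → absurd 0≢0) ⟩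
  wedgeExpr A 0 X 0ℤ (Ψ (pred A) ℤ.* z) 0ℤ 0ℤ
    ≡⟨ wedgeExpr-polynomial A 0 X _ _ _ _ ⟩
  [ A >0] ℤ.* (0ℤ ℤ.* 0ℤ - [ X >0] ℤ.* (Ψ (pred A) ℤ.* z)) - 0ℤ ℤ.* (0ℤ ℤ.* 0ℤ - [ X >0] ℤ.* 0ℤ)
    ≡⟨ solve 4 (λ a x y z → a :* (con 0ℤ :* con 0ℤ :- x :* (y :* z)) :- con 0ℤ :* (con 0ℤ :* con 0ℤ :- x :* con 0ℤ)
                          := (:- (a :* (x :* y))) :* z) refl [ A >0] [ X >0] (Ψ (pred A)) z ⟩
  (- ([ A >0] ℤ.* ([ X >0] ℤ.* Ψ (pred A)))) ℤ.* z
    ≡⟨ cong (λ u → (- u) ℤ.* z) (sym (trans (whenPos≡* A _) (cong (ℤ._*_ [ A >0]) (whenPos≡* X _)))) ⟩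
  (- whenPos A (whenPos X (Ψ (pred A)))) ℤ.* z ∎
  where open ≡-Reasoning
        absurd : ∀ {u v : ℤ} → 0 ≢ 0 → u ≡ v
        absurd 0≢0 = ⊥-elim (0≢0 refl)
wedgeExpr-value A 1 X Φ Ψ z t₁ t₂ t₃ t₄ _ t₁≡ t₂≡0 _ _ _ _ t₄≡ = begin
  wedgeExpr A 1 X t₁ t₂ t₃ t₄
    ≡⟨ wedgeExpr-cong A 1 X (λ _ → t₁≡ refl) (λ _ → t₂≡0 (λ ())) (λ 0≢0 → ⊥-elim (0≢0 refl)) (λ _ X≢0 → t₄≡ X≢0 refl) ⟩
  wedgeExpr A 1 X (Φ (pred A) ℤ.* z) 0ℤ 0ℤ (Ψ A ℤ.* z)
    ≡⟨ wedgeExpr-polynomial A 1 X _ _ _ _ ⟩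
  [ A >0] ℤ.* (1ℤ ℤ.* (Φ (pred A) ℤ.* z) - [ X >0] ℤ.* 0ℤ) - 1ℤ ℤ.* (0ℤ ℤ.* 0ℤ - [ X >0] ℤ.* (Ψ A ℤ.* z))
    ≡⟨ solve 5 (λ a x φ ψ z → a :* (con 1ℤ :* (φ :* z) :- x :* con 0ℤ) :- con 1ℤ :* (con 0ℤ :* con 0ℤ :- x :* (ψ :* z))
                            := (x :* ψ :+ a :* φ) :* z) refl [ A >0] [ X >0] (Φ (pred A)) (Ψ A) z ⟩
  ([ X >0] ℤ.* Ψ A ℤ.+ [ A >0] ℤ.* Φ (pred A)) ℤ.* z
    ≡⟨ cong (λ u → u ℤ.* z) (sym (cong₂ ℤ._+_ (whenPos≡* X _) (whenPos≡* A _))) ⟩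
  (whenPos X (Ψ A) ℤ.+ whenPos A (Φ (pred A))) ℤ.* z ∎
  where open ≡-Reasoning
wedgeExpr-value A 2 X Φ Ψ z t₁ t₂ t₃ t₄ t₁≡0 _ t₂≡0 _ _ t₃≡ t₄≡0 _ = begin
  wedgeExpr A 2 X t₁ t₂ t₃ t₄
    ≡⟨ wedgeExpr-cong A 2 X (λ _ → t₁≡0 (λ ())) (λ _ → t₂≡0 (λ ())) (λ _ → t₃≡ refl) (λ _ _ → t₄≡0 (λ ())) ⟩
  wedgeExpr A 2 X 0ℤ 0ℤ (Φ A ℤ.* z) 0ℤ
    ≡⟨ wedgeExpr-polynomial A 2 X _ _ _ _ ⟩
  [ A >0] ℤ.* (1ℤ ℤ.* 0ℤ - [ X >0] ℤ.* 0ℤ) - 1ℤ ℤ.* (1ℤ ℤ.* (Φ A ℤ.* z) - [ X >0] ℤ.* 0ℤ)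
    ≡⟨ solve 4 (λ a x φ z → a :* (con 1ℤ :* con 0ℤ :- x :* con 0ℤ) :- con 1ℤ :* (con 1ℤ :* (φ :* z) :- x :* con 0ℤ)
                          := (:- φ) :* z) refl [ A >0] [ X >0] (Φ A) z ⟩
  (- Φ A) ℤ.* z ∎
  where open ≡-Reasoning
wedgeExpr-value A P@(suc (suc (suc _))) X Φ Ψ z t₁ t₂ t₃ t₄ t₁≡0 _ t₂≡0 _ t₃≡0 _ t₄≡0 _ = begin
  wedgeExpr A P X t₁ t₂ t₃ t₄
    ≡⟨ wedgeExpr-cong A P X (λ _ → t₁≡0 (λ ())) (λ _ → t₂≡0 (λ ())) (λ _ → t₃≡0 (λ ())) (λ _ _ → t₄≡0 (λ ())) ⟩
  wedgeExpr A P X 0ℤ 0ℤ 0ℤ 0ℤ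
    ≡⟨ wedgeExpr-polynomial A P X _ _ _ _ ⟩
  [ A >0] ℤ.* (1ℤ ℤ.* 0ℤ - [ X >0] ℤ.* 0ℤ) - 1ℤ ℤ.* (1ℤ ℤ.* 0ℤ - [ X >0] ℤ.* 0ℤ)
    ≡⟨ solve 3 (λ a x z → a :* (con 1ℤ :* con 0ℤ :- x :* con 0ℤ) :- con 1ℤ :* (con 1ℤ :* con 0ℤ :- x :* con 0ℤ)
                        := con 0ℤ :* z) refl [ A >0] [ X >0] z ⟩
  0ℤ ℤ.* z ∎
  where open ≡-Reasoning

wedge-coeff : ∀ N h p q L (m : Vec ℕ N) (Φ Ψ : ℕ → ℤ) (z : ℤ) →
  h < N → p < N → q < N → h ≢ p → h ≢ q → p ≢ q → Avoids p L → EdgesIn N L →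
  (∀ b → b ≡ h ⊎ b ≡ p → at (decAt p (decAt b m)) p ≡ 0 →
     prodCoeffℕ N L (decAt p (decAt b m)) ≡ Φ (at (decAt p (decAt b m)) h) ℤ.* z) →
  (∀ b → b ≡ h ⊎ b ≡ p → at m q ≢ 0 → at (decAt q (decAt b m)) p ≡ 0 →
     prodCoeffℕ N L (decAt q (decAt b m)) ≡ Ψ (at (decAt q (decAt b m)) h) ℤ.* z) →
  prodCoeffℕ N ((h , p) ∷ (p , q) ∷ L) m ≡ wedgeValue Φ Ψ (at m h) (at m p) (at m q) ℤ.* z
wedge-coeff N h p q L m Φ Ψ z h< p< q< h≢p h≢q p≢q avoid-p inL Φ-spec Ψ-spec =
  trans (prodCoeffℕ-wedge N h p q L m h< p< q< h≢p h≢q p≢q)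
        (wedgeExpr-value (at m h) (at m p) (at m q) Φ Ψ z _ _ _ _
          (used-up p-of-ph) T-ph (used-up p-of-qh) T-qh (used-up p-of-pp) T-pp (used-up p-of-qp) T-qp)
  where
  T : ℕ → ℕ → ℤ
  T a b = prodCoeffℕ N L (decAt a (decAt b m))
  used-up : ∀ {a b ρ} → at (decAt a (decAt b m)) p ≡ ρ → ρ ≢ 0 → T a b ≡ 0ℤ
  used-up refl nz = prodCoeffℕ-isolated N L _ p nz avoid-p inL
  p-of-ph : at (decAt p (decAt h m)) p ≡ pred (at m p)
  p-of-ph = trans (at-decAt-same p (decAt h m)) (cong pred (at-decAt-other h p m h≢p))
  p-of-qh : at (decAt q (decAt h m)) p ≡ at m p
  p-of-qh = at-decAt²-other q h p m (≢-sym p≢q) h≢p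
  p-of-pp : at (decAt p (decAt p m)) p ≡ pred (pred (at m p))
  p-of-pp = trans (at-decAt-same p (decAt p m)) (cong pred (at-decAt-same p m))
  p-of-qp : at (decAt q (decAt p m)) p ≡ pred (at m p)
  p-of-qp = trans (at-decAt-other q p (decAt p m) (≢-sym p≢q)) (at-decAt-same p m)
  h-lowered : ∀ a → a ≢ h → at (decAt a (decAt h m)) h ≡ pred (at m h)
  h-lowered a a≢h = trans (at-decAt-other a h (decAt h m) a≢h) (at-decAt-same h m)
  T-ph : pred (at m p) ≡ 0 → T p h ≡ Φ (pred (at m h)) ℤ.* z
  T-ph e = trans (Φ-spec h (inj₁ refl) (trans p-of-ph e)) (cong (λ a → Φ a ℤ.* z) (h-lowered p (≢-sym h≢p)))
  T-pp : pred (pred (at m p)) ≡ 0 → T p p ≡ Φ (at m h) ℤ.* z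
  T-pp e = trans (Φ-spec p (inj₂ refl) (trans p-of-pp e))
    (cong (λ a → Φ a ℤ.* z) (at-decAt²-other p p h m (≢-sym h≢p) (≢-sym h≢p)))
  T-qh : at m q ≢ 0 → at m p ≡ 0 → T q h ≡ Ψ (pred (at m h)) ℤ.* z
  T-qh X≢0 e = trans (Ψ-spec h (inj₁ refl) X≢0 (trans p-of-qh e)) (cong (λ a → Ψ a ℤ.* z) (h-lowered q (≢-sym h≢q)))
  T-qp : at m q ≢ 0 → pred (at m p) ≡ 0 → T q p ≡ Ψ (at m h) ℤ.* z
  T-qp X≢0 e = trans (Ψ-spec p (inj₂ refl) X≢0 (trans p-of-qp e))
    (cong (λ a → Ψ a ℤ.* z) (at-decAt²-other q p h m (≢-sym h≢q) (≢-sym h≢p)))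

fanValue∷-[]≡wedgeValue : ∀ A P X → fanValue∷ A P [] ≡ wedgeValue δ₁ (λ _ → 0ℤ) A P X
fanValue∷-[]≡wedgeValue A 0 X = sym (cong -_ (trans (cong (whenPos A) (whenPos-0ℤ X)) (whenPos-0ℤ A)))
fanValue∷-[]≡wedgeValue A 1 X = sym (trans (cong (ℤ._+ whenPos A (δ₁ (pred A))) (whenPos-0ℤ X)) (ZP.+-identityˡ _))
fanValue∷-[]≡wedgeValue A 2 X = refl
fanValue∷-[]≡wedgeValue A (suc (suc (suc _))) X = refl

fanValue∷≡wedgeValue : ∀ A P X ys →
  fanValue∷ A P (X ∷ ys) ≡ wedgeValue (λ a → fanValue∷ a X ys) (λ a → fanValue∷ a (pred X) ys) A P X
fanValue∷≡wedgeValue A 0 X ys = refl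
fanValue∷≡wedgeValue A 1 X ys = refl
fanValue∷≡wedgeValue A 2 X ys = refl
fanValue∷≡wedgeValue A (suc (suc (suc _))) X ys = refl

-- Lowering a vertex of S₀ (the hub and the fan vertices already passed) keeps the
-- agreement with m₀, so the induction hypothesis applies to every term of the
-- wedge expansion that leaves p used up.
fan-shift : ∀ N h p (I : List ℕ) lst L R t S₀ (m₀ m : Vec ℕ N) →
  (∀ m′ → AgreeOff S₀ lst m₀ m′ → at m′ lst ≤ t →
     prodCoeffℕ N L m′ ≡ fanValue (at m′ h) (map (at m′) I) ℤ.* prodCoeffℕ N R (clearAll (h ∷ I) m′)) →
  AgreeOff S₀ lst m₀ m → at m lst ≤ t →
  elemᵇ h S₀ ≡ true → elemᵇ p S₀ ≡ true → h ≢ lst → p ≢ lst →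
  ∀ a b → b ≡ h ⊎ b ≡ p → elemᵇ a S₀ ≡ true → elemᵇ a (p ∷ h ∷ I) ≡ true → a ≢ lst →
  at (decAt a (decAt b m)) p ≡ 0 →
  prodCoeffℕ N L (decAt a (decAt b m)) ≡
    fanValue (at (decAt a (decAt b m)) h) (map (at (decAt a (decAt b m))) I) ℤ.* prodCoeffℕ N R (clearAll (h ∷ p ∷ I) m)
fan-shift N h p I lst L R t S₀ m₀ m IH ag le hS pS h≢lst p≢lst a b b∈hp aS aW a≢lst p₀ =
  trans (IH _ (AgreeOff-decAt S₀ lst m₀ (decAt b m) a (inj₁ aS) (AgreeOff-decAt S₀ lst m₀ m b (inj₁ bS) ag))
              (subst (_≤ t) (sym (at-decAt²-other a b lst m a≢lst b≢lst)) le))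
        (cong (λ w → fanValue (at (decAt a (decAt b m)) h) (map (at (decAt a (decAt b m))) I) ℤ.* prodCoeffℕ N R w)
              (clearAll-decAt² h p I a b m aW bW p₀))
  where
  bS : elemᵇ b S₀ ≡ true
  bS = [ (λ { refl → hS }) , (λ { refl → pS }) ]′ b∈hp
  bW : elemᵇ b (p ∷ h ∷ I) ≡ true
  bW = [ (λ { refl → elemᵇ-there h p (h ∷ I) (elemᵇ-here h I) }) , (λ { refl → elemᵇ-here p (h ∷ I) }) ]′ b∈hp
  b≢lst : b ≢ lst
  b≢lst = [ (λ { refl → h≢lst }) , (λ { refl → p≢lst }) ]′ b∈hp

fan-coeff : ∀ N h p rest (R : List (ℕ × ℕ)) t S₀ (m₀ m : Vec ℕ N) →
  h < N → All (_< N) (p ∷ rest) → EdgesIn N R →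
  NotIn h (p ∷ rest) → Distinct (p ∷ rest) →
  Avoids h R → All (λ v → Avoids v R) (dropLast p rest) →
  elemᵇ h S₀ ≡ true → All (λ v → elemᵇ v S₀ ≡ true) (dropLast p rest) →
  (∀ m′ → AgreeOff S₀ (lastOf p rest) m₀ m′ → at m′ (lastOf p rest) < t → prodCoeffℕ N R m′ ≡ 0ℤ) →
  AgreeOff S₀ (lastOf p rest) m₀ m → at m (lastOf p rest) ≤ t →
  prodCoeffℕ N (fanEdges h p rest ++ R) m ≡
    fanValue (at m h) (map (at m) (dropLast p rest)) ℤ.* prodCoeffℕ N R (clearAll (h ∷ dropLast p rest) m)
fan-coeff N h p [] R t S₀ m₀ m h< (p< ∷ []) inR (h≢p ∷ []) _ avh _ hS _ rest-vanishes ag le =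
  fan-coeff-edge N h p R t S₀ m₀ m h< p< inR h≢p avh hS rest-vanishes ag le
fan-coeff N h p (q ∷ []) R t S₀ m₀ m h< (p< ∷ q< ∷ []) inR (h≢p ∷ h≢q ∷ []) ((p≢q ∷ []) , _)
          avh (avp ∷ []) hS (pS ∷ []) rest-vanishes ag le =
  trans (wedge-coeff N h p q L m δ₁ (λ _ → 0ℤ) z h< p< q< h≢p h≢q p≢q avoid-p inL Φ-spec Ψ-spec)
        (cong (λ u → u ℤ.* z) (sym (fanValue∷-[]≡wedgeValue (at m h) (at m p) (at m q))))
  where
  L = (h , q) ∷ R
  z = prodCoeffℕ N R (clearAll (h ∷ p ∷ []) m)
  inL : EdgesIn N L
  inL = (h< , q<) ∷ inR
  avoid-p : Avoids p L
  avoid-p = (h≢p , ≢-sym p≢q) ∷ avp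
  IH : ∀ m′ → AgreeOff S₀ q m₀ m′ → at m′ q ≤ t → prodCoeffℕ N L m′ ≡ δ₁ (at m′ h) ℤ.* prodCoeffℕ N R (clearAll (h ∷ []) m′)
  IH m′ = fan-coeff-edge N h q R t S₀ m₀ m′ h< q< inR h≢q avh hS rest-vanishes
  Φ-spec : ∀ b → b ≡ h ⊎ b ≡ p → at (decAt p (decAt b m)) p ≡ 0 →
    prodCoeffℕ N L (decAt p (decAt b m)) ≡ δ₁ (at (decAt p (decAt b m)) h) ℤ.* z
  Φ-spec b b∈hp = fan-shift N h p [] q L R t S₀ m₀ m IH ag le hS pS h≢q p≢q p b b∈hp pS (elemᵇ-here p (h ∷ [])) p≢q
  Ψ-spec : ∀ b → b ≡ h ⊎ b ≡ p → at m q ≢ 0 → at (decAt q (decAt b m)) p ≡ 0 →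
    prodCoeffℕ N L (decAt q (decAt b m)) ≡ 0ℤ ℤ.* z
  Ψ-spec b b∈hp X≢0 _ =
    trans (IH m′ ag′ (subst (_≤ t) (sym q-of-m′) (pred≤ le)))
    (trans (cong (ℤ._*_ (δ₁ (at m′ h))) (rest-vanishes _ ag″ (subst (_< t) (sym (trans (at-clearAt-other h q m′ h≢q) q-of-m′))
        (pred< X≢0 le))))
    (trans (ZP.*-zeroʳ (δ₁ (at m′ h))) (sym (ZP.*-zeroˡ z))))
    where
    m′ = decAt q (decAt b m)
    b≢q : b ≢ q
    b≢q = [ (λ { refl → h≢q }) , (λ { refl → p≢q }) ]′ b∈hp
    bS : elemᵇ b S₀ ≡ true
    bS = [ (λ { refl → hS }) , (λ { refl → pS }) ]′ b∈hp
    q-of-m′ : at m′ q ≡ pred (at m q)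
    q-of-m′ = trans (at-decAt-same q (decAt b m)) (cong pred (at-decAt-other b q m b≢q))
    ag′ : AgreeOff S₀ q m₀ m′
    ag′ = AgreeOff-decAt S₀ q m₀ (decAt b m) q (inj₂ refl) (AgreeOff-decAt S₀ q m₀ m b (inj₁ bS) ag)
    ag″ : AgreeOff S₀ q m₀ (clearAt h m′)
    ag″ u u∉ u≢q = trans (at-clearAt-other h u m′ (elemᵇ-≢ S₀ u∉ hS)) (ag′ u u∉ u≢q)
fan-coeff N h p (q ∷ r ∷ rs) R t S₀ m₀ m h< (p< ∷ q< ∷ rs<) inR (h≢p ∷ h≢q ∷ h∉rs) ((p≢q ∷ p∉rs) , (q∉rs , dist))
          avh (avp ∷ avI) hS (pS ∷ iS) rest-vanishes ag le =
  trans (wedge-coeff N h p q L m (λ a → fanValue∷ a X ys) (λ a → fanValue∷ a (pred X) ys) z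
           h< p< q< h≢p h≢q p≢q avoid-p inL Φ-spec Ψ-spec)
        (cong (λ u → u ℤ.* z) (sym (fanValue∷≡wedgeValue (at m h) (at m p) X ys)))
  where
  I′ = dropLast r rs
  lst = lastOf r rs
  X = at m q
  ys = map (at m) I′
  L = fanEdges h q (r ∷ rs) ++ R
  z = prodCoeffℕ N R (clearAll (h ∷ p ∷ q ∷ I′) m)
  inL : EdgesIn N L
  inL = ++⁺ (fanEdges-in N h q (r ∷ rs) h< (q< ∷ rs<)) inR
  avoid-p : Avoids p L
  avoid-p = ++⁺ (fanEdges-avoid p h q (r ∷ rs) h≢p (p≢q ∷ p∉rs)) avp
  qS : elemᵇ q S₀ ≡ true
  qS = All.head iS
  IH : ∀ m′ → AgreeOff S₀ lst m₀ m′ → at m′ lst ≤ t →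
    prodCoeffℕ N L m′ ≡ fanValue (at m′ h) (map (at m′) (q ∷ I′)) ℤ.* prodCoeffℕ N R (clearAll (h ∷ q ∷ I′) m′)
  IH m′ = fan-coeff N h q (r ∷ rs) R t S₀ m₀ m′ h< (q< ∷ rs<) inR (h≢q ∷ h∉rs) (q∉rs , dist) avh avI hS iS rest-vanishes
  shift = fan-shift N h p (q ∷ I′) lst L R t S₀ m₀ m IH ag le hS pS (NotIn-lastOf h r rs h∉rs) (NotIn-lastOf p r rs p∉rs)
  b∉J : ∀ {b} → b ≡ h ⊎ b ≡ p → NotIn b I′
  b∉J = [ (λ { refl → NotIn-dropLast h r rs h∉rs }) , (λ { refl → NotIn-dropLast p r rs p∉rs }) ]′
  Φ-spec : ∀ b → b ≡ h ⊎ b ≡ p → at (decAt p (decAt b m)) p ≡ 0 →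
    prodCoeffℕ N L (decAt p (decAt b m)) ≡ fanValue∷ (at (decAt p (decAt b m)) h) X ys ℤ.* z
  Φ-spec b b∈hp p₀ =
    trans (shift p b b∈hp pS (elemᵇ-here p (h ∷ q ∷ I′)) (NotIn-lastOf p r rs p∉rs) p₀)
          (cong (λ xs → fanValue (at (decAt p (decAt b m)) h) xs ℤ.* z)
                (map-at-decAt² p b m (q ∷ I′) (p≢q ∷ NotIn-dropLast p r rs p∉rs) (b≢q ∷ b∉J b∈hp)))
    where b≢q = [ (λ { refl → h≢q }) , (λ { refl → p≢q }) ]′ b∈hp
  Ψ-spec : ∀ b → b ≡ h ⊎ b ≡ p → X ≢ 0 → at (decAt q (decAt b m)) p ≡ 0 →
    prodCoeffℕ N L (decAt q (decAt b m)) ≡ fanValue∷ (at (decAt q (decAt b m)) h) (pred X) ys ℤ.* z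
  Ψ-spec b b∈hp _ p₀ =
    trans (shift q b b∈hp qS (elemᵇ-there q p (h ∷ q ∷ I′) (elemᵇ-there q h (q ∷ I′) (elemᵇ-here q I′)))
                 (NotIn-lastOf q r rs q∉rs) p₀)
          (cong (λ xs → fanValue (at (decAt q (decAt b m)) h) xs ℤ.* z)
                (cong₂ _∷_ (trans (at-decAt-same q (decAt b m)) (cong pred (at-decAt-other b q m b≢q)))
                           (map-at-decAt² q b m I′ (NotIn-dropLast q r rs q∉rs) (b∉J b∈hp))))
    where b≢q = [ (λ { refl → h≢q }) , (λ { refl → p≢q }) ]′ b∈hp

oddLength-map : ∀ (f : ℕ → ℕ) xs → oddLength (map f xs) ≡ oddLength xs
oddLength-map f [] = refl
oddLength-map f (x ∷ xs) = cong not (oddLength-map f xs)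

All-map-at : ∀ {n} (m : Vec ℕ n) xs → All (λ v → at m v ≤ 2) xs → All (_≤ 2) (map (at m) xs)
All-map-at m [] [] = []
All-map-at m (x ∷ xs) (h ∷ hs) = h ∷ All-map-at m xs hs

fan-vanishes : ∀ N h p q qs (R : List (ℕ × ℕ)) t S₀ (m : Vec ℕ N) →
  h < N → All (_< N) (p ∷ q ∷ qs) → EdgesIn N R →
  NotIn h (p ∷ q ∷ qs) → Distinct (p ∷ q ∷ qs) →
  Avoids h R → All (λ v → Avoids v R) (dropLast p (q ∷ qs)) →
  elemᵇ h S₀ ≡ true → All (λ v → elemᵇ v S₀ ≡ true) (dropLast p (q ∷ qs)) →
  (∀ m′ → AgreeOff S₀ (lastOf q qs) m m′ → at m′ (lastOf q qs) < t → prodCoeffℕ N R m′ ≡ 0ℤ) →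
  at m (lastOf q qs) ≤ t →
  at m h ≤ 2 → at m p ≤ 1 → All (λ v → at m v ≤ 2) (dropLast q qs) → oddLength (dropLast q qs) ≡ true →
  prodCoeffℕ N (fanEdges h p (q ∷ qs) ++ R) m ≡ 0ℤ
fan-vanishes N h p q qs R t S₀ m h< ps< inR hn dist avh avI hS iS rest-vanishes le hb pb ib odd =
  trans (fan-coeff N h p (q ∷ qs) R t S₀ m m h< ps< inR hn dist avh avI hS iS rest-vanishes (λ u _ _ → refl) le)
   (trans (cong (λ z → z ℤ.* prodCoeffℕ N R (clearAll (h ∷ dropLast p (q ∷ qs)) m))
        (fanValue-vanishes (at m h) (at m p) (map (at m) (dropLast q qs)) hb pb (All-map-at m _ ib)
           (trans (oddLength-map (at m) (dropLast q qs)) odd)))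
     refl)

decAtAll : ∀ {n} → List ℕ → Vec ℕ n → Vec ℕ n
decAtAll [] m = m
decAtAll (r ∷ rs) m = decAt r (decAtAll rs m)

decAtAll-decAt : ∀ {n} rs r (m : Vec ℕ n) → decAtAll rs (decAt r m) ≡ decAt r (decAtAll rs m)
decAtAll-decAt [] r m = refl
decAtAll-decAt (x ∷ rs) r m = trans (cong (decAt x) (decAtAll-decAt rs r m)) (decAt-comm x r _)

at-decAt : ∀ {n} v u (m : Vec ℕ n) → at (decAt v m) u ≡ at m u ∸ (if u ≡ᵇ v then 1 else 0)
at-decAt v u m with u ≟ v
... | yes refl rewrite ≡ᵇ-refl u = at-decAt-same u m
... | no u≢v with u ≡ᵇ v in eq
...   | true = ⊥-elim (u≢v (≡ᵇ-true⇒≡ u v eq))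
...   | false = at-decAt-other v u m (λ e → u≢v (sym e))

opaque
  count : ℕ → List ℕ → ℕ
  count u [] = 0
  count u (x ∷ xs) = if u ≡ᵇ x then suc (count u xs) else count u xs

  count-miss : ∀ u x xs → x ≢ u → count u (x ∷ xs) ≡ count u xs
  count-miss u x xs n with u ≡ᵇ x in eq
  ... | true = ⊥-elim (n (sym (≡ᵇ-true⇒≡ u x eq)))
  ... | false = refl

  count-nil : ∀ u → count u [] ≡ 0
  count-nil u = refl

  at-decAtAll : ∀ {n} rs u (m : Vec ℕ n) → at (decAtAll rs m) u ≡ at m u ∸ count u rs
  at-decAtAll [] u m = refl
  at-decAtAll (r ∷ rs) u m = trans (at-decAt r u (decAtAll rs m)) (trans
      (cong (_∸ (if u ≡ᵇ r then 1 else 0)) (at-decAtAll rs u m)) (aux (u ≡ᵇ r)))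
    where
    aux : ∀ b → at m u ∸ count u rs ∸ (if b then 1 else 0) ≡ at m u ∸ (if b then suc (count u rs) else count u rs)
    aux true = trans (NP.∸-+-assoc (at m u) (count u rs) 1) (cong (at m u ∸_) (NP.+-comm (count u rs) 1))
    aux false = refl

  count-step : ∀ {n} rs r (m : Vec ℕ n) → at m r ≢ 0 → (∀ u → count u rs ≤ at (decAt r m) u) → ∀ u → count u (r ∷ rs) ≤ at m u
  count-step rs r m nz h u with u ≟ r
  ... | yes refl rewrite ≡ᵇ-refl u =
     NP.≤-trans (s≤s (subst (count u rs ≤_) (at-decAt-same u m) (h u))) (NP.≤-reflexive (NP.suc-pred (at m u) {{N.≢-nonZero nz}}))
  ... | no u≢r with u ≡ᵇ r in eq
  ...   | true = ⊥-elim (u≢r (≡ᵇ-true⇒≡ u r eq))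
  ...   | false = subst (count u rs ≤_) (at-decAt-other r u m (λ e → u≢r (sym e))) (h u)

  count-tail : ∀ u x xs → count u xs ≤ count u (x ∷ xs)
  count-tail u x xs with u ≡ᵇ x
  ... | true = NP.n≤1+n _
  ... | false = NP.≤-refl

  count-hit : ∀ u x xs → x ≡ u → count u (x ∷ xs) ≡ suc (count u xs)
  count-hit u .u xs refl rewrite ≡ᵇ-refl u = refl

data Forcing (Sd : List ℕ) : List (ℕ × ℕ) → List ℕ → Set where
  fnil : Forcing Sd [] []
  fwd : ∀ {s r es rs} → elemᵇ s Sd ≡ true → elemᵇ r Sd ≡ false → Forcing Sd es rs → Forcing Sd ((s , r) ∷ es) (r ∷ rs)
  bwd : ∀ {s r es rs} → elemᵇ s Sd ≡ true → elemᵇ r Sd ≡ false → Forcing Sd es rs → Forcing Sd ((r , s) ∷ es) (r ∷ rs)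

forced-vanishes : ∀ N Sd Fo rs R (m : Vec ℕ N) → Forcing Sd Fo rs → EdgesIn N Fo →
  (∀ s → elemᵇ s Sd ≡ true → at m s ≡ 0) →
  ((∀ u → count u rs ≤ at m u) → prodCoeffℕ N R (decAtAll rs m) ≡ 0ℤ) →
  prodCoeffℕ N (Fo ++ R) m ≡ 0ℤ
forced-vanishes N Sd [] [] R m fnil _ hs H = H (λ u → subst (_≤ at m u) (sym (count-nil u)) z≤n)
forced-vanishes N Sd ((s , r) ∷ es) (r ∷ rs) R m (fwd ms mr fl) ((s< , r<) ∷ ins) hs H =
  trans (prodCoeffℕ-∷ N s r _ s< r< m)
   (edgeCoeff-zero s r (prodCoeffℕ N (es ++ R)) m (λ nz → ⊥-elim (nz (hs s ms)))
     (λ nz → forced-vanishes N Sd es rs R (decAt r m) fl ins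
        (λ s′ ms′ → trans (at-decAt-other r s′ m (≢-sym (elemᵇ-≢ Sd mr ms′))) (hs s′ ms′))
        (λ cnts → trans (cong (prodCoeffℕ N R) (decAtAll-decAt rs r m)) (H (count-step rs r m nz cnts)))))
forced-vanishes N Sd ((r , s) ∷ es) (r ∷ rs) R m (bwd ms mr fl) ((r< , s<) ∷ ins) hs H =
  trans (prodCoeffℕ-∷ N r s _ r< s< m)
   (edgeCoeff-zero r s (prodCoeffℕ N (es ++ R)) m
     (λ nz → forced-vanishes N Sd es rs R (decAt r m) fl ins
        (λ s′ ms′ → trans (at-decAt-other r s′ m (≢-sym (elemᵇ-≢ Sd mr ms′))) (hs s′ ms′))
        (λ cnts → trans (cong (prodCoeffℕ N R) (decAtAll-decAt rs r m)) (H (count-step rs r m nz cnts))))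
     (λ nz → ⊥-elim (nz (hs s ms))))

data Chain : ℕ → List ℕ → List (ℕ × ℕ) → Set where
  cnil : ∀ {y₀} → Chain y₀ [] []
  cfw : ∀ {y₀ y₁ ys L} → Chain y₁ ys L → Chain y₀ (y₁ ∷ ys) ((y₁ , y₀) ∷ L)
  cbw : ∀ {y₀ y₁ ys L} → Chain y₁ ys L → Chain y₀ (y₁ ∷ ys) ((y₀ , y₁) ∷ L)

≤1-nz : ∀ {x} → x ≤ 1 → x ≢ 0 → pred x ≡ 0
≤1-nz {zero} _ nz = ⊥-elim (nz refl)
≤1-nz {suc zero} _ _ = refl
≤1-nz {suc (suc x)} (s≤s ()) _

All-at-dec : ∀ {n} v (m : Vec ℕ n) xs → NotIn v xs → All (λ u → at m u ≤ 1) xs → All (λ u → at (decAt v m) u ≤ 1) xs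
All-at-dec v m [] _ [] = []
All-at-dec v m (x ∷ xs) (h ∷ hs) (b ∷ bs) = subst (_≤ 1) (sym (at-decAt-other v x m h)) b ∷ All-at-dec v m xs hs bs

chain-vanishes : ∀ N y₀ y₁ ys L R Ex₀ (m₀ m : Vec ℕ N) → Chain y₀ (y₁ ∷ ys) L → EdgesIn N L →
  Distinct (y₀ ∷ y₁ ∷ ys) → All (λ v → elemᵇ v Ex₀ ≡ true) (dropLast y₁ ys) →
  at m y₀ ≡ 0 → All (λ v → at m v ≤ 1) (dropLast y₁ ys) →
  AgreeOff Ex₀ (lastOf y₁ ys) m₀ m → at m (lastOf y₁ ys) ≡ at m₀ (lastOf y₁ ys) →
  (∀ m′ → AgreeOff Ex₀ (lastOf y₁ ys) m₀ m′ → at m′ (lastOf y₁ ys) < at m₀ (lastOf y₁ ys) → prodCoeffℕ N R m′ ≡ 0ℤ) →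
  prodCoeffℕ N (L ++ R) m ≡ 0ℤ
chain-vanishes N y₀ y₁ [] ((y₁ , y₀) ∷ []) R Ex₀ m₀ m (cfw cnil) ((a< , b<) ∷ []) _ _ z₀ _ ag eq H =
  trans (prodCoeffℕ-∷ N y₁ y₀ R a< b< m)
   (edgeCoeff-zero y₁ y₀ (prodCoeffℕ N R) m
     (λ nz → H (decAt y₁ m) (AgreeOff-decAt Ex₀ y₁ m₀ m y₁ (inj₂ refl) ag)
        (subst (_< at m₀ y₁) (sym (at-decAt-same y₁ m)) (pred< nz (NP.≤-reflexive eq))))
     (λ nz → ⊥-elim (nz z₀)))
chain-vanishes N y₀ y₁ [] ((y₀ , y₁) ∷ []) R Ex₀ m₀ m (cbw cnil) ((a< , b<) ∷ []) _ _ z₀ _ ag eq H =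
  trans (prodCoeffℕ-∷ N y₀ y₁ R a< b< m)
   (edgeCoeff-zero y₀ y₁ (prodCoeffℕ N R) m
     (λ nz → ⊥-elim (nz z₀))
     (λ nz → H (decAt y₁ m) (AgreeOff-decAt Ex₀ y₁ m₀ m y₁ (inj₂ refl) ag)
        (subst (_< at m₀ y₁) (sym (at-decAt-same y₁ m)) (pred< nz (NP.≤-reflexive eq)))))
chain-vanishes N y₀ y₁ (y₂ ∷ ys) ((y₁ , y₀) ∷ L) R Ex₀ m₀ m (cfw c) ((a< , b<) ∷ ins) (_ , (n1 , d)) (e1 ∷ es) z₀
    (b1 ∷ bs) ag eq H =
  trans (prodCoeffℕ-∷ N y₁ y₀ (L ++ R) a< b< m)
   (edgeCoeff-zero y₁ y₀ (prodCoeffℕ N (L ++ R)) m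
     (λ nz → chain-vanishes N y₁ y₂ ys L R Ex₀ m₀ (decAt y₁ m) c ins (n1 , d) es
        (trans (at-decAt-same y₁ m) (≤1-nz b1 nz))
        (All-at-dec y₁ m _ (NotIn-dropLast y₁ y₂ ys n1) bs)
        (AgreeOff-decAt Ex₀ (lastOf y₂ ys) m₀ m y₁ (inj₁ e1) ag)
        (trans (at-decAt-other y₁ _ m (NotIn-lastOf y₁ y₂ ys n1)) eq) H)
     (λ nz → ⊥-elim (nz z₀)))
chain-vanishes N y₀ y₁ (y₂ ∷ ys) ((y₀ , y₁) ∷ L) R Ex₀ m₀ m (cbw c) ((a< , b<) ∷ ins) (_ , (n1 , d)) (e1 ∷ es) z₀
    (b1 ∷ bs) ag eq H =
  trans (prodCoeffℕ-∷ N y₀ y₁ (L ++ R) a< b< m)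
   (edgeCoeff-zero y₀ y₁ (prodCoeffℕ N (L ++ R)) m
     (λ nz → ⊥-elim (nz z₀))
     (λ nz → chain-vanishes N y₁ y₂ ys L R Ex₀ m₀ (decAt y₁ m) c ins (n1 , d) es
        (trans (at-decAt-same y₁ m) (≤1-nz b1 nz))
        (All-at-dec y₁ m _ (NotIn-dropLast y₁ y₂ ys n1) bs)
        (AgreeOff-decAt Ex₀ (lastOf y₂ ys) m₀ m y₁ (inj₁ e1) ag)
        (trans (at-decAt-other y₁ _ m (NotIn-lastOf y₁ y₂ ys n1)) eq) H))

data Reorient : List (ℕ × ℕ) → List (ℕ × ℕ) → Set where
  [] : Reorient [] []
  keep : ∀ {e L L′} → Reorient L L′ → Reorient (e ∷ L) (e ∷ L′)
  flip : ∀ {a b L L′} → Reorient L L′ → Reorient ((a , b) ∷ L) ((b , a) ∷ L′)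

reorient-scale : ∀ N L L′ R → Reorient L L′ → EdgesIn N L →
  Σ ℤ (λ s → ∀ m → prodCoeffℕ N (L ++ R) m ≡ s ℤ.* prodCoeffℕ N (L′ ++ R) m)
reorient-scale N [] [] R [] [] = 1ℤ , λ m → sym (ZP.*-identityˡ _)
reorient-scale N ((a , b) ∷ L) ((a , b) ∷ L′) R (keep f) ((a< , b<) ∷ ins) with reorient-scale N L L′ R f ins
... | s , h = s , λ m →
  trans (prodCoeffℕ-∷ N a b (L ++ R) a< b< m)
  (trans (edgeCoeff-scale a b s _ _ h m)
   (cong (ℤ._*_ s) (sym (prodCoeffℕ-∷ N a b (L′ ++ R) a< b< m))))
reorient-scale N ((a , b) ∷ L) ((b , a) ∷ L′) R (flip f) ((a< , b<) ∷ ins) with reorient-scale N L L′ R f ins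
... | s , h = - s , λ m →
  trans (prodCoeffℕ-∷ N a b (L ++ R) a< b< m)
  (trans (edgeCoeff-swap-scale b a s _ _ h m)
   (cong (ℤ._*_ (- s)) (sym (prodCoeffℕ-∷ N b a (L′ ++ R) b< a< m))))

reorient-vanishes : ∀ N L L′ R (m : Vec ℕ N) → Reorient L L′ → EdgesIn N L →
  prodCoeffℕ N (L′ ++ R) m ≡ 0ℤ → prodCoeffℕ N (L ++ R) m ≡ 0ℤ
reorient-vanishes N L L′ R m f ins z with reorient-scale N L L′ R f ins
... | s , h = trans (h m) (trans (cong (ℤ._*_ s) z) (ZP.*-zeroʳ s))

elemᵇ-∷⁻ : ∀ s x xs → elemᵇ s (x ∷ xs) ≡ true → s ≡ x ⊎ elemᵇ s xs ≡ true
elemᵇ-∷⁻ s x xs h with s ≡ᵇ x in eq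
... | true = inj₁ (≡ᵇ-true⇒≡ s x eq)
... | false = inj₂ h

at-decAtAll-≤ : ∀ {n} rs u (m : Vec ℕ n) k B → k ≤ count u rs → at m u ≤ B → at (decAtAll rs m) u ≤ B ∸ k
at-decAtAll-≤ rs u m k B kc b = subst (_≤ B ∸ k) (sym (at-decAtAll rs u m))
  (NP.≤-trans (NP.∸-monoʳ-≤ (at m u) kc) (NP.∸-monoˡ-≤ k b))

at-decAtAll-≤-at : ∀ {n} rs u (m : Vec ℕ n) → at (decAtAll rs m) u ≤ at m u
at-decAtAll-≤-at rs u m = subst (_≤ at m u) (sym (at-decAtAll rs u m)) (NP.m∸n≤m (at m u) (count u rs))

count-there : ∀ {u x xs k} → k ≤ count u xs → k ≤ count u (x ∷ xs)
count-there {u} {x} {xs} h = NP.≤-trans h (count-tail u x xs)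

count-here : ∀ {u x xs k} → x ≡ u → k ≤ count u xs → suc k ≤ count u (x ∷ xs)
count-here {u} {x} {xs} e h = subst (_ ≤_) (sym (count-hit u x xs e)) (s≤s h)

at-decAt-≤ : ∀ {n} v u (m : Vec ℕ n) → at (decAt v m) u ≤ at m u
at-decAt-≤ v u m = subst (_≤ at m u) (sym (at-decAt v u m)) (NP.m∸n≤m (at m u) (if u ≡ᵇ v then 1 else 0))

pathEdges : ℕ → ℕ → List (ℕ × ℕ)
pathEdges s zero = []
pathEdges s (suc c) = (s , suc s) ∷ pathEdges (suc s) c

spokes : ℕ → ℕ → ℕ → List (ℕ × ℕ)
spokes h s zero = []
spokes h s (suc c) = (h , s) ∷ spokes h (suc s) c

pathSpokes-↭-fanEdges : ∀ h s c → pathEdges s c ++ spokes h s (suc c) ↭ fanEdges h s (range (suc s) c)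
pathSpokes-↭-fanEdges h s zero = ↭-refl
pathSpokes-↭-fanEdges h s (suc c) =
  ↭-trans (Perm.prep (s , suc s) (PP.shift (h , s) (pathEdges (suc s) c) (spokes h (suc s) (suc c))))
  (↭-trans (Perm.swap (s , suc s) (h , s) ↭-refl)
   (Perm.prep (h , s) (Perm.prep (s , suc s) (pathSpokes-↭-fanEdges h (suc s) c))))

fanEdgesRev : ℕ → ℕ → List ℕ → List (ℕ × ℕ)
fanEdgesRev h p [] = (h , p) ∷ []
fanEdgesRev h p (q ∷ qs) = (h , p) ∷ (q , p) ∷ fanEdgesRev h q qs

fanEdgesRev-reorient : ∀ h p rest → Reorient (fanEdgesRev h p rest) (fanEdges h p rest)
fanEdgesRev-reorient h p [] = keep []
fanEdgesRev-reorient h p (q ∷ qs) = keep (flip (fanEdgesRev-reorient h q qs))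

rangeDesc : ℕ → ℕ → List ℕ
rangeDesc s zero = []
rangeDesc s (suc c) = (s + c) ∷ rangeDesc s c

pathEdges-snoc : ∀ s c → pathEdges s (suc c) ≡ pathEdges s c ++ [ (s + c , s + suc c) ]
pathEdges-snoc s zero = cong (λ x → (x , suc x) ∷ []) (sym (NP.+-identityʳ s)) ▸ cong (λ y → (s + 0 , y) ∷ [])
    (sym (NP.+-suc s 0))
  where _▸_ = trans
pathEdges-snoc s (suc c) = cong ((s , suc s) ∷_) (trans (pathEdges-snoc (suc s) c)
  (cong₂ (λ x y → pathEdges (suc s) c ++ [ (x , y) ]) (sym (NP.+-suc s c)) (sym (NP.+-suc s (suc c)))))

spokes-snoc : ∀ h s c → spokes h s (suc c) ≡ spokes h s c ++ [ (h , s + c) ]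
spokes-snoc h s zero = cong (λ x → (h , x) ∷ []) (sym (NP.+-identityʳ s))
spokes-snoc h s (suc c) = cong ((h , s) ∷_) (trans (spokes-snoc h (suc s) c)
  (cong (λ x → spokes h (suc s) c ++ [ (h , x) ]) (sym (NP.+-suc s c))))

pathSpokes-↭-fanEdgesRev : ∀ h s c → pathEdges s c ++ spokes h s (suc c) ↭ fanEdgesRev h (s + c) (rangeDesc s c)
pathSpokes-↭-fanEdgesRev h s zero = ↭-reflexive (cong (λ x → (h , x) ∷ []) (sym (NP.+-identityʳ s)))
pathSpokes-↭-fanEdgesRev h s (suc c) =
  ↭-trans (↭-reflexive (cong₂ _++_ (pathEdges-snoc s c) (spokes-snoc h s (suc c))))
  (↭-trans (↭-reflexive (++-assoc (pathEdges s c) [ E1 ] (spokes h s (suc c) ++ [ E2 ])))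
  (↭-trans (PP.shift E1 (pathEdges s c) (spokes h s (suc c) ++ [ E2 ]))
  (↭-trans (Perm.prep E1 (↭-trans (↭-reflexive (sym (++-assoc (pathEdges s c) (spokes h s (suc c)) [ E2 ])))
                                (PP.++-comm (pathEdges s c ++ spokes h s (suc c)) [ E2 ])))
  (↭-trans (Perm.swap E1 E2 ↭-refl)
   (Perm.prep E2 (Perm.prep E1 (pathSpokes-↭-fanEdgesRev h s c)))))))
  where
  E1 = (s + c , s + suc c)
  E2 = (h , s + suc c)

≡ᵇ-false : ∀ u v → u ≢ v → (u ≡ᵇ v) ≡ false
≡ᵇ-false zero zero h = ⊥-elim (h refl)
≡ᵇ-false zero (suc v) h = refl
≡ᵇ-false (suc u) zero h = refl
≡ᵇ-false (suc u) (suc v) h = ≡ᵇ-false u v (λ e → h (cong suc e))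

elemᵇ-false : ∀ v xs → NotIn v xs → elemᵇ v xs ≡ false
elemᵇ-false v [] _ = refl
elemᵇ-false v (x ∷ xs) (h ∷ hs) rewrite ≡ᵇ-false v x h = elemᵇ-false v xs hs

elemᵇ-self : ∀ xs → All (λ v → elemᵇ v xs ≡ true) xs
elemᵇ-self [] = []
elemᵇ-self (x ∷ xs) = elemᵇ-here x xs ∷ All.map (λ {v} h → elemᵇ-there v x xs h) (elemᵇ-self xs)

range-All : ∀ {P : ℕ → Set} s c → (∀ j → s ≤ j → j < s + c → P j) → All P (range s c)
range-All s zero h = []
range-All {P} s (suc c) h = h s NP.≤-refl (NP.m<m+n s (s≤s z≤n)) ∷
  range-All (suc s) c (λ j l u → h j (NP.≤-trans (NP.n≤1+n s) l) (subst (j <_) (sym (NP.+-suc s c)) u))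

rangeDesc-All : ∀ {P : ℕ → Set} s c → (∀ j → s ≤ j → j < s + c → P j) → All P (rangeDesc s c)
rangeDesc-All s zero h = []
rangeDesc-All s (suc c) h = h (s + c) (NP.m≤m+n s c) (subst (s + c <_) (sym (NP.+-suc s c)) NP.≤-refl) ∷
  rangeDesc-All s c (λ j l u → h j l (NP.<-trans u (subst (s + c <_) (sym (NP.+-suc s c)) NP.≤-refl)))

lastOf-range : ∀ s c → lastOf s (range (suc s) c) ≡ s + c
lastOf-range s zero = sym (NP.+-identityʳ s)
lastOf-range s (suc c) = trans (lastOf-range (suc s) c) (sym (NP.+-suc s c))

dropLast-range : ∀ s c → dropLast s (range (suc s) c) ≡ range s c
dropLast-range s zero = refl
dropLast-range s (suc c) = cong (s ∷_) (dropLast-range (suc s) c)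

lastOf-rangeDesc : ∀ s c → lastOf (s + c) (rangeDesc s c) ≡ s
lastOf-rangeDesc s zero = NP.+-identityʳ s
lastOf-rangeDesc s (suc c) = lastOf-rangeDesc s c

dropLast-rangeDesc : ∀ s c → dropLast (s + c) (rangeDesc s c) ≡ rangeDesc (suc s) c
dropLast-rangeDesc s zero = refl
dropLast-rangeDesc s (suc c) = cong₂ _∷_ (NP.+-suc s c) (dropLast-rangeDesc s c)

Distinct-range : ∀ s c → Distinct (range s c)
Distinct-range s zero = _
Distinct-range s (suc c) = range-All (suc s) c (λ j l _ → λ e → NP.<-irrefl e l) , Distinct-range (suc s) c

Distinct-rangeDesc : ∀ s c → Distinct (rangeDesc s c)
Distinct-rangeDesc s zero = _
Distinct-rangeDesc s (suc c) = rangeDesc-All s c (λ j _ u → λ e → NP.<-irrefl (sym e) u) , Distinct-rangeDesc s c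

oddᵇ : ℕ → Bool
oddᵇ zero = false
oddᵇ (suc zero) = true
oddᵇ (suc (suc n)) = oddᵇ n

oddLength-range : ∀ s c → oddLength (range s c) ≡ oddᵇ c
oddLength-range s zero = refl
oddLength-range s (suc zero) = refl
oddLength-range s (suc (suc c)) = trans (not-involutive (oddLength (range (suc (suc s)) c))) (oddLength-range (suc (suc s)) c)

oddLength-rangeDesc : ∀ s c → oddLength (rangeDesc s c) ≡ oddᵇ c
oddLength-rangeDesc s zero = refl
oddLength-rangeDesc s (suc zero) = refl
oddLength-rangeDesc s (suc (suc c)) = trans (not-involutive (oddLength (rangeDesc s c))) (oddLength-rangeDesc s c)

oddᵇ-¬2∣ : ∀ n → ¬ (2 ∣ n) → oddᵇ n ≡ true
oddᵇ-¬2∣ zero h = ⊥-elim (h (divides 0 refl))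
oddᵇ-¬2∣ (suc zero) h = refl
oddᵇ-¬2∣ (suc (suc n)) h = oddᵇ-¬2∣ n (λ { (divides q e) → h (divides (suc q) (cong (λ x → suc (suc x)) e)) })

count-++ʳ : ∀ u xs ys → count u ys ≤ count u (xs ++ ys)
count-++ʳ u [] ys = NP.≤-refl
count-++ʳ u (x ∷ xs) ys = NP.≤-trans (count-++ʳ u xs ys) (count-tail u x (xs ++ ys))

count-++ˡ : ∀ u xs ys → count u xs ≤ count u (xs ++ ys)
count-++ˡ u [] ys = subst (_≤ count u ys) (sym (count-nil u)) z≤n
count-++ˡ u (x ∷ xs) ys with x ≟ u
... | yes e = subst₂ _≤_ (sym (count-hit u x xs e)) (sym (count-hit u x (xs ++ ys) e)) (s≤s (count-++ˡ u xs ys))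
... | no n = subst₂ _≤_ (sym (count-miss u x xs n)) (sym (count-miss u x (xs ++ ys) n)) (count-++ˡ u xs ys)

count-range : ∀ j s c → s ≤ j → j < s + c → 1 ≤ count j (range s c)
count-range j s zero l u = ⊥-elim (NP.<-irrefl refl (NP.≤-<-trans l (subst (j <_) (NP.+-identityʳ s) u)))
count-range j s (suc c) l u with s ≟ j
... | yes e = count-here e z≤n
... | no n = count-there (count-range j (suc s) c (NP.≤∧≢⇒< l n) (subst (j <_) (NP.+-suc s c) u))

Forcing-++ : ∀ {Sd F1 F2 r1 r2} → Forcing Sd F1 r1 → Forcing Sd F2 r2 → Forcing Sd (F1 ++ F2) (r1 ++ r2)
Forcing-++ fnil g = g
Forcing-++ (fwd x y f) g = fwd x y (Forcing-++ f g)
Forcing-++ (bwd x y f) g = bwd x y (Forcing-++ f g)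

Forcing-spokes : ∀ Sd h s c → elemᵇ h Sd ≡ true → (∀ j → s ≤ j → j < s + c → elemᵇ j Sd ≡ false) → Forcing Sd (spokes h s c)
    (range s c)
Forcing-spokes Sd h s zero mh _ = fnil
Forcing-spokes Sd h s (suc c) mh nj = fwd mh (nj s NP.≤-refl (NP.m<m+n s (s≤s z≤n)))
  (Forcing-spokes Sd h (suc s) c mh (λ j l u → nj j (NP.≤-trans (NP.n≤1+n s) l) (subst (j <_) (sym (NP.+-suc s c)) u)))

pathEdgesRev : ℕ → ℕ → List (ℕ × ℕ)
pathEdgesRev s zero = []
pathEdgesRev s (suc c) = (s + c , s + suc c) ∷ pathEdgesRev s c

pathEdges-↭-rev : ∀ s c → pathEdges s c ↭ pathEdgesRev s c
pathEdges-↭-rev s zero = ↭-refl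
pathEdges-↭-rev s (suc c) = ↭-trans (↭-reflexive (pathEdges-snoc s c))
  (↭-trans (PP.++-comm (pathEdges s c) ((s + c , s + suc c) ∷ [])) (Perm.prep _ (pathEdges-↭-rev s c)))

chain-pathEdgesRev : ∀ s c → Chain (s + c) (rangeDesc s c) (pathEdgesRev s c)
chain-pathEdgesRev s zero = cnil
chain-pathEdgesRev s (suc c) = cfw (chain-pathEdgesRev s c)

chain-pathEdges : ∀ s c → Chain s (range (suc s) c) (pathEdges s c)
chain-pathEdges s zero = cnil
chain-pathEdges s (suc c) = cbw (chain-pathEdges (suc s) c)

count-++ : ∀ u xs ys → count u (xs ++ ys) ≡ count u xs + count u ys
count-++ u [] ys = cong (_+ count u ys) (sym (count-nil u))
count-++ u (x ∷ xs) ys with x ≟ u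
... | yes e = trans (count-hit u x (xs ++ ys) e) (trans (cong suc (count-++ u xs ys))
    (cong (_+ count u ys) (sym (count-hit u x xs e))))
... | no n = trans (count-miss u x (xs ++ ys) n) (trans (count-++ u xs ys) (cong (_+ count u ys) (sym (count-miss u x xs n))))

deleteEdge-keep : ∀ e x xs → sameEdge e x ≡ false → deleteEdge e (x ∷ xs) ≡ x ∷ deleteEdge e xs
deleteEdge-keep e x xs h rewrite h = refl

deleteEdge-drop : ∀ e x xs → sameEdge e x ≡ true → deleteEdge e (x ∷ xs) ≡ deleteEdge e xs
deleteEdge-drop e x xs h rewrite h = refl

deleteEdge-++ : ∀ e xs ys → deleteEdge e (xs ++ ys) ≡ deleteEdge e xs ++ deleteEdge e ys
deleteEdge-++ e xs ys = filter-++ _ xs ys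

deleteEdge-pathEdges : ∀ x s c → deleteEdge (0 , x) (pathEdges (suc s) c) ≡ pathEdges (suc s) c
deleteEdge-pathEdges x s zero = refl
deleteEdge-pathEdges x s (suc c) = cong ((suc s , suc (suc s)) ∷_) (deleteEdge-pathEdges x (suc s) c)

deleteEdge-spokes : ∀ x h s c → deleteEdge (0 , x) (spokes (suc h) (suc s) c) ≡ spokes (suc h) (suc s) c
deleteEdge-spokes x h s zero = refl
deleteEdge-spokes x h s (suc c) = cong ((suc h , suc s) ∷_) (deleteEdge-spokes x h (suc s) c)

deleteEdge-spokes₀ : ∀ x s c → (∀ j → suc s ≤ j → j < suc s + c → x ≢ j) → deleteEdge (0 , x) (spokes 0 (suc s) c) ≡ spokes 0
    (suc s) c
deleteEdge-spokes₀ x s zero h = refl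
deleteEdge-spokes₀ x s (suc c) h =
  trans (deleteEdge-keep (0 , x) (0 , suc s) _ (trans (cong (_∨ false)
      (≡ᵇ-false x (suc s) (h (suc s) NP.≤-refl (s≤s (subst (suc s ≤_) (sym (NP.+-suc s c)) (s≤s (NP.m≤m+n s c))))))) refl))
   (cong ((0 , suc s) ∷_) (deleteEdge-spokes₀ x (suc s) c (λ j l u → h j (NP.≤-trans (NP.n≤1+n (suc s)) l)
       (subst (j <_) (cong suc (sym (NP.+-suc s c))) u))))

map-g₁-path : ∀ s c → map (λ j → j ∸ 1 , suc j ∸ 1) (range (suc s) c) ≡ pathEdges s c
map-g₁-path s zero = refl
map-g₁-path s (suc c) = cong ((s , suc s) ∷_) (map-g₁-path (suc s) c)

map-g₁-spokes : ∀ h s c → map (λ j → h , j ∸ 1) (range (suc s) c) ≡ spokes h s c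
map-g₁-spokes h s zero = refl
map-g₁-spokes h s (suc c) = cong ((h , s) ∷_) (map-g₁-spokes h (suc s) c)

g₂ : ℕ → ℕ → ℕ
g₂ a = g₂label (suc (suc (suc a)))

map-g₂-path : ∀ a t c → map (λ j → g₂ a j , g₂ a (suc j)) (range (suc (suc t)) c) ≡ pathEdges (a + suc (suc t)) c
map-g₂-path a t zero = refl
map-g₂-path a t (suc c) = cong₂ _∷_ (cong (a + suc (suc t) ,_) (NP.+-suc a (suc (suc t))))
  (trans (map-g₂-path a (suc t) c) (cong (λ x → pathEdges x c) (NP.+-suc a (suc (suc t)))))

map-g₂-spokes : ∀ a h t c → map (λ j → h , g₂ a j) (range (suc (suc t)) c) ≡ spokes h (a + suc (suc t)) c
map-g₂-spokes a h t zero = refl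
map-g₂-spokes a h t (suc c) = cong ((h , a + suc (suc t)) ∷_)
  (trans (map-g₂-spokes a h (suc t) c) (cong (λ x → spokes h x c) (NP.+-suc a (suc (suc t)))))

wheel₁-ordinary : ∀ a K → wheelEdges ordinary (suc (suc (suc a))) g₁label K ≡
  (0 , 1) ∷ (1 , 2) ∷ pathEdges 2 a ++ (suc (suc a) , 0) ∷ (K , 0) ∷ (K , 1) ∷ spokes K 2 (suc a)
wheel₁-ordinary a K = cong₂ _++_ (map-g₁-path 0 (suc (suc a))) (cong ((suc (suc a) , 0) ∷_)
    (map-g₁-spokes K 0 (suc (suc (suc a)))))

wheel₁-broken : ∀ a K → wheelEdges broken (suc (suc (suc a))) g₁label K ≡ pathEdges 1 (suc a) ++ (0 , 1) ∷ spokes 0 2 (suc a)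
wheel₁-broken a K = cong₂ _++_ (map-g₁-path 1 (suc a)) (map-g₁-spokes 0 1 (suc (suc a)))

a+3+b : ∀ a b → a + suc (suc (suc b)) ≡ suc (suc (suc (a + b)))
a+3+b a b = trans (NP.+-suc a (suc (suc b))) (cong suc (trans (NP.+-suc a (suc b)) (cong suc (NP.+-suc a b))))

wheel₂-ordinary : ∀ a b H → wheelEdges ordinary (suc (suc (suc b))) (g₂ a) H ≡
  (0 , suc (suc a)) ∷ pathEdges (suc (suc a)) (suc b) ++ (suc (suc (suc (a + b))) , 0) ∷ (H , 0) ∷ spokes H (suc (suc a))
      (suc (suc b))
wheel₂-ordinary a b H = cong₂ _++_
  (cong₂ _∷_ (cong (0 ,_) (NP.+-comm a 2)) (trans (map-g₂-path a 0 (suc b)) (cong (λ x → pathEdges x (suc b)) (NP.+-comm a 2))))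
  (cong₂ _∷_ (cong (_, 0) (a+3+b a b)) (cong ((H , 0) ∷_) (trans (map-g₂-spokes a H 0 (suc (suc b)))
      (cong (λ x → spokes H x (suc (suc b))) (NP.+-comm a 2)))))

wheel₂-broken : ∀ a b H → wheelEdges broken (suc (suc (suc b))) (g₂ a) H ≡
  pathEdges (suc (suc a)) (suc b) ++ (0 , suc (suc a)) ∷ spokes 0 (suc (suc (suc a))) b ++ [ (0 , suc (suc (suc (a + b)))) ]
wheel₂-broken a b H = cong₂ _++_ (trans (map-g₂-path a 0 (suc b)) (cong (λ x → pathEdges x (suc b)) (NP.+-comm a 2)))
  (trans (map-g₂-spokes a 0 0 (suc (suc b)))
   (trans (cong (λ x → spokes 0 x (suc (suc b))) (NP.+-comm a 2))
    (cong ((0 , suc (suc a)) ∷_) (spokes-snoc 0 (suc (suc (suc a))) b))))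

n≢sn : ∀ n → n ≢ suc n
n≢sn n ()

n≢ssn : ∀ n → n ≢ suc (suc n)
n≢ssn n ()

sa+b≢a : ∀ a b → suc (a + b) ≢ a
sa+b≢a a b e = NP.m≢1+m+n a (sym e)

hubSide₁ : ℕ → ℕ → List (ℕ × ℕ)
hubSide₁ a K = (suc (suc a) , 0) ∷ (K , 0) ∷ (K , 1) ∷ spokes K 2 (suc a)

deletePrincipal₁-ordinary : ∀ a b → let s = a + b in
  deleteEdge (0 , 1) (deleteEdge (0 , suc (suc (suc s)))
     ((0 , 1) ∷ (1 , 2) ∷ pathEdges 2 a ++ hubSide₁ a (suc (suc (suc (suc s))))))
  ≡ (1 , 2) ∷ pathEdges 2 a ++ hubSide₁ a (suc (suc (suc (suc s))))
deletePrincipal₁-ordinary a b =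
  trans (cong (λ z → deleteEdge (0 , 1) ((0 , 1) ∷ (1 , 2) ∷ z))
          (trans (deleteEdge-++ (0 , KL) (pathEdges 2 a) (hubSide₁ a K)) (cong₂ _++_ (deleteEdge-pathEdges KL 1 a) r1)))
   (cong ((1 , 2) ∷_) (trans (deleteEdge-++ (0 , 1) (pathEdges 2 a) (hubSide₁ a K)) (cong₂ _++_ (deleteEdge-pathEdges 1 1 a)
        (cong (λ z → (suc (suc a) , 0) ∷ (K , 0) ∷ (K , 1) ∷ z) (deleteEdge-spokes 1 (suc (suc (suc (a + b)))) 1 (suc a))))))
  where
  KL = suc (suc (suc (a + b)))
  K = suc KL
  r1 : deleteEdge (0 , KL) (hubSide₁ a K) ≡ hubSide₁ a K
  r1 = trans (deleteEdge-keep (0 , KL) _ _ (≡ᵇ-false (suc (a + b)) a (sa+b≢a a b)))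
       (cong ((suc (suc a) , 0) ∷_) (trans (deleteEdge-keep (0 , KL) _ _ (≡ᵇ-false (a + b) (suc (a + b)) (n≢sn (a + b))))
       (cong ((K , 0) ∷_) (cong ((K , 1) ∷_) (deleteEdge-spokes KL KL 1 (suc a))))))

sameEdge-refl0 : ∀ x → sameEdge (0 , x) (0 , x) ≡ true
sameEdge-refl0 x rewrite ≡ᵇ-refl x = refl

sameEdge-rev0 : ∀ x → sameEdge (0 , suc x) (suc x , 0) ≡ true
sameEdge-rev0 x rewrite ≡ᵇ-refl x = refl

deletePrincipal₁-broken : ∀ a b → let KL = suc (suc (suc (a + b))) in
  deleteEdge (0 , 1) (deleteEdge (0 , KL) (pathEdges 1 (suc a) ++ (0 , 1) ∷ spokes 0 2 (suc a)))
  ≡ pathEdges 1 (suc a) ++ spokes 0 2 (suc a)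
deletePrincipal₁-broken a b =
  trans (cong (deleteEdge (0 , 1)) (trans (deleteEdge-++ (0 , KL) (pathEdges 1 (suc a)) _)
          (cong₂ _++_ (deleteEdge-pathEdges KL 0 (suc a)) (cong ((0 , 1) ∷_) (deleteEdge-spokes₀ KL 1 (suc a) c1)))))
  (trans (deleteEdge-++ (0 , 1) (pathEdges 1 (suc a)) _) (cong₂ _++_ (deleteEdge-pathEdges 1 0 (suc a))
      (deleteEdge-spokes₀ 1 1 (suc a) c2)))
  where
  KL = suc (suc (suc (a + b)))
  c1 : ∀ j → 2 ≤ j → j < 2 + suc a → KL ≢ j
  c1 j _ u e = NP.<-irrefl refl (NP.<-≤-trans (subst (_< 3 + a) (sym e) u) (s≤s (s≤s (s≤s (NP.m≤m+n a b)))))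
  c2 : ∀ j → 2 ≤ j → j < 2 + suc a → 1 ≢ j
  c2 j l _ e = NP.<-irrefl e l

deletePrincipal₂-ordinary : ∀ a b h → let KL = suc (suc (suc (a + b))) ; H = suc (suc h) in
  suc (suc a) ≢ H → KL ≢ H →
  deleteEdge (0 , 1) (deleteEdge (0 , KL) (deleteEdge (0 , suc (suc a))
    ((0 , suc (suc a)) ∷ pathEdges (suc (suc a)) (suc b) ++ (KL , 0) ∷ (H , 0) ∷ spokes H (suc (suc a)) (suc (suc b)))))
  ≡ pathEdges (suc (suc a)) (suc b) ++ (H , 0) ∷ spokes H (suc (suc a)) (suc (suc b))
deletePrincipal₂-ordinary a b h n1 n2 =
  trans (cong (λ z → deleteEdge (0 , 1) (deleteEdge (0 , KL) z))
    (trans (deleteEdge-drop (0 , A2) (0 , A2) _ (sameEdge-refl0 A2))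
    (trans (deleteEdge-++ (0 , A2) P2 _)
     (cong₂ _++_ (deleteEdge-pathEdges A2 (suc a) (suc b))
      (trans (deleteEdge-keep (0 , A2) (KL , 0) _ (≡ᵇ-false A2 KL (λ e → sa+b≢a a b (sym (cong (λ x → pred (pred x)) e)))))
       (cong ((KL , 0) ∷_) (trans (deleteEdge-keep (0 , A2) (H , 0) _ (≡ᵇ-false A2 H n1))
         (cong ((H , 0) ∷_) (deleteEdge-spokes A2 (suc h) (suc a) (suc (suc b)))))))))))
  (trans (cong (deleteEdge (0 , 1))
    (trans (deleteEdge-++ (0 , KL) P2 _)
     (cong₂ _++_ (deleteEdge-pathEdges KL (suc a) (suc b))
      (trans (deleteEdge-drop (0 , KL) (KL , 0) _ (sameEdge-rev0 (suc (suc (a + b)))))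
       (trans (deleteEdge-keep (0 , KL) (H , 0) _ (≡ᵇ-false KL H n2))
        (cong ((H , 0) ∷_) (deleteEdge-spokes KL (suc h) (suc a) (suc (suc b)))))))))
  (trans (deleteEdge-++ (0 , 1) P2 _)
   (cong₂ _++_ (deleteEdge-pathEdges 1 (suc a) (suc b))
    (cong ((H , 0) ∷_) (deleteEdge-spokes 1 (suc h) (suc a) (suc (suc b)))))))
  where
  KL = suc (suc (suc (a + b)))
  H = suc (suc h)
  A2 = suc (suc a)
  P2 = pathEdges (suc (suc a)) (suc b)

deletePrincipal₂-broken : ∀ a b → let KL = suc (suc (suc (a + b))) in
  deleteEdge (0 , 1) (deleteEdge (0 , KL) (deleteEdge (0 , suc (suc a))
    (pathEdges (suc (suc a)) (suc b) ++ (0 , suc (suc a)) ∷ spokes 0 (suc (suc (suc a))) b ++ [ (0 , KL) ])))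
  ≡ pathEdges (suc (suc a)) (suc b) ++ spokes 0 (suc (suc (suc a))) b
deletePrincipal₂-broken a b =
  trans (cong (λ z → deleteEdge (0 , 1) (deleteEdge (0 , KL) z))
    (trans (deleteEdge-++ (0 , A2) P2 _)
     (cong₂ _++_ (deleteEdge-pathEdges A2 (suc a) (suc b))
      (trans (deleteEdge-drop (0 , A2) (0 , A2) _ (sameEdge-refl0 A2))
       (trans (deleteEdge-++ (0 , A2) S3 _)
        (cong₂ _++_ (deleteEdge-spokes₀ A2 (suc (suc a)) b c1)
          (deleteEdge-keep (0 , A2) (0 , KL) [] (cong (_∨ false) (≡ᵇ-false A2 KL
              (λ e → sa+b≢a a b (sym (cong (λ x → pred (pred x)) e))))))))))))
  (trans (cong (deleteEdge (0 , 1))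
    (trans (deleteEdge-++ (0 , KL) P2 _)
     (cong₂ _++_ (deleteEdge-pathEdges KL (suc a) (suc b))
      (trans (deleteEdge-++ (0 , KL) S3 _)
       (trans (cong₂ _++_ (deleteEdge-spokes₀ KL (suc (suc a)) b c2) (deleteEdge-drop (0 , KL) (0 , KL) [] (sameEdge-refl0 KL)))
        (++-identityʳ S3))))))
  (trans (deleteEdge-++ (0 , 1) P2 _)
   (cong₂ _++_ (deleteEdge-pathEdges 1 (suc a) (suc b)) (deleteEdge-spokes₀ 1 (suc (suc a)) b c3))))
  where
  KL = suc (suc (suc (a + b)))
  A2 = suc (suc a)
  P2 = pathEdges (suc (suc a)) (suc b)
  S3 = spokes 0 (suc (suc (suc a))) b
  c1 : ∀ j → 3 + a ≤ j → j < 3 + a + b → A2 ≢ j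
  c1 j l _ e = NP.<-irrefl e l
  c2 : ∀ j → 3 + a ≤ j → j < 3 + a + b → KL ≢ j
  c2 j _ u e = NP.<-irrefl (sym e) u
  c3 : ∀ j → 3 + a ≤ j → j < 3 + a + b → 1 ≢ j
  c3 j l _ e = NP.<-irrefl e (NP.<-≤-trans (s≤s (s≤s z≤n)) l)

dwMinusPathEdges′ : Kind → ℕ → Kind → ℕ → ℕ → List (ℕ × ℕ)
dwMinusPathEdges′ t1 a t2 b K = deleteEdge (0 , 1) (deleteEdge (0 , K ∸ 1)
  (wheelEdges t1 (suc (suc (suc a))) g₁label K ++ deleteEdge (0 , suc (suc a))
      (wheelEdges t2 (suc (suc (suc b))) (g₂ a) (K + nHubs t1))))

outerLen≡ : ∀ a b → outerLen (suc (suc (suc a))) (suc (suc (suc b))) ≡ suc (suc (suc (suc (a + b))))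
outerLen≡ a b = cong suc (a+3+b a b)

dwMinusPathEdges′-++ : ∀ t1 a t2 b K → dwMinusPathEdges′ t1 a t2 b K ≡
  deleteEdge (0 , 1) (deleteEdge (0 , K ∸ 1) (wheelEdges t1 (suc (suc (suc a))) g₁label K))
  ++ deleteEdge (0 , 1) (deleteEdge (0 , K ∸ 1) (deleteEdge (0 , suc (suc a))
      (wheelEdges t2 (suc (suc (suc b))) (g₂ a) (K + nHubs t1))))
dwMinusPathEdges′-++ t1 a t2 b K = trans (cong (deleteEdge (0 , 1)) (deleteEdge-++ (0 , K ∸ 1) X Y))
    (deleteEdge-++ (0 , 1) (deleteEdge (0 , K ∸ 1) X) (deleteEdge (0 , K ∸ 1) Y))
  where
  X = wheelEdges t1 (suc (suc (suc a))) g₁label K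
  Y = deleteEdge (0 , suc (suc a)) (wheelEdges t2 (suc (suc (suc b))) (g₂ a) (K + nHubs t1))

hub₁ : ℕ → ℕ → ℕ
hub₁ a b = suc (suc (suc (suc (a + b))))

edges-oo : ℕ → ℕ → List (ℕ × ℕ)
edges-oo a b = ((1 , 2) ∷ pathEdges 2 a ++ hubSide₁ a (hub₁ a b)) ++ (pathEdges (suc (suc a)) (suc b) ++
    (suc (hub₁ a b) , 0) ∷ spokes (suc (hub₁ a b)) (suc (suc a)) (suc (suc b)))

edges-ob : ℕ → ℕ → List (ℕ × ℕ)
edges-ob a b = ((1 , 2) ∷ pathEdges 2 a ++ hubSide₁ a (hub₁ a b)) ++ (pathEdges (suc (suc a)) (suc b) ++ spokes 0
    (suc (suc (suc a))) b)

edges-bo : ℕ → ℕ → List (ℕ × ℕ)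
edges-bo a b = (pathEdges 1 (suc a) ++ spokes 0 2 (suc a)) ++ (pathEdges (suc (suc a)) (suc b) ++ (hub₁ a b , 0) ∷ spokes
    (hub₁ a b) (suc (suc a)) (suc (suc b)))

dwMinusPathEdges-oo : ∀ a b → dwMinusPathEdgesℕ ordinary (suc (suc (suc a))) ordinary (suc (suc (suc b))) ≡ edges-oo a b
dwMinusPathEdges-oo a b =
  trans (cong (dwMinusPathEdges′ ordinary a ordinary b) (outerLen≡ a b))
  (trans (dwMinusPathEdges′-++ ordinary a ordinary b (hub₁ a b))
   (cong₂ _++_
     (trans (cong (λ z → deleteEdge (0 , 1) (deleteEdge (0 , suc (suc (suc (a + b)))) z)) (wheel₁-ordinary a (hub₁ a b)))
         (deletePrincipal₁-ordinary a b))
     (trans (cong (λ z → deleteEdge (0 , 1) (deleteEdge (0 , suc (suc (suc (a + b)))) (deleteEdge (0 , suc (suc a)) z)))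
        (trans (wheel₂-ordinary a b (hub₁ a b + 1)) (cong (λ H → (0 , suc (suc a)) ∷ pathEdges (suc (suc a)) (suc b) ++
            (suc (suc (suc (a + b))) , 0) ∷ (H , 0) ∷ spokes H (suc (suc a)) (suc (suc b))) (NP.+-comm (hub₁ a b) 1))))
      (deletePrincipal₂-ordinary a b (suc (suc (suc (a + b)))) (ne-a2 a b)
          (λ e → n≢ssn (a + b) (cong (λ x → pred (pred (pred x))) e))))))
  where
  ne-a2 : ∀ a b → suc (suc a) ≢ suc (suc (suc (suc (suc (a + b)))))
  ne-a2 a b e = NP.m≢1+m+n a {suc (suc b)} (trans (cong (λ x → pred (pred x)) e)
      (cong suc (sym (trans (NP.+-suc a (suc b)) (cong suc (NP.+-suc a b))))))

dwMinusPathEdges-ob : ∀ a b → dwMinusPathEdgesℕ ordinary (suc (suc (suc a))) broken (suc (suc (suc b))) ≡ edges-ob a b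
dwMinusPathEdges-ob a b =
  trans (cong (dwMinusPathEdges′ ordinary a broken b) (outerLen≡ a b))
  (trans (dwMinusPathEdges′-++ ordinary a broken b (hub₁ a b))
   (cong₂ _++_
     (trans (cong (λ z → deleteEdge (0 , 1) (deleteEdge (0 , suc (suc (suc (a + b)))) z)) (wheel₁-ordinary a (hub₁ a b)))
         (deletePrincipal₁-ordinary a b))
     (trans (cong (λ z → deleteEdge (0 , 1) (deleteEdge (0 , suc (suc (suc (a + b)))) (deleteEdge (0 , suc (suc a)) z)))
        (wheel₂-broken a b (hub₁ a b + 1)))
      (deletePrincipal₂-broken a b))))

dwMinusPathEdges-bo : ∀ a b → dwMinusPathEdgesℕ broken (suc (suc (suc a))) ordinary (suc (suc (suc b))) ≡ edges-bo a b
dwMinusPathEdges-bo a b =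
  trans (cong (dwMinusPathEdges′ broken a ordinary b) (outerLen≡ a b))
  (trans (dwMinusPathEdges′-++ broken a ordinary b (hub₁ a b))
   (cong₂ _++_
     (trans (cong (λ z → deleteEdge (0 , 1) (deleteEdge (0 , suc (suc (suc (a + b)))) z)) (wheel₁-broken a (hub₁ a b)))
         (deletePrincipal₁-broken a b))
     (trans (cong (λ z → deleteEdge (0 , 1) (deleteEdge (0 , suc (suc (suc (a + b)))) (deleteEdge (0 , suc (suc a)) z)))
        (trans (wheel₂-ordinary a b (hub₁ a b + 0)) (cong (λ H → (0 , suc (suc a)) ∷ pathEdges (suc (suc a)) (suc b) ++
            (suc (suc (suc (a + b))) , 0) ∷ (H , 0) ∷ spokes H (suc (suc a)) (suc (suc b))) (NP.+-identityʳ (hub₁ a b)))))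
      (deletePrincipal₂-ordinary a b (suc (suc (a + b))) ne1 (n≢sn (suc (suc (suc (a + b)))))))))
  where
  ne1 : suc (suc a) ≢ suc (suc (suc (suc (a + b))))
  ne1 e = NP.m≢1+m+n a {suc b} (trans (cong (λ x → pred (pred x)) e) (cong suc (sym (NP.+-suc a b))))

Outside : ℕ → ℕ → ℕ → Set
Outside s c u = u < s ⊎ s + c < u

prodCoeffℕ-↭-vanishes : ∀ N {L L′} (m : Vec ℕ N) → L ↭ L′ → prodCoeffℕ N L′ m ≡ 0ℤ → prodCoeffℕ N L m ≡ 0ℤ
prodCoeffℕ-↭-vanishes N m p z = trans (prodCoeffℕ-↭ N p m) z

pathEdges-in : ∀ N s c → s + c < N → EdgesIn N (pathEdges s c)
pathEdges-in N s zero h = []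
pathEdges-in N s (suc c) h = (NP.≤-<-trans (NP.m≤m+n s (suc c)) h , NP.≤-<-trans
    (subst (suc s ≤_) (sym (NP.+-suc s c)) (s≤s (NP.m≤m+n s c))) h)
  ∷ pathEdges-in N (suc s) c (subst (_< N) (NP.+-suc s c) h)

spokes-in : ∀ N h s c → h < N → s + c ≤ N → EdgesIn N (spokes h s c)
spokes-in N h s zero h< l = []
spokes-in N h s (suc c) h< l = (h< , NP.<-≤-trans (subst (s <_) (sym (NP.+-suc s c)) (s≤s (NP.m≤m+n s c))) l)
  ∷ spokes-in N h (suc s) c h< (subst (_≤ N) (NP.+-suc s c) l)

pathEdges-avoid : ∀ v s c → Outside s c v → Avoids v (pathEdges s c)
pathEdges-avoid v s zero o = []
pathEdges-avoid v s (suc c) (inj₁ v<s) = ((λ e → NP.<-irrefl (sym e) v<s) ,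
    (λ e → NP.<-irrefl (sym e) (NP.<-trans v<s (NP.n<1+n s)))) ∷ pathEdges-avoid v (suc s) c (inj₁ (NP.<-trans v<s (NP.n<1+n s)))
pathEdges-avoid v s (suc c) (inj₂ sc<v) =
  ((λ e → NP.<-irrefl e (NP.≤-<-trans (NP.m≤m+n s (suc c)) sc<v)) , (λ e → NP.<-irrefl e
      (NP.≤-<-trans (subst (suc s ≤_) (sym (NP.+-suc s c)) (s≤s (NP.m≤m+n s c))) sc<v)))
  ∷ pathEdges-avoid v (suc s) c (inj₂ (subst (_< v) (NP.+-suc s c) sc<v))

spokes-avoid : ∀ v h s c → v ≢ h → (v < s ⊎ s + c ≤ v) → Avoids v (spokes h s c)
spokes-avoid v h s zero n o = []
spokes-avoid v h s (suc c) n (inj₁ v<s) = ((λ e → n (sym e)) , (λ e → NP.<-irrefl (sym e) v<s)) ∷ spokes-avoid v h (suc s) c n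
    (inj₁ (NP.<-trans v<s (NP.n<1+n s)))
spokes-avoid v h s (suc c) n (inj₂ l) = ((λ e → n (sym e)) , (λ e → NP.<-irrefl e
    (NP.<-≤-trans (subst (s <_) (sym (NP.+-suc s c)) (s≤s (NP.m≤m+n s c))) l)))
  ∷ spokes-avoid v h (suc s) c n (inj₂ (subst (_≤ v) (NP.+-suc s c) l))

elemᵇ-∷-range-false : ∀ u h s c → u ≢ h → (u < s ⊎ s + c < u) → elemᵇ u (h ∷ range s c) ≡ false
elemᵇ-∷-range-false u h s c n o = elemᵇ-false u (h ∷ range s c) (n ∷ range-All s c (λ j l r e → aux j l r e o))
  where
  aux : ∀ j → s ≤ j → j < s + c → u ≡ j → (u < s ⊎ s + c < u) → ⊥
  aux j l r refl (inj₁ x) = NP.<-irrefl refl (NP.<-≤-trans x l)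
  aux j l r refl (inj₂ x) = NP.<-irrefl refl (NP.<-trans x r)

ascendingFan-vanishes : ∀ N h s c′ (R : List (ℕ × ℕ)) t (m : Vec ℕ N) →
  h < N → s + suc (suc c′) < N → s + suc (suc c′) < h →
  EdgesIn N R → Avoids h R → (∀ j → s ≤ j → j < s + suc (suc c′) → Avoids j R) →
  oddᵇ (suc c′) ≡ true →
  at m h ≤ 2 → at m s ≤ 1 → (∀ j → s < j → j < s + suc (suc c′) → at m j ≤ 2) →
  (∀ m′ → (∀ u → u ≢ h → Outside s (suc (suc c′)) u → at m′ u ≡ at m u) → at m′ (s + suc (suc c′)) < t → prodCoeffℕ N R m′ ≡ 0ℤ) →
  at m (s + suc (suc c′)) ≤ t →
  prodCoeffℕ N ((pathEdges s (suc (suc c′)) ++ spokes h s (suc (suc (suc c′)))) ++ R) m ≡ 0ℤ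
ascendingFan-vanishes N h s c′ R t m h< sc< sch inR avh avR odd hb pb ib rest-vanishes le =
  prodCoeffℕ-↭-vanishes N m (PP.++⁺ʳ R (pathSpokes-↭-fanEdges h s c))
   (fan-vanishes N h s (suc s) qs R t S₀ m h< ps< inR hn (Distinct-range s (suc c)) avh avI
       (elemᵇ-here h (dropLast s (range (suc s) c))) iS rest-vanishes′
     (subst (λ x → at m x ≤ t) (sym eL) le) hb pb ib′ odd′)
  where
  c = suc (suc c′)
  qs = range (suc (suc s)) (suc c′)
  S₀ = h ∷ dropLast s (range (suc s) c)
  eL : lastOf s (range (suc s) c) ≡ s + c
  eL = lastOf-range s c
  eI : dropLast s (range (suc s) c) ≡ range s c
  eI = dropLast-range s c
  ps< : All (_< N) (range s (suc c))
  ps< = range-All s (suc c) (λ j _ u → NP.<-≤-trans (subst (j <_) (NP.+-suc s c) u) sc<)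
  hn : NotIn h (range s (suc c))
  hn = range-All s (suc c) (λ j _ u e → NP.<-irrefl (sym e) (NP.<-≤-trans (subst (j <_) (NP.+-suc s c) u) sch))
  avI : All (λ v → Avoids v R) (dropLast s (range (suc s) c))
  avI = subst (All (λ v → Avoids v R)) (sym eI) (range-All s c avR)
  iS : All (λ v → elemᵇ v S₀ ≡ true) (dropLast s (range (suc s) c))
  iS = All.map (λ {v} x → elemᵇ-there v h (dropLast s (range (suc s) c)) x) (elemᵇ-self (dropLast s (range (suc s) c)))
  rest-vanishes′ : ∀ m′ → AgreeOff S₀ (lastOf (suc s) qs) m m′ → at m′ (lastOf (suc s) qs) < t → prodCoeffℕ N R m′ ≡ 0ℤ
  rest-vanishes′ m′ ag lt = rest-vanishes m′ conv (subst (λ x → at m′ x < t) eL lt)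
    where
    conv : ∀ u → u ≢ h → Outside s c u → at m′ u ≡ at m u
    conv u n o = ag u (subst (λ L → elemᵇ u (h ∷ L) ≡ false) (sym eI) (elemᵇ-∷-range-false u h s c n o))
                      (λ e → aux (trans e eL) o)
      where aux : u ≡ s + c → Outside s c u → ⊥
            aux refl (inj₁ x) = NP.<-irrefl refl (NP.<-≤-trans x (NP.m≤m+n s c))
            aux refl (inj₂ x) = NP.<-irrefl refl x
  ib′ : All (λ v → at m v ≤ 2) (dropLast (suc s) qs)
  ib′ = subst (All (λ v → at m v ≤ 2)) (sym (dropLast-range (suc s) (suc c′)))
          (range-All (suc s) (suc c′) (λ j l u → ib j l (subst (j <_) (sym (NP.+-suc s (suc c′))) u)))
  odd′ : oddLength (dropLast (suc s) qs) ≡ true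
  odd′ = trans (cong oddLength (dropLast-range (suc s) (suc c′))) (trans (oddLength-range (suc s) (suc c′)) odd)

pathSpokes-in : ∀ N h s c → h < N → s + c < N → EdgesIn N (pathEdges s c ++ spokes h s (suc c))
pathSpokes-in N h s c h< sc< = ++⁺ (pathEdges-in N s c sc<) (spokes-in N h s (suc c) h< (subst (_≤ N) (sym (NP.+-suc s c)) sc<))

-- The same fan entered from s + c.
descendingFan-vanishes : ∀ N h s c′ (m : Vec ℕ N) →
  h < N → s + suc (suc c′) < N → s + suc (suc c′) < h →
  oddᵇ (suc c′) ≡ true →
  at m h ≤ 2 → at m (s + suc (suc c′)) ≤ 1 → (∀ j → s < j → j < s + suc (suc c′) → at m j ≤ 2) → at m s ≡ 0 →
  prodCoeffℕ N (pathEdges s (suc (suc c′)) ++ spokes h s (suc (suc (suc c′)))) m ≡ 0ℤ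
descendingFan-vanishes N h s c′ m h< sc< sch odd hb pb ib z =
  prodCoeffℕ-↭-vanishes N m (pathSpokes-↭-fanEdgesRev h s c)
   (subst (λ L → prodCoeffℕ N L m ≡ 0ℤ) (++-identityʳ (fanEdgesRev h (s + c) (rangeDesc s c)))
    (reorient-vanishes N (fanEdgesRev h (s + c) (rangeDesc s c)) (fanEdges h (s + c) (rangeDesc s c)) [] m
        (fanEdgesRev-reorient h (s + c) (rangeDesc s c))
      (PP.All-resp-↭ (pathSpokes-↭-fanEdgesRev h s c) (pathSpokes-in N h s c h< sc<))
      (fan-vanishes N h (s + c) (s + suc c′) qs [] 0 S₀ m h< ps< [] hn (Distinct-rangeDesc s (suc c)) [] avI
        (elemᵇ-here h (dropLast (s + c) (rangeDesc s c))) iS (λ _ _ ())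
        (subst (λ x → at m x ≤ 0) (sym (lastOf-rangeDesc s (suc c′))) (NP.≤-reflexive z))
        hb pb ib′ odd′)))
  where
  c = suc (suc c′)
  qs = rangeDesc s (suc c′)
  S₀ = h ∷ dropLast (s + c) (rangeDesc s c)
  ps< : All (_< N) (rangeDesc s (suc c))
  ps< = rangeDesc-All s (suc c) (λ j _ u → NP.<-≤-trans (subst (j <_) (NP.+-suc s c) u) sc<)
  hn : NotIn h (rangeDesc s (suc c))
  hn = rangeDesc-All s (suc c) (λ j _ u e → NP.<-irrefl (sym e) (NP.<-≤-trans (subst (j <_) (NP.+-suc s c) u) sch))
  avI : All (λ v → Avoids v []) (dropLast (s + c) (rangeDesc s c))
  avI = All.tabulate (λ _ → [])
  iS : All (λ v → elemᵇ v S₀ ≡ true) (dropLast (s + c) (rangeDesc s c))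
  iS = All.map (λ {v} x → elemᵇ-there v h (dropLast (s + c) (rangeDesc s c)) x) (elemᵇ-self (dropLast (s + c) (rangeDesc s c)))
  ib′ : All (λ v → at m v ≤ 2) (dropLast (s + suc c′) qs)
  ib′ = subst (All (λ v → at m v ≤ 2)) (sym (dropLast-rangeDesc s (suc c′)))
          (rangeDesc-All (suc s) (suc c′) (λ j l u → ib j l (subst (j <_) (sym (NP.+-suc s (suc c′))) u)))
  odd′ : oddLength (dropLast (s + suc c′) qs) ≡ true
  odd′ = trans (cong oddLength (dropLast-rangeDesc s (suc c′))) (trans (oddLength-rangeDesc (suc s) (suc c′)) odd)

module OrdinaryOrdinary where

  -- Labels for k₁ = a + 3, k₂ = b + 3 (see Defs): h₁, h₂ are the hubs, joint = a + 2 is the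
  -- rim vertex shared by G₁ and G₂, vk = vk′ is v_k.  The forced edges are those at the
  -- principal vertices; forcedEnds lists, in order, the endpoint each of them must use.
  module Layout (a b : ℕ) where
    h₁ h₂ joint vk : ℕ
    h₁ = hub₁ a b
    h₂ = suc h₁
    joint = suc (suc a)
    vk = joint + suc b
    rimEnd spokeEnd : ℕ × ℕ
    rimEnd = (joint + b , vk)
    spokeEnd = (h₂ , vk)
    fan₁ fan₂ : List (ℕ × ℕ)
    fan₁ = pathEdges 2 a ++ spokes h₁ 2 (suc a)
    fan₂ = pathEdges joint b ++ spokes h₂ joint (suc b)
    forced : List (ℕ × ℕ)
    forced = (1 , 2) ∷ (joint , 0) ∷ (h₁ , 0) ∷ (h₁ , 1) ∷ rimEnd ∷ (h₂ , 0) ∷ spokeEnd ∷ []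

    edges-oo-↭ : edges-oo a b ↭ forced ++ (fan₁ ++ fan₂)
    edges-oo-↭ = ↭-trans (PP.++⁺ p1 p2)
      (Perm.prep _ (Perm.prep _ (Perm.prep _ (Perm.prep _ (PP.shifts fan₁ (rimEnd ∷ (h₂ , 0) ∷ spokeEnd ∷ []) {fan₂})))))
      where
      p1 : (1 , 2) ∷ pathEdges 2 a ++ hubSide₁ a h₁ ↭ (1 , 2) ∷ (joint , 0) ∷ (h₁ , 0) ∷ (h₁ , 1) ∷ fan₁
      p1 = Perm.prep (1 , 2) (PP.shifts (pathEdges 2 a) ((joint , 0) ∷ (h₁ , 0) ∷ (h₁ , 1) ∷ []) {spokes h₁ 2 (suc a)})
      S : List (ℕ × ℕ)
      S = spokes h₂ joint (suc b)
      p2 : pathEdges joint (suc b) ++ (h₂ , 0) ∷ spokes h₂ joint (suc (suc b)) ↭ rimEnd ∷ (h₂ , 0) ∷ spokeEnd ∷ fan₂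
      p2 = ↭-trans (↭-reflexive (cong₂ (λ x y → x ++ (h₂ , 0) ∷ y) (pathEdges-snoc joint b) (spokes-snoc h₂ joint (suc b))))
           (↭-trans (↭-reflexive (++-assoc (pathEdges joint b) [ rimEnd ] ((h₂ , 0) ∷ (S ++ [ spokeEnd ]))))
           (↭-trans (PP.shift rimEnd (pathEdges joint b) ((h₂ , 0) ∷ (S ++ [ spokeEnd ])))
           (Perm.prep rimEnd (↭-trans (PP.shift (h₂ , 0) (pathEdges joint b) (S ++ [ spokeEnd ]))
              (Perm.prep (h₂ , 0) (↭-trans (↭-reflexive (sym (++-assoc (pathEdges joint b) S [ spokeEnd ])))
                 (PP.++-comm (pathEdges joint b ++ S) [ spokeEnd ])))))))

    vk′ : ℕ
    vk′ = suc (suc (suc (a + b)))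
    vk≡vk′ : vk ≡ vk′
    vk≡vk′ = cong (λ x → suc (suc x)) (NP.+-suc a b)

    principal : List ℕ
    principal = 0 ∷ 1 ∷ vk ∷ []

    forcedEnds : List ℕ
    forcedEnds = 2 ∷ joint ∷ h₁ ∷ h₁ ∷ (joint + b) ∷ h₂ ∷ h₂ ∷ []

    ≢vk : ∀ r → r ≢ vk′ → r ≢ vk
    ≢vk r n e = n (trans e vk≡vk′)

    ∉principal : ∀ r → r ≢ 0 → r ≢ 1 → r ≢ vk′ → elemᵇ r principal ≡ false
    ∉principal r n0 n1 nK = elemᵇ-false r principal (n0 ∷ n1 ∷ ≢vk r nK ∷ [])

    vk∈principal : elemᵇ vk principal ≡ true
    vk∈principal = elemᵇ-there vk 0 (1 ∷ vk ∷ []) (elemᵇ-there vk 1 (vk ∷ []) (elemᵇ-here vk []))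

    forcing : Forcing principal forced forcedEnds
    forcing = fwd refl (∉principal 2 (λ ()) (λ ()) (λ e → NP.<-irrefl e (s≤s (s≤s (s≤s z≤n)))))
       (bwd refl (∉principal joint (λ ()) (λ ()) (λ e → NP.m≢1+m+n a (cong (λ x → pred (pred x)) e)))
       (bwd refl (∉principal h₁ (λ ()) (λ ()) (λ e → n≢sn vk′ (sym e)))
       (bwd refl (∉principal h₁ (λ ()) (λ ()) (λ e → n≢sn vk′ (sym e)))
       (bwd vk∈principal (∉principal (joint + b) (λ ()) (λ ()) (λ e → n≢sn (suc (suc (a + b))) e))
       (bwd refl (∉principal h₂ (λ ()) (λ ()) (λ e → n≢ssn vk′ (sym e)))
       (bwd vk∈principal (∉principal h₂ (λ ()) (λ ()) (λ e → n≢ssn vk′ (sym e)))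
       fnil))))))

    module AtMonomial (N : ℕ) (m : Vec ℕ N) (h₂<N : h₂ < N)
             (z₀ : at m 0 ≡ 0) (z₁ : at m 1 ≡ 0) (z-vk : at m vk′ ≡ 0)
             (rim≤2 : ∀ u → 2 ≤ u → u < vk′ → at m u ≤ 2) (hub≤4 : ∀ u → h₁ ≤ u → at m u ≤ 4) where

      principal-zero : ∀ s → elemᵇ s principal ≡ true → at m s ≡ 0
      principal-zero s h with elemᵇ-∷⁻ s 0 (1 ∷ vk ∷ []) h
      ... | inj₁ refl = z₀
      ... | inj₂ h′ with elemᵇ-∷⁻ s 1 (vk ∷ []) h′
      ...   | inj₁ refl = z₁
      ...   | inj₂ h″ with elemᵇ-∷⁻ s vk [] h″
      ...     | inj₁ refl = trans (cong (at m) vk≡vk′) z-vk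
      ...     | inj₂ ()

      h₁<N : h₁ < N
      h₁<N = NP.≤-<-trans (NP.n≤1+n h₁) h₂<N
      lt : ∀ x → x ≤ h₁ → x < N
      lt x h = NP.≤-<-trans h h₁<N
      joint≤h₁ : joint ≤ h₁
      joint≤h₁ = s≤s (s≤s (NP.≤-trans (NP.m≤m+n a b) (NP.≤-trans (NP.n≤1+n _) (NP.n≤1+n _))))
      joint+b≤h₁ : joint + b ≤ h₁
      joint+b≤h₁ = s≤s (s≤s (NP.≤-trans (NP.n≤1+n (a + b)) (NP.n≤1+n _)))

      forcedEdges-in : EdgesIn N forced
      forcedEdges-in = (lt 1 (s≤s z≤n) , lt 2 (s≤s (s≤s z≤n))) ∷ (lt joint joint≤h₁ , lt 0 z≤n) ∷ (h₁<N , lt 0 z≤n) ∷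
          (h₁<N , lt 1 (s≤s z≤n))
        ∷ (lt (joint + b) joint+b≤h₁ , lt vk (subst (_≤ h₁) (sym vk≡vk′) (NP.n≤1+n vk′))) ∷ (h₂<N , lt 0 z≤n) ∷
            (h₂<N , lt vk (subst (_≤ h₁) (sym vk≡vk′) (NP.n≤1+n vk′))) ∷ []

  open Layout using (h₁; h₂; joint; fan₁; fan₂; forced; edges-oo-↭; vk′; principal; forcedEnds; forcing)

  fans-vanish : ∀ a′ b N (m : Vec ℕ N) → h₂ (suc (suc a′)) b < N →
    (rim≤2 : ∀ u → 2 ≤ u → u < vk′ (suc (suc a′)) b → at m u ≤ 2) → (hub≤4 : ∀ u → h₁ (suc (suc a′)) b ≤ u → at m u ≤ 4) →
    oddᵇ (suc a′) ≡ true → (∀ u → count u (forcedEnds (suc (suc a′)) b) ≤ at m u) → ∀ t →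
    (∀ m′ → (∀ u → u ≢ h₁ (suc (suc a′)) b → Outside 2 (suc (suc a′)) u → at m′ u ≡ at
        (decAtAll (forcedEnds (suc (suc a′)) b) m) u) →
        at m′ (joint (suc (suc a′)) b) < t → prodCoeffℕ N (fan₂ (suc (suc a′)) b) m′ ≡ 0ℤ) →
    at (decAtAll (forcedEnds (suc (suc a′)) b) m) (joint (suc (suc a′)) b) ≤ t →
    prodCoeffℕ N (fan₁ (suc (suc a′)) b ++ fan₂ (suc (suc a′)) b) (decAtAll (forcedEnds (suc (suc a′)) b) m) ≡ 0ℤ
  fans-vanish a′ b N m h₂<N rim≤2 hub≤4 odd₁ forcedEnds≤ t rest-vanishes le =
    ascendingFan-vanishes N h₁′ 2 a′ fan₂′ t lowered h₁<N joint<N joint<h₁ inF2 avK avF2 odd₁ bK b2 bm′ rest-vanishes le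
    where
    a = suc (suc a′)
    h₁′ = h₁ a b
    h₂′ = h₂ a b
    joint′ = joint a b
    fan₂′ = fan₂ a b
    lowered = decAtAll (forcedEnds a b) m
    h₁<N : h₁′ < N
    h₁<N = NP.≤-<-trans (NP.n≤1+n h₁′) h₂<N
    joint<h₁ : joint′ < h₁′
    joint<h₁ = s≤s (s≤s (s≤s (NP.≤-trans (NP.m≤m+n a b) (NP.n≤1+n _))))
    joint<N : joint′ < N
    joint<N = NP.<-trans joint<h₁ h₁<N
    joint+b<h₁ : joint′ + b < h₁′
    joint+b<h₁ = NP.<-trans (NP.n<1+n _) (NP.n<1+n _)
    joint+b<N : joint′ + b < N
    joint+b<N = NP.<-trans joint+b<h₁ h₁<N
    vk″ = vk′ a b
    inF2 : EdgesIn N fan₂′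
    inF2 = pathSpokes-in N h₂′ joint′ b h₂<N joint+b<N
    avK : Avoids h₁′ fan₂′
    avK = ++⁺ (pathEdges-avoid h₁′ joint′ b (inj₂ joint+b<h₁))
              (spokes-avoid h₁′ h₂′ joint′ (suc b) (n≢sn h₁′) (inj₂ (subst (_≤ h₁′) (sym (NP.+-suc joint′ b)) joint+b<h₁)))
    avF2 : ∀ j → 2 ≤ j → j < joint′ → Avoids j fan₂′
    avF2 j _ j<A2 = ++⁺ (pathEdges-avoid j joint′ b (inj₁ j<A2)) (spokes-avoid j h₂′ joint′ (suc b)
        (λ e → NP.<-irrefl e (NP.<-trans j<A2 (NP.<-trans joint<h₁ (NP.n<1+n h₁′)))) (inj₁ j<A2))
    bK : at lowered h₁′ ≤ 2
    bK = at-decAtAll-≤ (forcedEnds a b) h₁′ m 2 4 (count-there (count-there (count-here refl (count-here refl z≤n))))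
        (hub≤4 h₁′ NP.≤-refl)
    b2 : at lowered 2 ≤ 1
    b2 = at-decAtAll-≤ (forcedEnds a b) 2 m 1 2 (count-here refl z≤n) (rim≤2 2 NP.≤-refl (s≤s (s≤s (s≤s z≤n))))
    joint<vk : joint′ < vk″
    joint<vk = s≤s (s≤s (s≤s (NP.m≤m+n a b)))
    bm′ : ∀ j → 2 < j → j < 2 + a → at lowered j ≤ 2
    bm′ j l u = NP.≤-trans (at-decAtAll-≤-at (forcedEnds a b) j m) (rim≤2 j (NP.<⇒≤ l) (NP.<-trans u joint<vk))

  -- a = 1 or b = 1 would be an even wheel; for a = b = 0 the vertex 2 is forced three times.
  after-forcing-oo : ∀ a b N (m : Vec ℕ N) → h₂ a b < N →
    (rim≤2 : ∀ u → 2 ≤ u → u < vk′ a b → at m u ≤ 2) → (hub≤4 : ∀ u → h₁ a b ≤ u → at m u ≤ 4) →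
    oddᵇ (suc a) ≡ true → oddᵇ (suc b) ≡ true →
    (∀ u → count u (forcedEnds a b) ≤ at m u) → prodCoeffℕ N (fan₁ a b ++ fan₂ a b) (decAtAll (forcedEnds a b) m) ≡ 0ℤ
  after-forcing-oo (suc zero) b N m _ _ _ () _ _
  after-forcing-oo a (suc zero) N m _ _ _ _ () _
  after-forcing-oo zero zero N m h₂<N rim≤2 hub≤4 odd₁ odd₂ forcedEnds≤ =
    ⊥-elim (NP.<-irrefl refl (NP.<-≤-trans 3≤vertex2 (rim≤2 2 NP.≤-refl (s≤s (s≤s (s≤s z≤n))))))
    where
    3≤vertex2 : 3 ≤ at m 2
    3≤vertex2 = NP.≤-trans (count-here refl (count-here refl (count-there (count-there (count-here refl z≤n))))) (forcedEnds≤ 2)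
  after-forcing-oo (suc (suc a′)) zero N m h₂<N rim≤2 hub≤4 odd₁ odd₂ forcedEnds≤ =
    fans-vanish a′ 0 N m h₂<N rim≤2 hub≤4 odd₁ forcedEnds≤ 0 (λ _ _ ()) joint≤0
    where
    a = suc (suc a′)
    joint′ = joint a 0
    joint≤0 : at (decAtAll (forcedEnds a 0) m) joint′ ≤ 0
    joint≤0 = at-decAtAll-≤ (forcedEnds a 0) joint′ m 2 2 (count-there
        (count-here refl (count-there (count-there (count-here (NP.+-identityʳ joint′) z≤n)))))
            (rim≤2 joint′ (s≤s (s≤s z≤n)) (s≤s (s≤s (s≤s (NP.m≤m+n a 0)))))
  after-forcing-oo (suc (suc a′)) (suc (suc b′)) N m h₂<N rim≤2 hub≤4 odd₁ odd₂ forcedEnds≤ =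
    fans-vanish a′ b N m h₂<N rim≤2 hub≤4 odd₁ forcedEnds≤ (at lowered joint′) rest-vanishes NP.≤-refl
    where
    a = suc (suc a′)
    b = suc (suc b′)
    h₁′ = h₁ a b
    h₂′ = h₂ a b
    joint′ = joint a b
    fan₂′ = fan₂ a b
    lowered = decAtAll (forcedEnds a b) m
    joint<h₁ : joint′ < h₁′
    joint<h₁ = s≤s (s≤s (s≤s (NP.≤-trans (NP.m≤m+n a b) (NP.n≤1+n _))))
    joint+b<h₁ : joint′ + b < h₁′
    joint+b<h₁ = NP.<-trans (NP.n<1+n _) (NP.n<1+n _)
    joint+b<N : joint′ + b < N
    joint+b<N = NP.<-trans joint+b<h₁ (NP.≤-<-trans (NP.n≤1+n h₁′) h₂<N)
    joint<vk : joint′ < vk′ a b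
    joint<vk = s≤s (s≤s (s≤s (NP.m≤m+n a b)))
    rest-vanishes : ∀ m′ → (∀ u → u ≢ h₁′ → Outside 2 a u → at m′ u ≡ at lowered u) → at m′
        (2 + a) < at lowered joint′ → prodCoeffℕ N fan₂′ m′ ≡ 0ℤ
    rest-vanishes m′ ag lt = descendingFan-vanishes N h₂′ joint′ b′ m′ h₂<N joint+b<N (NP.<-trans joint+b<h₁ (NP.n<1+n h₁′)) odd₂
       (≡-≤ (ag h₂′ (λ e → n≢sn h₁′ (sym e)) (inj₂ (NP.<-trans joint<h₁ (NP.n<1+n h₁′))))
         (at-decAtAll-≤ (forcedEnds a b) h₂′ m 2 4 (count-there (count-there
             (count-there (count-there (count-there (count-here refl (count-here refl z≤n))))))) (hub≤4 h₂′ (NP.n≤1+n h₁′))))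
       (≡-≤ (ag (joint′ + b) (λ e → NP.<-irrefl e joint+b<h₁) (inj₂ (NP.m<m+n joint′ (s≤s z≤n))))
         (at-decAtAll-≤ (forcedEnds a b) (joint′ + b) m 1 2 (count-there
             (count-there (count-there (count-there (count-here refl z≤n))))) (rim≤2 (joint′ + b) (s≤s (s≤s z≤n)) (NP.n<1+n _))))
       (λ j l u → ≡-≤ (ag j (λ e → NP.<-irrefl e (NP.<-trans u joint+b<h₁)) (inj₂ l))
          (NP.≤-trans (at-decAtAll-≤-at (forcedEnds a b) j m) (rim≤2 j (NP.≤-trans (s≤s (s≤s z≤n)) (NP.<⇒≤ l))
              (NP.<-trans u (NP.n<1+n _)))))
       (NP.n<1⇒n≡0 (NP.<-≤-trans lt (at-decAtAll-≤ (forcedEnds a b) joint′ m 1 2 (count-there (count-here refl z≤n))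
           (rim≤2 joint′ (s≤s (s≤s z≤n)) joint<vk))))
      where
      ≡-≤ : ∀ {x y z} → x ≡ y → y ≤ z → x ≤ z
      ≡-≤ refl h = h
  after-forcing-oo zero (suc (suc b′)) N m h₂<N rim≤2 hub≤4 odd₁ odd₂ forcedEnds≤ =
    trans (prodCoeffℕ-∷ N h₁′ 2 fan₂′ h₁<N (NP.<-trans (s≤s (s≤s (s≤s z≤n))) h₁<N) lowered)
     (edgeCoeff-zero h₁′ 2 (prodCoeffℕ N fan₂′) lowered
       (λ _ → descendingFan-vanishes N h₂′ 2 b′ (decAt h₁′ lowered) h₂<N joint+b<N (NP.<-trans joint+b<h₁ (NP.n<1+n h₁′)) odd₂
          (NP.≤-trans (at-decAt-≤ h₁′ h₂′ lowered) (at-decAtAll-≤ (forcedEnds 0 b) h₂′ m 2 4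
              (count-there (count-there (count-there (count-there (count-there (count-here refl (count-here refl z≤n)))))))
                  (hub≤4 h₂′ (NP.n≤1+n h₁′))))
          (NP.≤-trans (at-decAt-≤ h₁′ (2 + b) lowered) (at-decAtAll-≤ (forcedEnds 0 b) (2 + b) m 1 2
              (count-there (count-there (count-there (count-there (count-here refl z≤n)))))
                  (rim≤2 (2 + b) (s≤s (s≤s z≤n)) (NP.n<1+n _))))
          (λ j l u → NP.≤-trans (at-decAt-≤ h₁′ j lowered) (NP.≤-trans (at-decAtAll-≤-at (forcedEnds 0 b) j m)
              (rim≤2 j (NP.<⇒≤ l) (NP.<-trans u (NP.n<1+n _)))))
          (trans (at-decAt-other h₁′ 2 lowered (λ ())) vertex2≡0))
       (λ nz → ⊥-elim (nz vertex2≡0)))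
    where
    b = suc (suc b′)
    h₁′ = h₁ 0 b
    h₂′ = h₂ 0 b
    fan₂′ = fan₂ 0 b
    lowered = decAtAll (forcedEnds 0 b) m
    h₁<N : h₁′ < N
    h₁<N = NP.≤-<-trans (NP.n≤1+n h₁′) h₂<N
    joint+b<h₁ : 2 + b < h₁′
    joint+b<h₁ = NP.<-trans (NP.n<1+n _) (NP.n<1+n _)
    joint+b<N : 2 + b < N
    joint+b<N = NP.<-trans joint+b<h₁ h₁<N
    vertex2≡0 : at lowered 2 ≡ 0
    vertex2≡0 = NP.n≤0⇒n≡0 (at-decAtAll-≤ (forcedEnds 0 b) 2 m 2 2 (count-here refl (count-here refl z≤n))
        (rim≤2 2 NP.≤-refl (s≤s (s≤s (s≤s z≤n)))))

  ordinary-ordinary-vanishes : ∀ a b N (m : Vec ℕ N) → h₂ a b < N →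
    at m 0 ≡ 0 → at m 1 ≡ 0 → at m (vk′ a b) ≡ 0 →
    (∀ u → 2 ≤ u → u < vk′ a b → at m u ≤ 2) → (∀ u → h₁ a b ≤ u → at m u ≤ 4) →
    oddᵇ (suc a) ≡ true → oddᵇ (suc b) ≡ true → prodCoeffℕ N (edges-oo a b) m ≡ 0ℤ
  ordinary-ordinary-vanishes a b N m h₂<N z₀ z₁ z-vk rim≤2 hub≤4 odd₁ odd₂ =
    prodCoeffℕ-↭-vanishes N m (edges-oo-↭ a b)
     (forced-vanishes N (principal a b) (forced a b) (forcedEnds a b) (fan₁ a b ++ fan₂ a b) m (forcing a b)
       (Layout.AtMonomial.forcedEdges-in a b N m h₂<N z₀ z₁ z-vk rim≤2 hub≤4)
           (Layout.AtMonomial.principal-zero a b N m h₂<N z₀ z₁ z-vk rim≤2 hub≤4)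
       (after-forcing-oo a b N m h₂<N rim≤2 hub≤4 odd₁ odd₂))

module OrdinaryBroken where

  module Layout (a b : ℕ) where
    h₁ joint vk vk′ : ℕ
    h₁ = hub₁ a b
    joint = suc (suc a)
    vk = joint + suc b
    vk′ = suc (suc (suc (a + b)))
    vk≡vk′ : vk ≡ vk′
    vk≡vk′ = cong (λ x → suc (suc x)) (NP.+-suc a b)
    fan₁ spokes₀ rimRev forced : List (ℕ × ℕ)
    fan₁ = pathEdges 2 a ++ spokes h₁ 2 (suc a)
    spokes₀ = spokes 0 (suc joint) b
    rimRev = pathEdgesRev joint (suc b)
    forced = (1 , 2) ∷ (joint , 0) ∷ (h₁ , 0) ∷ (h₁ , 1) ∷ spokes₀

    edges-ob-↭ : edges-ob a b ↭ forced ++ (rimRev ++ fan₁)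
    edges-ob-↭ = ↭-trans (PP.++⁺ p1 p2)
      (Perm.prep _ (Perm.prep _ (Perm.prep _ (Perm.prep _
        (↭-trans (PP.shifts fan₁ spokes₀ {rimRev}) (PP.++⁺ˡ spokes₀ (PP.++-comm fan₁ rimRev)))))))
      where
      p1 : (1 , 2) ∷ pathEdges 2 a ++ hubSide₁ a h₁ ↭ (1 , 2) ∷ (joint , 0) ∷ (h₁ , 0) ∷ (h₁ , 1) ∷ fan₁
      p1 = Perm.prep (1 , 2) (PP.shifts (pathEdges 2 a) ((joint , 0) ∷ (h₁ , 0) ∷ (h₁ , 1) ∷ []) {spokes h₁ 2 (suc a)})
      p2 : pathEdges joint (suc b) ++ spokes₀ ↭ spokes₀ ++ rimRev
      p2 = ↭-trans (PP.++-comm (pathEdges joint (suc b)) spokes₀) (PP.++⁺ˡ spokes₀ (pathEdges-↭-rev joint (suc b)))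

    principal : List ℕ
    principal = 0 ∷ 1 ∷ vk ∷ []

    forcedEnds : List ℕ
    forcedEnds = 2 ∷ joint ∷ h₁ ∷ h₁ ∷ range (suc joint) b

    ∉principal : ∀ r → r ≢ 0 → r ≢ 1 → r ≢ vk′ → elemᵇ r principal ≡ false
    ∉principal r n0 n1 nK = elemᵇ-false r principal (n0 ∷ n1 ∷ (λ e → nK (trans e vk≡vk′)) ∷ [])

    forcing : Forcing principal forced forcedEnds
    forcing = fwd refl (∉principal 2 (λ ()) (λ ()) (λ e → NP.<-irrefl e (s≤s (s≤s (s≤s z≤n)))))
       (bwd refl (∉principal joint (λ ()) (λ ()) (λ e → NP.m≢1+m+n a (cong (λ x → pred (pred x)) e)))
       (bwd refl (∉principal h₁ (λ ()) (λ ()) (λ e → n≢sn vk′ (sym e)))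
       (bwd refl (∉principal h₁ (λ ()) (λ ()) (λ e → n≢sn vk′ (sym e)))
       (Forcing-spokes principal 0 (suc joint) b refl (λ j l u → ∉principal j
           (λ e → NP.<-irrefl (sym e) (NP.<-≤-trans (s≤s z≤n) l))
                                                  (λ e → NP.<-irrefl (sym e) (NP.<-≤-trans (s≤s (s≤s z≤n)) l))
                                                  (λ e → NP.<-irrefl e u))))))

    module AtMonomial (N : ℕ) (m : Vec ℕ N) (h₁<N : h₁ < N)
             (z₀ : at m 0 ≡ 0) (z₁ : at m 1 ≡ 0) (z-vk : at m vk′ ≡ 0) where

      principal-zero : ∀ s → elemᵇ s principal ≡ true → at m s ≡ 0
      principal-zero s h with elemᵇ-∷⁻ s 0 (1 ∷ vk ∷ []) h
      ... | inj₁ refl = z₀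
      ... | inj₂ h′ with elemᵇ-∷⁻ s 1 (vk ∷ []) h′
      ...   | inj₁ refl = z₁
      ...   | inj₂ h″ with elemᵇ-∷⁻ s vk [] h″
      ...     | inj₁ refl = trans (cong (at m) vk≡vk′) z-vk
      ...     | inj₂ ()

      lt : ∀ x → x ≤ h₁ → x < N
      lt x h = NP.≤-<-trans h h₁<N
      joint≤h₁ : joint ≤ h₁
      joint≤h₁ = s≤s (s≤s (NP.≤-trans (NP.m≤m+n a b) (NP.≤-trans (NP.n≤1+n _) (NP.n≤1+n _))))

      forcedEdges-in : EdgesIn N forced
      forcedEdges-in = (lt 1 (s≤s z≤n) , lt 2 (s≤s (s≤s z≤n))) ∷ (lt joint joint≤h₁ , lt 0 z≤n) ∷ (h₁<N , lt 0 z≤n) ∷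
          (h₁<N , lt 1 (s≤s z≤n))
        ∷ spokes-in N 0 (suc joint) b (lt 0 z≤n) (NP.<⇒≤ (NP.<-trans (NP.n<1+n vk′) h₁<N))

  open Layout using (h₁; joint; vk; vk′; vk≡vk′; fan₁; rimRev; forced; edges-ob-↭; principal; forcedEnds; forcing)

  module _ (a b N : ℕ) (m : Vec ℕ N) (h₁<N : h₁ a b < N) (z-vk : at m (vk′ a b) ≡ 0)
           (rim≤2 : ∀ u → 2 ≤ u → u < vk′ a b → at m u ≤ 2) (hub≤4 : ∀ u → h₁ a b ≤ u → at m u ≤ 4)
           (forcedEnds≤ : ∀ u → count u (forcedEnds a b) ≤ at m u) where
    private
      lowered = decAtAll (forcedEnds a b) m
      chainInterior = dropLast (joint a b + b) (rangeDesc (joint a b) b)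
      chainEnd = lastOf (joint a b + b) (rangeDesc (joint a b) b)

    chainEnd≡joint : chainEnd ≡ joint a b
    chainEnd≡joint = lastOf-rangeDesc (joint a b) b

    ∉chainInterior : ∀ u → (u < suc (joint a b) ⊎ joint a b + b < u) → elemᵇ u chainInterior ≡ false
    ∉chainInterior u o = subst (λ L → elemᵇ u L ≡ false) (sym (dropLast-rangeDesc (joint a b) b))
      (elemᵇ-false u _ (rangeDesc-All (suc (joint a b)) b (λ j l r e → aux j l r e o)))
      where
      aux : ∀ j → suc (joint a b) ≤ j → j < suc (joint a b) + b → u ≡ j → (u < suc (joint a b) ⊎ joint a b + b < u) → ⊥
      aux j l r refl (inj₁ x) = NP.<-irrefl refl (NP.<-≤-trans x l)
      aux j l r refl (inj₂ x) = NP.<-irrefl refl (NP.<-≤-trans x (NP.≤-pred r))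

    chain-then-fan : (∀ m′ → AgreeOff chainInterior chainEnd lowered m′ → at m′ chainEnd < at lowered chainEnd → prodCoeffℕ N
        (fan₁ a b) m′ ≡ 0ℤ) →
      prodCoeffℕ N (rimRev a b ++ fan₁ a b) lowered ≡ 0ℤ
    chain-then-fan fan-vanishes′ = chain-vanishes N (vk a b) (joint a b + b) (rangeDesc (joint a b) b) (rimRev a b)
        (fan₁ a b) chainInterior lowered lowered
       (chain-pathEdgesRev (joint a b) (suc b)) rimRev-in (Distinct-rangeDesc (joint a b) (suc (suc b)))
           (elemᵇ-self chainInterior) z-vk′ interior≤1
       (λ _ _ _ → refl) refl fan-vanishes′
      where
      rimRev-in : EdgesIn N (rimRev a b)
      rimRev-in = PP.All-resp-↭ (pathEdges-↭-rev (joint a b) (suc b)) (pathEdges-in N (joint a b) (suc b)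
               (subst (_< N) (sym (vk≡vk′ a b)) (NP.<-trans (NP.n<1+n _) h₁<N)))
      z-vk′ : at lowered (vk a b) ≡ 0
      z-vk′ = NP.n≤0⇒n≡0 (NP.≤-trans (at-decAtAll-≤-at (forcedEnds a b) (vk a b) m)
          (NP.≤-reflexive (trans (cong (at m) (vk≡vk′ a b)) z-vk)))
      interior≤1 : All (λ v → at lowered v ≤ 1) chainInterior
      interior≤1 = subst (All (λ v → at lowered v ≤ 1)) (sym (dropLast-rangeDesc (joint a b) b))
        (rangeDesc-All (suc (joint a b)) b (λ j l u → at-decAtAll-≤ (forcedEnds a b) j m 1 2
            (count-there (count-there (count-there (count-there (count-range j (suc (joint a b)) b l u)))))
            (rim≤2 j (NP.≤-trans (s≤s (s≤s z≤n)) l) u)))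

  after-forcing-ob : ∀ a b N (m : Vec ℕ N) → h₁ a b < N → at m (vk′ a b) ≡ 0 →
    (rim≤2 : ∀ u → 2 ≤ u → u < vk′ a b → at m u ≤ 2) → (hub≤4 : ∀ u → h₁ a b ≤ u → at m u ≤ 4) →
    oddᵇ (suc a) ≡ true → (∀ u → count u (forcedEnds a b) ≤ at m u) → prodCoeffℕ N (rimRev a b ++ fan₁ a b)
        (decAtAll (forcedEnds a b) m) ≡ 0ℤ
  after-forcing-ob (suc zero) b N m _ _ _ _ () _
  after-forcing-ob zero b N m h₁<N z-vk rim≤2 hub≤4 odd₁ forcedEnds≤ =
    chain-then-fan 0 b N m h₁<N z-vk rim≤2 hub≤4 forcedEnds≤ (λ m′ ag lt → ⊥-elim
        (absurd {m′ = m′} (subst (λ x → at m′ x < at lowered x) (chainEnd≡joint 0 b N m h₁<N z-vk rim≤2 hub≤4 forcedEnds≤) lt)))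
    where
    lowered = decAtAll (forcedEnds 0 b) m
    vertex2≡0 : at lowered 2 ≡ 0
    vertex2≡0 = NP.n≤0⇒n≡0 (at-decAtAll-≤ (forcedEnds 0 b) 2 m 2 2 (count-here refl (count-here refl z≤n))
        (rim≤2 2 NP.≤-refl (s≤s (s≤s (s≤s z≤n)))))
    absurd : ∀ {m′ : Vec ℕ N} → at m′ 2 < at lowered 2 → ⊥
    absurd {m′} lt = NP.<-irrefl refl (NP.<-≤-trans lt (subst (_≤ at m′ 2) (sym vertex2≡0) z≤n))
  after-forcing-ob (suc (suc a′)) b N m h₁<N z-vk rim≤2 hub≤4 odd₁ forcedEnds≤ =
    chain-then-fan a b N m h₁<N z-vk rim≤2 hub≤4 forcedEnds≤ fan-vanishes′
    where
    a = suc (suc a′)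
    lowered = decAtAll (forcedEnds a b) m
    h₁′ = h₁ a b
    joint′ = joint a b
    joint<h₁ : joint′ < h₁′
    joint<h₁ = s≤s (s≤s (s≤s (NP.≤-trans (NP.m≤m+n a b) (NP.n≤1+n _))))
    joint<vk : joint′ < vk′ a b
    joint<vk = s≤s (s≤s (s≤s (NP.m≤m+n a b)))
    joint+b<h₁ : joint′ + b < h₁′
    joint+b<h₁ = NP.<-trans (NP.n<1+n _) (NP.n<1+n _)
    fan-vanishes′ : ∀ m′ → AgreeOff (dropLast (joint′ + b) (rangeDesc joint′ b))
        (lastOf (joint′ + b) (rangeDesc joint′ b)) lowered m′ →
          at m′ (lastOf (joint′ + b) (rangeDesc joint′ b)) < at lowered (lastOf (joint′ + b) (rangeDesc joint′ b)) → prodCoeffℕ N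
              (fan₁ a b) m′ ≡ 0ℤ
    fan-vanishes′ m′ ag lt = subst (λ L → prodCoeffℕ N L m′ ≡ 0ℤ) (++-identityʳ (fan₁ a b))
      (ascendingFan-vanishes N h₁′ 2 a′ [] 0 m′ h₁<N (NP.<-trans joint<h₁ h₁<N) joint<h₁ [] [] (λ _ _ _ → []) odd₁
        (≡-≤ (agrees h₁′ (inj₂ joint+b<h₁) (λ e → NP.<-irrefl (sym e) joint<h₁))
            (at-decAtAll-≤ (forcedEnds a b) h₁′ m 2 4 (count-there (count-there (count-here refl (count-here refl z≤n))))
                (hub≤4 h₁′ NP.≤-refl)))
        (≡-≤ (agrees 2 (inj₁ (s≤s (s≤s (s≤s z≤n)))) (λ e → NP.<-irrefl e (s≤s (s≤s (s≤s z≤n)))))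
            (at-decAtAll-≤ (forcedEnds a b) 2 m 1 2 (count-here refl z≤n) (rim≤2 2 NP.≤-refl (s≤s (s≤s (s≤s z≤n))))))
        (λ j l u → ≡-≤ (agrees j (inj₁ (NP.<-trans u (NP.n<1+n _))) (λ e → NP.<-irrefl e u))
            (NP.≤-trans (at-decAtAll-≤-at (forcedEnds a b) j m) (rim≤2 j (NP.<⇒≤ l) (NP.<-trans u joint<vk))))
        (λ _ _ ()) joint≤0)
      where
      chainEnd≡joint′ = chainEnd≡joint a b N m h₁<N z-vk rim≤2 hub≤4 forcedEnds≤
      ≡-≤ : ∀ {x y w : ℕ} → x ≡ y → y ≤ w → x ≤ w
      ≡-≤ refl h = h
      agrees : ∀ u → (u < suc joint′ ⊎ joint′ + b < u) → u ≢ joint′ → at m′ u ≡ at lowered u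
      agrees u o n = ag u (∉chainInterior a b N m h₁<N z-vk rim≤2 hub≤4 forcedEnds≤ u o) (λ e → n (trans e chainEnd≡joint′))
      joint≤0 : at m′ (2 + a) ≤ 0
      joint≤0 = subst (λ x → at m′ x ≤ 0) chainEnd≡joint′ (NP.≤-reflexive (NP.n<1⇒n≡0 (NP.<-≤-trans lt
               (subst (_≤ 1) (cong (at lowered) (sym chainEnd≡joint′))
                   (at-decAtAll-≤ (forcedEnds a b) joint′ m 1 2 (count-there (count-here refl z≤n))
                       (rim≤2 joint′ (s≤s (s≤s z≤n)) joint<vk))))))

  ordinary-broken-vanishes : ∀ a b N (m : Vec ℕ N) → h₁ a b < N →
    at m 0 ≡ 0 → at m 1 ≡ 0 → at m (vk′ a b) ≡ 0 →
    (∀ u → 2 ≤ u → u < vk′ a b → at m u ≤ 2) → (∀ u → h₁ a b ≤ u → at m u ≤ 4) →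
    oddᵇ (suc a) ≡ true → prodCoeffℕ N (edges-ob a b) m ≡ 0ℤ
  ordinary-broken-vanishes a b N m h₁<N z₀ z₁ z-vk rim≤2 hub≤4 odd₁ =
    prodCoeffℕ-↭-vanishes N m (edges-ob-↭ a b)
     (forced-vanishes N (principal a b) (forced a b) (forcedEnds a b) (rimRev a b ++ fan₁ a b) m (forcing a b)
       (Layout.AtMonomial.forcedEdges-in a b N m h₁<N z₀ z₁ z-vk) (Layout.AtMonomial.principal-zero a b N m h₁<N z₀ z₁ z-vk)
       (after-forcing-ob a b N m h₁<N z-vk rim≤2 hub≤4 odd₁))

module BrokenOrdinary where

  module Layout (a b : ℕ) where
    h₁ joint vk vk′ : ℕ
    h₁ = hub₁ a b
    joint = suc (suc a)
    vk = joint + suc b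
    vk′ = suc (suc (suc (a + b)))
    vk≡vk′ : vk ≡ vk′
    vk≡vk′ = cong (λ x → suc (suc x)) (NP.+-suc a b)
    rimEnd spokeEnd : ℕ × ℕ
    rimEnd = (joint + b , vk)
    spokeEnd = (h₁ , vk)
    spokes₁ rim₁ fan₂ forced : List (ℕ × ℕ)
    spokes₁ = spokes 0 2 (suc a)
    rim₁ = pathEdges 1 (suc a)
    fan₂ = pathEdges joint b ++ spokes h₁ joint (suc b)
    forced = spokes₁ ++ (rimEnd ∷ (h₁ , 0) ∷ spokeEnd ∷ [])

    edges-bo-↭ : edges-bo a b ↭ forced ++ (rim₁ ++ fan₂)
    edges-bo-↭ = ↭-trans (PP.++⁺ˡ (rim₁ ++ spokes₁) p2)
      (↭-trans (↭-reflexive (++-assoc rim₁ spokes₁ Y))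
      (↭-trans (PP.shifts rim₁ spokes₁ {Y})
      (↭-trans (PP.++⁺ˡ spokes₁ (PP.shifts rim₁ (rimEnd ∷ (h₁ , 0) ∷ spokeEnd ∷ []) {fan₂}))
       (↭-reflexive (sym (++-assoc spokes₁ (rimEnd ∷ (h₁ , 0) ∷ spokeEnd ∷ []) (rim₁ ++ fan₂)))))))
      where
      Y : List (ℕ × ℕ)
      Y = rimEnd ∷ (h₁ , 0) ∷ spokeEnd ∷ fan₂
      S : List (ℕ × ℕ)
      S = spokes h₁ joint (suc b)
      p2 : pathEdges joint (suc b) ++ (h₁ , 0) ∷ spokes h₁ joint (suc (suc b)) ↭ rimEnd ∷ (h₁ , 0) ∷ spokeEnd ∷ fan₂
      p2 = ↭-trans (↭-reflexive (cong₂ (λ x y → x ++ (h₁ , 0) ∷ y) (pathEdges-snoc joint b) (spokes-snoc h₁ joint (suc b))))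
           (↭-trans (↭-reflexive (++-assoc (pathEdges joint b) [ rimEnd ] ((h₁ , 0) ∷ (S ++ [ spokeEnd ]))))
           (↭-trans (PP.shift rimEnd (pathEdges joint b) ((h₁ , 0) ∷ (S ++ [ spokeEnd ])))
           (Perm.prep rimEnd (↭-trans (PP.shift (h₁ , 0) (pathEdges joint b) (S ++ [ spokeEnd ]))
              (Perm.prep (h₁ , 0) (↭-trans (↭-reflexive (sym (++-assoc (pathEdges joint b) S [ spokeEnd ])))
                 (PP.++-comm (pathEdges joint b ++ S) [ spokeEnd ])))))))

    principal : List ℕ
    principal = 0 ∷ 1 ∷ vk ∷ []

    forcedEnds : List ℕ
    forcedEnds = range 2 (suc a) ++ (joint + b) ∷ h₁ ∷ h₁ ∷ []

    ∉principal : ∀ r → r ≢ 0 → r ≢ 1 → r ≢ vk′ → elemᵇ r principal ≡ false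
    ∉principal r n0 n1 nK = elemᵇ-false r principal (n0 ∷ n1 ∷ (λ e → nK (trans e vk≡vk′)) ∷ [])

    vk∈principal : elemᵇ vk principal ≡ true
    vk∈principal = elemᵇ-there vk 0 (1 ∷ vk ∷ []) (elemᵇ-there vk 1 (vk ∷ []) (elemᵇ-here vk []))

    forcing : Forcing principal forced forcedEnds
    forcing = Forcing-++ (Forcing-spokes principal 0 2 (suc a) refl (λ j l u → ∉principal j
        (λ e → NP.<-irrefl (sym e) (NP.<-≤-trans (s≤s z≤n) l))
                                                       (λ e → NP.<-irrefl (sym e) l)
                                                       (λ e → NP.<-irrefl e (NP.<-≤-trans u (s≤s (s≤s (s≤s (NP.m≤m+n a b))))))))
       (bwd vk∈principal (∉principal (joint + b) (λ ()) (λ ()) (λ e → n≢sn (suc (suc (a + b))) e))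
       (bwd refl (∉principal h₁ (λ ()) (λ ()) (λ e → n≢sn vk′ (sym e)))
       (bwd vk∈principal (∉principal h₁ (λ ()) (λ ()) (λ e → n≢sn vk′ (sym e)))
       fnil)))

    module AtMonomial (N : ℕ) (m : Vec ℕ N) (h₁<N : h₁ < N)
             (z₀ : at m 0 ≡ 0) (z₁ : at m 1 ≡ 0) (z-vk : at m vk′ ≡ 0) where

      principal-zero : ∀ s → elemᵇ s principal ≡ true → at m s ≡ 0
      principal-zero s h with elemᵇ-∷⁻ s 0 (1 ∷ vk ∷ []) h
      ... | inj₁ refl = z₀
      ... | inj₂ h′ with elemᵇ-∷⁻ s 1 (vk ∷ []) h′
      ...   | inj₁ refl = z₁
      ...   | inj₂ h″ with elemᵇ-∷⁻ s vk [] h″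
      ...     | inj₁ refl = trans (cong (at m) vk≡vk′) z-vk
      ...     | inj₂ ()

      lt : ∀ x → x ≤ h₁ → x < N
      lt x h = NP.≤-<-trans h h₁<N

      forcedEdges-in : EdgesIn N forced
      forcedEdges-in = ++⁺ (spokes-in N 0 2 (suc a) (lt 0 z≤n) (NP.<⇒≤
          (lt (suc joint) (s≤s (s≤s (s≤s (NP.≤-trans (NP.m≤m+n a b) (NP.n≤1+n _))))))))
        ((lt (joint + b) (NP.≤-trans (NP.n≤1+n _) (NP.n≤1+n _)) , lt vk (subst (_≤ h₁) (sym vk≡vk′) (NP.n≤1+n vk′)))
         ∷ (h₁<N , lt 0 z≤n) ∷ (h₁<N , lt vk (subst (_≤ h₁) (sym vk≡vk′) (NP.n≤1+n vk′))) ∷ [])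

  open Layout using (h₁; joint; vk′; rim₁; fan₂; forced; edges-bo-↭; principal; forcedEnds; forcing)

  module _ (a b N : ℕ) (m : Vec ℕ N) (h₁<N : h₁ a b < N) (z₁ : at m 1 ≡ 0)
           (rim≤2 : ∀ u → 2 ≤ u → u < vk′ a b → at m u ≤ 2) (hub≤4 : ∀ u → h₁ a b ≤ u → at m u ≤ 4)
           (forcedEnds≤ : ∀ u → count u (forcedEnds a b) ≤ at m u) where
    private
      lowered = decAtAll (forcedEnds a b) m
      chainInterior = dropLast 2 (range 3 a)
      chainEnd = lastOf 2 (range 3 a)

    chainEnd≡joint : chainEnd ≡ joint a b
    chainEnd≡joint = lastOf-range 2 a

    ∉chainInterior : ∀ u → joint a b ≤ u → elemᵇ u chainInterior ≡ false
    ∉chainInterior u l = subst (λ L → elemᵇ u L ≡ false) (sym (dropLast-range 2 a))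
      (elemᵇ-false u _ (range-All 2 a (λ j _ r e → NP.<-irrefl refl (NP.<-≤-trans r (subst (joint a b ≤_) e l)))))

    chain-then-fan : (∀ m′ → AgreeOff chainInterior chainEnd lowered m′ → at m′ chainEnd < at lowered chainEnd → prodCoeffℕ N
        (fan₂ a b) m′ ≡ 0ℤ) →
      prodCoeffℕ N (rim₁ a b ++ fan₂ a b) lowered ≡ 0ℤ
    chain-then-fan fan-vanishes′ = chain-vanishes N 1 2 (range 3 a) (rim₁ a b) (fan₂ a b) chainInterior lowered lowered
       (chain-pathEdges 1 (suc a)) rim₁-in (Distinct-range 1 (suc (suc a))) (elemᵇ-self chainInterior) z₁′ interior≤1
       (λ _ _ _ → refl) refl fan-vanishes′
      where
      rim₁-in : EdgesIn N (rim₁ a b)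
      rim₁-in = pathEdges-in N 1 (suc a) (NP.<-trans (s≤s (s≤s (s≤s (NP.≤-trans (NP.m≤m+n a b) (NP.n≤1+n _))))) h₁<N)
      z₁′ : at lowered 1 ≡ 0
      z₁′ = NP.n≤0⇒n≡0 (NP.≤-trans (at-decAtAll-≤-at (forcedEnds a b) 1 m) (NP.≤-reflexive z₁))
      interior≤1 : All (λ v → at lowered v ≤ 1) chainInterior
      interior≤1 = subst (All (λ v → at lowered v ≤ 1)) (sym (dropLast-range 2 a))
        (range-All 2 a (λ j l u → at-decAtAll-≤ (forcedEnds a b) j m 1 2
            (NP.≤-trans (count-range j 2 (suc a) l (NP.<-trans u (NP.n<1+n _))) (count-++ˡ j (range 2 (suc a)) _))
            (rim≤2 j l (NP.<-trans u (s≤s (s≤s (s≤s (NP.m≤m+n a b))))))))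

  after-forcing-bo : ∀ a b N (m : Vec ℕ N) → h₁ a b < N → at m 1 ≡ 0 →
    (rim≤2 : ∀ u → 2 ≤ u → u < vk′ a b → at m u ≤ 2) → (hub≤4 : ∀ u → h₁ a b ≤ u → at m u ≤ 4) →
    oddᵇ (suc b) ≡ true → (∀ u → count u (forcedEnds a b) ≤ at m u) → prodCoeffℕ N (rim₁ a b ++ fan₂ a b)
        (decAtAll (forcedEnds a b) m) ≡ 0ℤ
  after-forcing-bo a (suc zero) N m _ _ _ _ () _
  after-forcing-bo a zero N m h₁<N z₁ rim≤2 hub≤4 odd₂ forcedEnds≤ =
    chain-then-fan a 0 N m h₁<N z₁ rim≤2 hub≤4 forcedEnds≤ (λ m′ ag lt → ⊥-elim
        (absurd {m′ = m′} (subst (λ x → at m′ x < at lowered x) (chainEnd≡joint a 0 N m h₁<N z₁ rim≤2 hub≤4 forcedEnds≤) lt)))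
    where
    lowered = decAtAll (forcedEnds a 0) m
    joint′ = joint a 0
    joint≡0 : at lowered joint′ ≡ 0
    joint≡0 = NP.n≤0⇒n≡0 (at-decAtAll-≤ (forcedEnds a 0) joint′ m 2 2
           (subst (2 ≤_) (sym (count-++ joint′ (range 2 (suc a)) _)) (NP.+-mono-≤
               (count-range joint′ 2 (suc a) (s≤s (s≤s z≤n)) (NP.n<1+n _))
              (count-here (NP.+-identityʳ joint′) z≤n)))
           (rim≤2 joint′ (s≤s (s≤s z≤n)) (s≤s (s≤s (s≤s (NP.m≤m+n a 0))))))
    absurd : ∀ {m′ : Vec ℕ N} → at m′ joint′ < at lowered joint′ → ⊥
    absurd {m′} lt = NP.<-irrefl refl (NP.<-≤-trans lt (subst (_≤ at m′ joint′) (sym joint≡0) z≤n))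
  after-forcing-bo a (suc (suc b′)) N m h₁<N z₁ rim≤2 hub≤4 odd₂ forcedEnds≤ =
    chain-then-fan a b N m h₁<N z₁ rim≤2 hub≤4 forcedEnds≤ fan-vanishes′
    where
    b = suc (suc b′)
    lowered = decAtAll (forcedEnds a b) m
    h₁′ = h₁ a b
    joint′ = joint a b
    joint+b<h₁ : joint′ + b < h₁′
    joint+b<h₁ = NP.<-trans (NP.n<1+n _) (NP.n<1+n _)
    joint+b<vk : joint′ + b < vk′ a b
    joint+b<vk = NP.n<1+n _
    joint<vk : joint′ < vk′ a b
    joint<vk = s≤s (s≤s (s≤s (NP.m≤m+n a b)))
    count-tail-segment : ∀ u k → k ≤ count u ((joint′ + b) ∷ h₁′ ∷ h₁′ ∷ []) → k ≤ count u (forcedEnds a b)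
    count-tail-segment u k h = NP.≤-trans h (count-++ʳ u (range 2 (suc a)) _)
    fan-vanishes′ : ∀ m′ → AgreeOff (dropLast 2 (range 3 a)) (lastOf 2 (range 3 a)) lowered m′ →
          at m′ (lastOf 2 (range 3 a)) < at lowered (lastOf 2 (range 3 a)) → prodCoeffℕ N (fan₂ a b) m′ ≡ 0ℤ
    fan-vanishes′ m′ ag lt = descendingFan-vanishes N h₁′ joint′ b′ m′ h₁<N (NP.<-trans joint+b<h₁ h₁<N) joint+b<h₁ odd₂
        (≡-≤ (agrees h₁′ (NP.<⇒≤ (NP.<-trans (NP.m<m+n joint′ (s≤s z≤n)) joint+b<h₁))
            (λ e → NP.<-irrefl (sym e) (NP.<-trans (NP.m<m+n joint′ (s≤s z≤n)) joint+b<h₁)))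
            (at-decAtAll-≤ (forcedEnds a b) h₁′ m 2 4 (count-tail-segment h₁′ 2
                (count-there (count-here refl (count-here refl z≤n)))) (hub≤4 h₁′ NP.≤-refl)))
        (≡-≤ (agrees (joint′ + b) (NP.m≤m+n joint′ b) (λ e → NP.<-irrefl (sym e) (NP.m<m+n joint′ (s≤s z≤n))))
            (at-decAtAll-≤ (forcedEnds a b) (joint′ + b) m 1 2 (count-tail-segment (joint′ + b) 1 (count-here refl z≤n))
                (rim≤2 (joint′ + b) (s≤s (s≤s z≤n)) joint+b<vk)))
        (λ j l u → ≡-≤ (agrees j (NP.<⇒≤ l) (λ e → NP.<-irrefl (sym e) l))
            (NP.≤-trans (at-decAtAll-≤-at (forcedEnds a b) j m) (rim≤2 j (NP.≤-trans (s≤s (s≤s z≤n)) (NP.<⇒≤ l))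
                (NP.<-trans u joint+b<vk))))
        joint≡0
      where
      chainEnd≡joint′ = chainEnd≡joint a b N m h₁<N z₁ rim≤2 hub≤4 forcedEnds≤
      ≡-≤ : ∀ {x y w : ℕ} → x ≡ y → y ≤ w → x ≤ w
      ≡-≤ refl h = h
      agrees : ∀ u → joint′ ≤ u → u ≢ joint′ → at m′ u ≡ at lowered u
      agrees u l n = ag u (∉chainInterior a b N m h₁<N z₁ rim≤2 hub≤4 forcedEnds≤ u l) (λ e → n (trans e chainEnd≡joint′))
      joint≡0 : at m′ joint′ ≡ 0
      joint≡0 = NP.n<1⇒n≡0 (NP.<-≤-trans (subst (λ x → at m′ x < at lowered x) chainEnd≡joint′ lt)
              (at-decAtAll-≤ (forcedEnds a b) joint′ m 1 2 (NP.≤-trans (count-range joint′ 2 (suc a) (s≤s (s≤s z≤n)) (NP.n<1+n _))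
                  (count-++ˡ joint′ (range 2 (suc a)) _))
                 (rim≤2 joint′ (s≤s (s≤s z≤n)) joint<vk)))

  broken-ordinary-vanishes : ∀ a b N (m : Vec ℕ N) → h₁ a b < N →
    at m 0 ≡ 0 → at m 1 ≡ 0 → at m (vk′ a b) ≡ 0 →
    (∀ u → 2 ≤ u → u < vk′ a b → at m u ≤ 2) → (∀ u → h₁ a b ≤ u → at m u ≤ 4) →
    oddᵇ (suc b) ≡ true → prodCoeffℕ N (edges-bo a b) m ≡ 0ℤ
  broken-ordinary-vanishes a b N m h₁<N z₀ z₁ z-vk rim≤2 hub≤4 odd₂ =
    prodCoeffℕ-↭-vanishes N m (edges-bo-↭ a b)
     (forced-vanishes N (principal a b) (forced a b) (forcedEnds a b) (rim₁ a b ++ fan₂ a b) m (forcing a b)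
       (Layout.AtMonomial.forcedEdges-in a b N m h₁<N z₀ z₁ z-vk) (Layout.AtMonomial.principal-zero a b N m h₁<N z₀ z₁ z-vk)
       (after-forcing-bo a b N m h₁<N z₁ rim≤2 hub≤4 odd₂))

open OrdinaryOrdinary using (ordinary-ordinary-vanishes)
open OrdinaryBroken using (ordinary-broken-vanishes)
open BrokenOrdinary using (broken-ordinary-vanishes)

exponentBound-principal : ∀ K u e → u < 2 → ExponentBound K u e → e ≡ 0
exponentBound-principal K u e l h with u <? 2 | suc u N.≟ K | u <? K
... | yes _ | _ | _ = h
... | no ¬p | _ | _ = ⊥-elim (¬p l)

exponentBound-last : ∀ K u e → 2 ≤ u → suc u ≡ K → ExponentBound K u e → e ≡ 0
exponentBound-last K u e l q h with u <? 2 | suc u N.≟ K | u <? K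
... | yes p | _ | _ = ⊥-elim (NP.<-irrefl refl (NP.<-≤-trans p l))
... | no _ | yes _ | _ = h
... | no _ | no ¬q | _ = ⊥-elim (¬q q)

exponentBound-rim : ∀ K u e → 2 ≤ u → suc u < K → ExponentBound K u e → e ≤ 2
exponentBound-rim K u e l q h with u <? 2 | suc u N.≟ K | u <? K
... | yes p | _ | _ = ⊥-elim (NP.<-irrefl refl (NP.<-≤-trans p l))
... | no _ | yes e′ | _ = ⊥-elim (NP.<-irrefl e′ q)
... | no _ | no _ | yes _ = h
... | no _ | no _ | no ¬r = ⊥-elim (¬r (NP.<-trans (NP.n<1+n u) q))

exponentBound-hub : ∀ K u e → K ≤ u → ExponentBound K u e → e ≤ 4
exponentBound-hub K u e l h with u <? 2 | suc u N.≟ K | u <? K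
... | yes _ | _ | _ = NP.≤-trans (NP.≤-reflexive h) z≤n
... | no _ | yes _ | _ = NP.≤-trans (NP.≤-reflexive h) z≤n
... | no _ | no _ | yes r = ⊥-elim (NP.<-irrefl refl (NP.<-≤-trans r l))
... | no _ | no _ | no _ = h

at-lookup : ∀ {N} (m : Vec ℕ N) u (u< : u < N) → lookup m (fromℕ< u<) ≡ at m u
at-lookup (x ∷ m) zero (s≤s _) = refl
at-lookup (x ∷ m) (suc u) (s≤s u<) = at-lookup m u u<

at-out : ∀ {N} (m : Vec ℕ N) u → N ≤ u → at m u ≡ 0
at-out [] u _ = refl
at-out (x ∷ m) zero ()
at-out (x ∷ m) (suc u) (s≤s l) = at-out m u l

module MonomialBounds (t₁ t₂ : Kind) (a b : ℕ) (m : Monomial (dwSize t₁ (3 + a) t₂ (3 + b)))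
  (bounds : ∀ i → ExponentBound (outerLen (3 + a) (3 + b)) (toℕ i) (lookup m i)) where

  private
    K = outerLen (3 + a) (3 + b)

    bounded : ∀ {Q : ℕ → Set} u → (∀ e → ExponentBound K u e → Q e) → Q 0 → Q (at m u)
    bounded {Q} u f q₀ with u <? dwSize t₁ (3 + a) t₂ (3 + b)
    ... | yes u< = f _ (subst₂ (ExponentBound K) (FP.toℕ-fromℕ< u<) (at-lookup m u u<) (bounds (fromℕ< u<)))
    ... | no u≮ = subst Q (sym (at-out m u (NP.≮⇒≥ u≮))) q₀

  z₀ : at m 0 ≡ 0
  z₀ = bounded 0 (λ e → exponentBound-principal K 0 e (s≤s z≤n)) refl

  z₁ : at m 1 ≡ 0
  z₁ = bounded 1 (λ e → exponentBound-principal K 1 e (s≤s (s≤s z≤n))) refl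

  z-vk : at m (3 + (a + b)) ≡ 0
  z-vk = bounded (3 + (a + b)) (λ e → exponentBound-last K _ e (s≤s (s≤s z≤n)) (sym (outerLen≡ a b))) refl

  rim≤2 : ∀ u → 2 ≤ u → u < 3 + (a + b) → at m u ≤ 2
  rim≤2 u 2≤u u< = bounded u (λ e → exponentBound-rim K u e 2≤u (subst (suc u <_) (sym (outerLen≡ a b)) (s≤s u<))) z≤n

  hub≤4 : ∀ u → hub₁ a b ≤ u → at m u ≤ 4
  hub≤4 u hub≤u = bounded u (λ e → exponentBound-hub K u e (subst (_≤ u) (sym (outerLen≡ a b)) hub≤u)) z≤n

  label<N : ∀ u → u < hub₁ a b + nHubs t₁ + nHubs t₂ → u < dwSize t₁ (3 + a) t₂ (3 + b)
  label<N u = subst (u <_) (cong (λ k → k + nHubs t₁ + nHubs t₂) (sym (outerLen≡ a b)))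

doubleWheel-vanishes : ∀ t₁ a t₂ b (σ : ℕ → Bool) (m : Monomial (dwSize t₁ (3 + a) t₂ (3 + b))) L →
  dwMinusPathEdgesℕ t₁ (3 + a) t₂ (3 + b) ≡ L → prodCoeffℕ (dwSize t₁ (3 + a) t₂ (3 + b)) L m ≡ 0ℤ →
  Vanishes m (P (doubleWheelMinusPath t₁ (3 + a) t₂ (3 + b)) σ)
doubleWheel-vanishes t₁ a t₂ b σ m L refl = orientedProd-vanishes σ (E (doubleWheelMinusPath t₁ (3 + a) t₂ (3 + b))) m

theorem5p9 : (t₁ : Kind) (k₁ : ℕ) (t₂ : Kind) (k₂ : ℕ) →
    3 ≤ k₁ → 3 ≤ k₂ → AtLeastOneOrdinary t₁ t₂ →
    NotEvenWheel t₁ k₁ → NotEvenWheel t₂ k₂ →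
    (σ : ℕ → Bool) →
    (m : Monomial (dwSize t₁ k₁ t₂ k₂)) →
    (∀ (i : Fin (dwSize t₁ k₁ t₂ k₂)) →
       ExponentBound (outerLen k₁ k₂) (toℕ i) (lookup m i)) →
    Vanishes m (P (doubleWheelMinusPath t₁ k₁ t₂ k₂) σ)
theorem5p9 broken _ broken _ _ _ () _ _ _ _ _
theorem5p9 ordinary _ ordinary _ (s≤s (s≤s (s≤s {n = a} _))) (s≤s (s≤s (s≤s {n = b} _))) _ odd₁ odd₂ σ m bounds =
  doubleWheel-vanishes ordinary a ordinary b σ m _ (dwMinusPathEdges-oo a b)
    (ordinary-ordinary-vanishes a b _ m (label<N _ hub₂<) z₀ z₁ z-vk rim≤2 hub≤4 (oddᵇ-¬2∣ _ odd₁) (oddᵇ-¬2∣ _ odd₂))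
  where
  open MonomialBounds ordinary ordinary a b m bounds
  hub₂< : suc (hub₁ a b) < hub₁ a b + 1 + 1
  hub₂< = subst (_< hub₁ a b + 1 + 1) (NP.+-comm (hub₁ a b) 1) (NP.m<m+n (hub₁ a b + 1) (s≤s z≤n))
theorem5p9 ordinary _ broken _ (s≤s (s≤s (s≤s {n = a} _))) (s≤s (s≤s (s≤s {n = b} _))) _ odd₁ _ σ m bounds =
  doubleWheel-vanishes ordinary a broken b σ m _ (dwMinusPathEdges-ob a b)
    (ordinary-broken-vanishes a b _ m (label<N _ hub₁<) z₀ z₁ z-vk rim≤2 hub≤4 (oddᵇ-¬2∣ _ odd₁))
  where
  open MonomialBounds ordinary broken a b m bounds
  hub₁< : hub₁ a b < hub₁ a b + 1 + 0
  hub₁< = subst (hub₁ a b <_) (sym (NP.+-identityʳ (hub₁ a b + 1))) (NP.m<m+n (hub₁ a b) (s≤s z≤n))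
theorem5p9 broken _ ordinary _ (s≤s (s≤s (s≤s {n = a} _))) (s≤s (s≤s (s≤s {n = b} _))) _ _ odd₂ σ m bounds =
  doubleWheel-vanishes broken a ordinary b σ m _ (dwMinusPathEdges-bo a b)
    (broken-ordinary-vanishes a b _ m (label<N _ hub₁<) z₀ z₁ z-vk rim≤2 hub≤4 (oddᵇ-¬2∣ _ odd₂))
  where
  open MonomialBounds broken ordinary a b m bounds
  hub₁< : hub₁ a b < hub₁ a b + 0 + 1
  hub₁< = subst (λ k → hub₁ a b < k + 1) (sym (NP.+-identityʳ (hub₁ a b))) (NP.m<m+n (hub₁ a b) (s≤s z≤n))
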